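{- For every integer $n \geq 1$ and each $\sigma \in \{132, 213\}$, the number $t_n(\sigma)$ of shallow permutations of $[n]=\{1,\dots,n\}$ that avoid $\sigma$ equals $F_{2n-1}$, the $(2n-1)$-st Fibonacci number.
   Context: For $\pi=\pi_1\cdots\pi_n \in S_n$ (one-line notation): the total displacement is $D(\pi)=\sum_{i=1}^n|\pi_i-i|$; the inversion number is $I(\pi)=|\{(i,j): i<j,\ \pi_i>\pi_j\}|$; the reflection length is $T(\pi)=n-\mathrm{cyc}(\pi)$, where $\mathrm{cyc}(\pi)$ is the number of cycles in the disjoint cycle decomposition of $\pi$. A permutation $\pi$ is shallow if $I(\pi)+T(\pi)=D(\pi)$. A permutation $\pi\in S_n$ avoids $\sigma\in S_3$ if there are no indices $i<j<k$ such that $\pi_i\pi_j\pi_k$ is in the same relative order as $\sigma_1\sigma_2\sigma_3$. Fibonacci numbers: $F_1=F_2=1$, $F_{m}=F_{m-1}+F_{m-2}$. -}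

module Defs where

open import Data.Nat using (ℕ; zero; suc; _+_; _∸_; _<ᵇ_; _≡ᵇ_; ∣_-_∣)
open import Data.Bool using (Bool; true; false; _∧_; _∨_; not; if_then_else_)
open import Data.Fin using (Fin; toℕ)
open import Data.Vec using (Vec; []; _∷_; lookup)
open import Data.List using (List; []; _∷_; map; concatMap; length; filter; allFin; [_])
open import Data.Nat.ListAction using (sum)
open import Relation.Nullary.Decidable using (Dec; yes; no)
open import Relation.Binary.PropositionalEquality using (_≡_)
open import Data.Bool using (T)
open import Relation.Nullary.Decidable using () renaming (map′ to mapDec)
open import Data.Bool.Properties using (T?)

fib : ℕ → ℕ
fib zero = zero
fib (suc zero) = suc zero
fib (suc (suc m)) = fib (suc m) + fib m

-- A permutation of [n] in one-line notation, stored 0-based: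
-- the vector v with lookup v i = π_{i+1} - 1.
-- Enumeration of all words of length k over the alphabet Fin n.
words : (n k : ℕ) → List (Vec (Fin n) k)
words n zero = [ [] ]
words n (suc k) = concatMap (λ a → map (a ∷_) (words n k)) (allFin n)

allᵇ : {n : ℕ} → (Fin n → Bool) → Bool
allᵇ {n} p = Data.List.foldr (λ i b → p i ∧ b) true (allFin n)

anyᵇ : {n : ℕ} → (Fin n → Bool) → Bool
anyᵇ {n} p = Data.List.foldr (λ i b → p i ∨ b) false (allFin n)

countᵇ : {n : ℕ} → (Fin n → Bool) → ℕ
countᵇ {n} p = length (filter (λ i → T? (p i)) (allFin n))

_≡ᶠ_ : {n : ℕ} → Fin n → Fin n → Bool
i ≡ᶠ j = toℕ i ≡ᵇ toℕ j

_<ᶠ_ : {n : ℕ} → Fin n → Fin n → Bool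
i <ᶠ j = toℕ i <ᵇ toℕ j

isPerm : {n : ℕ} → Vec (Fin n) n → Bool
isPerm v = allᵇ (λ i → allᵇ (λ j → not (i <ᶠ j) ∨ not (lookup v i ≡ᶠ lookup v j)))

disp : {n : ℕ} → Vec (Fin n) n → ℕ
disp {n} v = sum (map (λ i → ∣ toℕ (lookup v i) - toℕ i ∣) (allFin n))

inv : {n : ℕ} → Vec (Fin n) n → ℕ
inv v = sum (Data.List.map (λ i → countᵇ (λ j → (i <ᶠ j) ∧ (lookup v j <ᶠ lookup v i))) (allFinL))
  where allFinL = allFin _

iter : {n : ℕ} → Vec (Fin n) n → ℕ → Fin n → Fin n
iter v zero i = i
iter v (suc k) i = lookup v (iter v k i)

-- number of cycles of π: each cycle is counted via its least element,
-- i.e. the i with π^k(i) ≥ i for all 0 ≤ k < n (every cycle has length ≤ n).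
cyc : {n : ℕ} → Vec (Fin n) n → ℕ
cyc {n} v = countᵇ (λ i → allᵇ {n} (λ k → not (iter v (toℕ k) i <ᶠ i)))

refl-len : {n : ℕ} → Vec (Fin n) n → ℕ
refl-len {n} v = n ∸ cyc v

shallow : {n : ℕ} → Vec (Fin n) n → Bool
shallow v = (inv v + refl-len v) ≡ᵇ disp v

sameOrder : ℕ → ℕ → ℕ → ℕ → ℕ → ℕ → Bool
sameOrder a b c s t u =
  ((a <ᵇ b) ≡ᵇᵇ (s <ᵇ t)) ∧ ((b <ᵇ a) ≡ᵇᵇ (t <ᵇ s)) ∧
  ((a <ᵇ c) ≡ᵇᵇ (s <ᵇ u)) ∧ ((c <ᵇ a) ≡ᵇᵇ (u <ᵇ s)) ∧
  ((b <ᵇ c) ≡ᵇᵇ (t <ᵇ u)) ∧ ((c <ᵇ b) ≡ᵇᵇ (u <ᵇ t))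
  where
    _≡ᵇᵇ_ : Bool → Bool → Bool
    true ≡ᵇᵇ y = y
    false ≡ᵇᵇ y = not y

contains : {n : ℕ} → Vec ℕ 3 → Vec (Fin n) n → Bool
contains (s ∷ t ∷ u ∷ []) v =
  anyᵇ (λ i → anyᵇ (λ j → anyᵇ (λ k →
    (i <ᶠ j) ∧ (j <ᶠ k) ∧
    sameOrder (toℕ (lookup v i)) (toℕ (lookup v j)) (toℕ (lookup v k)) s t u)))

avoids : {n : ℕ} → Vec ℕ 3 → Vec (Fin n) n → Bool
avoids σ v = not (contains σ v)

t : ℕ → Vec ℕ 3 → ℕ
t n σ = length (filter (λ v → T? (isPerm v ∧ shallow v ∧ avoids σ v)) (words n n))

{-# OPTIONS --safe #-}
module Submission where

open import Defs
open import Data.Bool using (Bool; true; false; _∧_; _∨_; not; T; if_then_else_)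
open import Data.Bool.Properties using (T?; ∧-zeroʳ; ∧-identityʳ; ∧-comm; T-∧; T-∨; T-not-≡)
open import Data.Empty using (⊥; ⊥-elim)
open import Data.Fin using (Fin; toℕ; fromℕ<)
open import Data.Fin.Properties using (toℕ<n; toℕ-injective; toℕ-fromℕ<)
open import Data.List using (List; []; _∷_; map; length; filter; allFin; tabulate; foldr; concatMap; cartesianProductWith; applyUpTo; _++_)
open import Data.List.Membership.Propositional using (_∈_)
open import Data.List.Membership.Propositional.Properties
  using (∈-map⁺; ∈-map⁻; ∈-concatMap⁺; ∈-allFin; ∈-filter⁺; ∈-filter⁻; ∈-∃++; ∈-++⁻; ∈-++⁺ˡ; ∈-++⁺ʳ)
open import Data.List.Properties using (map-tabulate; length-applyUpTo; length-++; ∷-injective)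
open import Data.List.Relation.Unary.All using (All; []; _∷_)
import Data.List.Relation.Unary.All as All
open import Data.List.Relation.Unary.AllPairs using ([]; _∷_)
open import Data.List.Relation.Unary.Any using (here; there)
import Data.List.Relation.Unary.Any as Any
open import Data.List.Relation.Unary.Unique.Propositional using (Unique)
open import Data.List.Relation.Unary.Unique.Propositional.Properties using (map⁺; cartesianProductWith⁺; allFin⁺; filter⁺)
open import Data.Nat
open import Data.Nat.DivMod using (_%_; _/_; m%n<n; m≡m%n+[m/n]*n)
open import Data.Nat.GeneralisedArithmetic using (fold; fold-+)
open import Data.Nat.ListAction using (sum)
open import Data.Nat.Properties
open import Algebra.Properties.CommutativeSemigroup +-commutativeSemigroup
  using (interchange; xy∙z≈zy∙x; xy∙z≈xz∙y; x∙yz≈yx∙z)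
open import Data.Nat.Tactic.RingSolver using (solve-∀)
open import Data.Product using (∃; _×_; _,_; proj₁; proj₂)
open import Data.Sum using (_⊎_; inj₁; inj₂)
open import Data.Unit using (tt)
open import Data.Vec using (Vec; []; _∷_; lookup)
import Data.Vec as Vec
open import Function using (_∘_)
open import Function.Bundles using (Equivalence)
open import Relation.Binary.Definitions using (Tri; tri<; tri≈; tri>)
open import Relation.Binary.PropositionalEquality
open import Relation.Nullary using (¬_; Dec; yes; no)

-- Write IT = I + T and regard a permutation of [n] as a function on ℕ.  Erasing the largest
-- value m from its cycle turns f ∈ S(m+1) into g ∈ S(m), and with j = f⁻¹(m), k = f(m),
--   D f + IT g = D g + IT f + 2e,
-- where e counts the entries after position j below k if k < j, and the entries before j
-- above k otherwise.  By induction IT ≤ D, and f is shallow iff g is shallow and e = 0.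
-- For shallow 132-avoiders this forces: if the maximum is not at an end, the last entry is 0,
-- and unless it is second to last, the first entry is the second largest.  Classifying by
-- the position of the maximum, the classes are matched by erasing or inserting the maximum,
-- by inversion, and by stripping the first and last entries; the counts obey
-- t(n+2) + t(n) = 3 t(n+1), the recurrence of F(2n−1).  Reverse-complement preserves D, I
-- and the number of cycles and exchanges 132 with 213.

∑< : ℕ → (ℕ → ℕ) → ℕ
∑< zero    h = 0
∑< (suc n) h = h 0 + ∑< n (λ x → h (suc x))

syntax ∑< n (λ x → e) = ∑[ x < n ] e

⟦_⟧ : Bool → ℕ
⟦ true ⟧  = 1
⟦ false ⟧ = 0

count : ℕ → (ℕ → Bool) → ℕ
count n p = ∑[ x < n ] ⟦ p x ⟧

all< : ℕ → (ℕ → Bool) → Bool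
all< zero    p = true
all< (suc n) p = p 0 ∧ all< n (λ x → p (suc x))

any< : ℕ → (ℕ → Bool) → Bool
any< zero    p = false
any< (suc n) p = p 0 ∨ any< n (λ x → p (suc x))

∑<-cong : ∀ n {h g : ℕ → ℕ} → (∀ x → x < n → h x ≡ g x) → ∑< n h ≡ ∑< n g
∑<-cong zero    e = refl
∑<-cong (suc n) e = cong₂ _+_ (e 0 z<s) (∑<-cong n (λ x x<n → e (suc x) (s<s x<n)))

∑<-suc : ∀ n h → ∑< (suc n) h ≡ ∑< n h + h n
∑<-suc zero    h = +-comm (h 0) 0
∑<-suc (suc n) h = trans (cong (h 0 +_) (∑<-suc n (λ x → h (suc x)))) (sym (+-assoc (h 0) _ _))

∑<-distrib-+ : ∀ n h g → ∑[ x < n ] (h x + g x) ≡ ∑< n h + ∑< n g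
∑<-distrib-+ zero    h g = refl
∑<-distrib-+ (suc n) h g =
  trans (cong ((h 0 + g 0) +_) (∑<-distrib-+ n _ _)) (interchange (h 0) (g 0) _ _)

∑<-zero : ∀ n {h} → (∀ x → x < n → h x ≡ 0) → ∑< n h ≡ 0
∑<-zero zero    e = refl
∑<-zero (suc n) e = cong₂ _+_ (e 0 z<s) (∑<-zero n (λ x x<n → e (suc x) (s<s x<n)))

∑<-comm : ∀ n m (h : ℕ → ℕ → ℕ) → ∑[ x < n ] ∑[ y < m ] h x y ≡ ∑[ y < m ] ∑[ x < n ] h x y
∑<-comm zero    m h = sym (∑<-zero m (λ _ _ → refl))
∑<-comm (suc n) m h = trans (cong (∑< m (h 0) +_) (∑<-comm n m (λ x → h (suc x))))
                            (sym (∑<-distrib-+ m (h 0) _))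

n∸x≡1+n∸1+x : ∀ n x → x < n → n ∸ x ≡ suc (n ∸ suc x)
n∸x≡1+n∸1+x (suc n) zero    _         = refl
n∸x≡1+n∸1+x (suc n) (suc x) (s<s x<n) = n∸x≡1+n∸1+x n x x<n

∑<-reverse : ∀ n h → ∑[ x < n ] h (n ∸ suc x) ≡ ∑< n h
∑<-reverse zero    h = refl
∑<-reverse (suc n) h = begin
  ∑[ x < suc n ] h (suc n ∸ suc x)           ≡⟨ ∑<-suc n _ ⟩
  ∑[ x < n ] h (n ∸ x) + h (n ∸ n)          ≡⟨ cong₂ _+_ (∑<-cong n (λ x x<n → cong h (n∸x≡1+n∸1+x n x x<n)))
                                                          (cong h (n∸n≡0 n)) ⟩
  ∑[ x < n ] h (suc (n ∸ suc x)) + h 0      ≡⟨ cong (_+ h 0) (∑<-reverse n (λ x → h (suc x))) ⟩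
  ∑[ x < n ] h (suc x) + h 0                ≡⟨ +-comm _ (h 0) ⟩
  ∑< (suc n) h                              ∎
  where open ≡-Reasoning

∑<-update : ∀ n h g j → j < n → (∀ x → x < n → x ≢ j → h x ≡ g x) →
            ∑< n h + g j ≡ ∑< n g + h j
∑<-update (suc n) h g zero j<n e = begin
  (h 0 + ∑[ x < n ] h (suc x)) + g 0   ≡⟨ xy∙z≈zy∙x (h 0) _ (g 0) ⟩
  (g 0 + ∑[ x < n ] h (suc x)) + h 0   ≡⟨ cong (λ s → (g 0 + s) + h 0)
                                             (∑<-cong n (λ x x<n → e (suc x) (s<s x<n) (λ ()))) ⟩
  (g 0 + ∑[ x < n ] g (suc x)) + h 0   ∎
  where open ≡-Reasoning
∑<-update (suc n) h g (suc j) (s<s j<n) e = begin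
  (h 0 + ∑[ x < n ] h (suc x)) + g (suc j)   ≡⟨ +-assoc (h 0) _ _ ⟩
  h 0 + (∑[ x < n ] h (suc x) + g (suc j))   ≡⟨ cong₂ _+_ (e 0 z<s (λ ())) (∑<-update n _ _ j j<n
                                                  (λ x x<n x≢j → e (suc x) (s<s x<n) (x≢j ∘ suc-injective))) ⟩
  g 0 + (∑[ x < n ] g (suc x) + h (suc j))   ≡⟨ sym (+-assoc (g 0) _ _) ⟩
  (g 0 + ∑[ x < n ] g (suc x)) + h (suc j)   ∎
  where open ≡-Reasoning

∑<-single : ∀ n h j → j < n → (∀ x → x < n → x ≢ j → h x ≡ 0) → ∑< n h ≡ h j
∑<-single n h j j<n e = begin
  ∑< n h                   ≡⟨ sym (+-identityʳ _) ⟩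
  ∑< n h + 0               ≡⟨ ∑<-update n h (λ _ → 0) j j<n e ⟩
  ∑[ x < n ] 0 + h j       ≡⟨ cong (_+ h j) (∑<-zero n (λ _ _ → refl)) ⟩
  h j                      ∎
  where open ≡-Reasoning

⟦⟧-true : ∀ {b} → T b → ⟦ b ⟧ ≡ 1
⟦⟧-true {true} _ = refl

⟦⟧-false : ∀ {b} → ¬ T b → ⟦ b ⟧ ≡ 0
⟦⟧-false {true}  ¬b = ⊥-elim (¬b tt)
⟦⟧-false {false} _  = refl

⟦⟧≤1 : ∀ b → ⟦ b ⟧ ≤ 1
⟦⟧≤1 true  = s≤s z≤n
⟦⟧≤1 false = z≤n

T⇔T⇒≡ : ∀ {a b} → (T a → T b) → (T b → T a) → a ≡ b
T⇔T⇒≡ {true}  {true}  _ _ = refl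
T⇔T⇒≡ {true}  {false} f _ = ⊥-elim (f tt)
T⇔T⇒≡ {false} {true}  _ g = ⊥-elim (g tt)
T⇔T⇒≡ {false} {false} _ _ = refl

<ᵇ-true : ∀ {a b} → a < b → (a <ᵇ b) ≡ true
<ᵇ-true {a} {b} a<b = T⇔T⇒≡ (λ _ → tt) (λ _ → <⇒<ᵇ a<b)

<ᵇ-false : ∀ {a b} → ¬ a < b → (a <ᵇ b) ≡ false
<ᵇ-false {a} {b} a≮b = T⇔T⇒≡ (λ t → a≮b (<ᵇ⇒< a b t)) (λ ())

≡ᵇ-refl : ∀ x → (x ≡ᵇ x) ≡ true
≡ᵇ-refl x = T⇔T⇒≡ (λ _ → tt) (λ _ → ≡⇒≡ᵇ x x refl)

≡ᵇ-false : ∀ {x y} → x ≢ y → (x ≡ᵇ y) ≡ false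
≡ᵇ-false {x} {y} x≢y = T⇔T⇒≡ (λ t → x≢y (≡ᵇ⇒≡ x y t)) (λ ())

count-cong : ∀ n {p q} → (∀ x → x < n → p x ≡ q x) → count n p ≡ count n q
count-cong n e = ∑<-cong n (λ x x<n → cong ⟦_⟧ (e x x<n))

count≤ : ∀ n p → count n p ≤ n
count≤ zero    p = z≤n
count≤ (suc n) p = +-mono-≤ (⟦⟧≤1 (p 0)) (count≤ n _)

count-pos : ∀ n p x → x < n → T (p x) → 1 ≤ count n p
count-pos (suc n) p zero    _         px = ≤-trans (≤-reflexive (sym (⟦⟧-true px))) (m≤m+n ⟦ p 0 ⟧ _)
count-pos (suc n) p (suc x) (s<s x<n) px = ≤-trans (count-pos n _ x x<n px) (m≤n+m _ ⟦ p 0 ⟧)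

count-above : ∀ m j → count m (j <ᵇ_) ≡ m ∸ suc j
count-above zero    j = refl
count-above (suc m) j = begin
  count (suc m) (j <ᵇ_)           ≡⟨ ∑<-suc m _ ⟩
  count m (j <ᵇ_) + ⟦ j <ᵇ m ⟧    ≡⟨ cong (_+ ⟦ j <ᵇ m ⟧) (count-above m j) ⟩
  m ∸ suc j + ⟦ j <ᵇ m ⟧          ≡⟨ last-step (<-cmp j m) ⟩
  suc m ∸ suc j                   ∎
  where
  open ≡-Reasoning
  last-step : Tri (j < m) (j ≡ m) (j > m) → m ∸ suc j + ⟦ j <ᵇ m ⟧ ≡ m ∸ j
  last-step (tri< j<m _ _) = begin
    m ∸ suc j + ⟦ j <ᵇ m ⟧ ≡⟨ cong (λ b → m ∸ suc j + ⟦ b ⟧) (<ᵇ-true j<m) ⟩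
    m ∸ suc j + 1          ≡⟨ +-comm _ 1 ⟩
    suc (m ∸ suc j)        ≡⟨ sym (n∸x≡1+n∸1+x m j j<m) ⟩
    m ∸ j                  ∎
  last-step (tri≈ _ j≡m _) rewrite j≡m | <ᵇ-false (<-irrefl {m} refl) | n∸n≡0 m
    = trans (+-identityʳ _) (m≤n⇒m∸n≡0 (n≤1+n m))
  last-step (tri> _ _ m<j) rewrite <ᵇ-false (<-asym m<j) | +-identityʳ (m ∸ suc j)
    = trans (m≤n⇒m∸n≡0 (≤-trans (n≤1+n m) (m<n⇒m<1+n m<j))) (sym (m≤n⇒m∸n≡0 (<⇒≤ m<j)))

all<⁻ : ∀ n {p} → T (all< n p) → ∀ x → x < n → T (p x)
all<⁻ (suc n) {p} t zero    _         with p 0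
... | true = tt
all<⁻ (suc n) {p} t (suc x) (s<s x<n) with p 0
... | true = all<⁻ n t x x<n

all<⁺ : ∀ n {p} → (∀ x → x < n → T (p x)) → T (all< n p)
all<⁺ zero    f = tt
all<⁺ (suc n) {p} f with p 0 | f 0 z<s
... | true | _ = all<⁺ n (λ x x<n → f (suc x) (s<s x<n))

any<⁻ : ∀ n {p} → T (any< n p) → ∃ λ x → x < n × T (p x)
any<⁻ (suc n) {p} t with p 0 in p0
... | true  = 0 , z<s , subst T (sym p0) tt
... | false with any<⁻ n t
...   | x , x<n , px = suc x , s<s x<n , px

any<⁺ : ∀ n {p} x → x < n → T (p x) → T (any< n p)
any<⁺ (suc n) {p} zero    _         px with p 0
... | true = tt
any<⁺ (suc n) {p} (suc x) (s<s x<n) px with p 0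
... | true  = tt
... | false = any<⁺ n x x<n px

all<-cong : ∀ n {p q} → (∀ x → x < n → p x ≡ q x) → all< n p ≡ all< n q
all<-cong zero    e = refl
all<-cong (suc n) e = cong₂ _∧_ (e 0 z<s) (all<-cong n (λ x x<n → e (suc x) (s<s x<n)))

any<-cong : ∀ n {p q} → (∀ x → x < n → p x ≡ q x) → any< n p ≡ any< n q
any<-cong zero    e = refl
any<-cong (suc n) e = cong₂ _∨_ (e 0 z<s) (any<-cong n (λ x x<n → e (suc x) (s<s x<n)))

search< : ∀ n (p : ℕ → Bool) → (∃ λ x → x < n × T (p x)) ⊎ (∀ x → x < n → ¬ T (p x))
search< n p with any< n p in found
... | true  = inj₁ (any<⁻ n (subst T (sym found) tt))
... | false = inj₂ (λ x x<n px → subst T found (any<⁺ n x x<n px))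

least : ℕ → (ℕ → Bool) → ℕ
least zero    p = zero
least (suc n) p = if p 0 then 0 else suc (least n (λ x → p (suc x)))

least-spec : ∀ n p x → x < n → T (p x) → least n p < n × T (p (least n p))
least-spec (suc n) p x x<n px with p 0 in p0
... | true = z<s , subst T (sym p0) tt
least-spec (suc n) p zero    _         px | false = ⊥-elim (subst T p0 px)
least-spec (suc n) p (suc x) (s<s x<n) px | false with least-spec n (λ y → p (suc y)) x x<n px
... | lt , found = s<s lt , found

least-cong : ∀ n p q → (∀ x → x < n → p x ≡ q x) → least n p ≡ least n q
least-cong zero    p q e = refl
least-cong (suc n) p q e rewrite e 0 z<s =
  cong (λ z → if q 0 then 0 else suc z) (least-cong n _ _ (λ x x<n → e (suc x) (s<s x<n)))

toℕs : ∀ {n k} → Vec (Fin n) k → List ℕ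
toℕs v = Vec.toList (Vec.map toℕ v)

at : List ℕ → ℕ → ℕ
at []      x       = 0
at (a ∷ ℓ) zero    = a
at (a ∷ ℓ) (suc x) = at ℓ x

lookup≡at : ∀ {n k} (v : Vec (Fin n) k) i → toℕ (lookup v i) ≡ at (toℕs v) (toℕ i)
lookup≡at (a ∷ v) Fin.zero    = refl
lookup≡at (a ∷ v) (Fin.suc i) = lookup≡at v i

_^[_]_ : (ℕ → ℕ) → ℕ → ℕ → ℕ
f ^[ k ] x = fold x f k

iter≡^ : ∀ {n} (v : Vec (Fin n) n) k i → toℕ (iter v k i) ≡ at (toℕs v) ^[ k ] toℕ i
iter≡^ v zero    i = refl
iter≡^ v (suc k) i = trans (lookup≡at v (iter v k i)) (cong (at (toℕs v)) (iter≡^ v k i))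

sum≡∑< : ∀ n (g : Fin n → ℕ) h → (∀ i → g i ≡ h (toℕ i)) → sum (map g (allFin n)) ≡ ∑< n h
sum≡∑< n g h e = trans (cong sum (map-tabulate (λ i → i) g)) (go n g h e)
  where
  go : ∀ n (g : Fin n → ℕ) h → (∀ i → g i ≡ h (toℕ i)) → sum (tabulate g) ≡ ∑< n h
  go zero    g h e = refl
  go (suc n) g h e = cong₂ _+_ (e Fin.zero) (go n (λ i → g (Fin.suc i)) (λ x → h (suc x)) (λ i → e (Fin.suc i)))

lengthFilter : ∀ {A : Set} → (A → Bool) → List A → ℕ
lengthFilter P xs = length (filter (λ a → T? (P a)) xs)

lengthFilter-∷ : ∀ {A : Set} (P : A → Bool) a xs → lengthFilter P (a ∷ xs) ≡ ⟦ P a ⟧ + lengthFilter P xs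
lengthFilter-∷ P a xs with P a
... | true  = refl
... | false = refl

countᵇ≡count : ∀ n (p : Fin n → Bool) q → (∀ i → p i ≡ q (toℕ i)) → countᵇ p ≡ count n q
countᵇ≡count n p q e = go n (λ i → i) q e
  where
  go : ∀ k (f : Fin k → Fin n) q → (∀ i → p (f i) ≡ q (toℕ i)) → lengthFilter p (tabulate f) ≡ count k q
  go zero    f q e = refl
  go (suc k) f q e = trans (lengthFilter-∷ p (f Fin.zero) _)
    (cong₂ _+_ (cong ⟦_⟧ (e Fin.zero)) (go k (λ i → f (Fin.suc i)) (λ x → q (suc x)) (λ i → e (Fin.suc i))))

allᵇ≡all< : ∀ n (p : Fin n → Bool) q → (∀ i → p i ≡ q (toℕ i)) → allᵇ p ≡ all< n q
allᵇ≡all< n p q e = go n (λ i → i) q e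
  where
  go : ∀ k (f : Fin k → Fin n) q → (∀ i → p (f i) ≡ q (toℕ i)) → foldr (λ i b → p i ∧ b) true (tabulate f) ≡ all< k q
  go zero    f q e = refl
  go (suc k) f q e = cong₂ _∧_ (e Fin.zero) (go k (λ i → f (Fin.suc i)) (λ x → q (suc x)) (λ i → e (Fin.suc i)))

anyᵇ≡any< : ∀ n (p : Fin n → Bool) q → (∀ i → p i ≡ q (toℕ i)) → anyᵇ p ≡ any< n q
anyᵇ≡any< n p q e = go n (λ i → i) q e
  where
  go : ∀ k (f : Fin k → Fin n) q → (∀ i → p (f i) ≡ q (toℕ i)) → foldr (λ i b → p i ∨ b) false (tabulate f) ≡ any< k q
  go zero    f q e = refl
  go (suc k) f q e = cong₂ _∨_ (e Fin.zero) (go k (λ i → f (Fin.suc i)) (λ x → q (suc x)) (λ i → e (Fin.suc i)))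

permᵇ : ℕ → (ℕ → ℕ) → Bool
permᵇ n f = all< n (λ x → all< n (λ y → not (x <ᵇ y) ∨ not (f x ≡ᵇ f y)))

I : ℕ → (ℕ → ℕ) → ℕ
I n f = ∑[ x < n ] count n (λ y → (x <ᵇ y) ∧ (f y <ᵇ f x))

D : ℕ → (ℕ → ℕ) → ℕ
D n f = ∑[ x < n ] ∣ f x - x ∣

IsCycleMin : ℕ → (ℕ → ℕ) → ℕ → Bool
IsCycleMin n f x = all< n (λ k → not (f ^[ k ] x <ᵇ x))

cycles : ℕ → (ℕ → ℕ) → ℕ
cycles n f = count n (IsCycleMin n f)

IT : ℕ → (ℕ → ℕ) → ℕ
IT n f = I n f + (n ∸ cycles n f)

shallowᵇ : ℕ → (ℕ → ℕ) → Bool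
shallowᵇ n f = IT n f ≡ᵇ D n f

containsᵇ : ℕ → ℕ → ℕ → ℕ → (ℕ → ℕ) → Bool
containsᵇ s t u n f = any< n (λ x → any< n (λ y → any< n (λ z →
  (x <ᵇ y) ∧ (y <ᵇ z) ∧ sameOrder (f x) (f y) (f z) s t u)))

goodᵇ : Vec ℕ 3 → ℕ → (ℕ → ℕ) → Bool
goodᵇ (s ∷ t ∷ u ∷ []) n f = permᵇ n f ∧ shallowᵇ n f ∧ not (containsᵇ s t u n f)

module _ {n : ℕ} (v : Vec (Fin n) n) where
  private
    f : ℕ → ℕ
    f = at (toℕs v)
    ≡f : ∀ i → toℕ (lookup v i) ≡ f (toℕ i)
    ≡f = lookup≡at v

  isPerm≡permᵇ : isPerm v ≡ permᵇ n f
  isPerm≡permᵇ = allᵇ≡all< n _ _ λ i → allᵇ≡all< n _ _ λ j →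
    cong₂ (λ a b → not (toℕ i <ᵇ toℕ j) ∨ not (a ≡ᵇ b)) (≡f i) (≡f j)

  inv≡I : inv v ≡ I n f
  inv≡I = sum≡∑< n _ _ λ i → countᵇ≡count n _ _ λ j →
    cong₂ (λ a b → (toℕ i <ᵇ toℕ j) ∧ (a <ᵇ b)) (≡f j) (≡f i)

  disp≡D : disp v ≡ D n f
  disp≡D = sum≡∑< n _ _ λ i → cong (λ a → ∣ a - toℕ i ∣) (≡f i)

  cyc≡cycles : cyc v ≡ cycles n f
  cyc≡cycles = countᵇ≡count n _ _ λ i → allᵇ≡all< n _ _ λ k →
    cong (λ a → not (a <ᵇ toℕ i)) (iter≡^ v (toℕ k) i)

  shallow≡shallowᵇ : shallow v ≡ shallowᵇ n f
  shallow≡shallowᵇ = cong₂ _≡ᵇ_ (cong₂ (λ a c → a + (n ∸ c)) inv≡I cyc≡cycles) disp≡D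

  contains≡containsᵇ : ∀ s t u → contains (s ∷ t ∷ u ∷ []) v ≡ containsᵇ s t u n f
  contains≡containsᵇ s t u = anyᵇ≡any< n _ _ λ i → anyᵇ≡any< n _ _ λ j → anyᵇ≡any< n _ _ λ k →
    cong (λ w → (toℕ i <ᵇ toℕ j) ∧ (toℕ j <ᵇ toℕ k) ∧ w)
      (trans (cong₂ (λ a c → sameOrder a (toℕ (lookup v j)) c s t u) (≡f i) (≡f k))
             (cong (λ b → sameOrder (f (toℕ i)) b (f (toℕ k)) s t u) (≡f j)))

  good≡goodᵇ : ∀ σ → (isPerm v ∧ shallow v ∧ avoids σ v) ≡ goodᵇ σ n f
  good≡goodᵇ (s ∷ t ∷ u ∷ []) =
    cong₂ _∧_ isPerm≡permᵇ (cong₂ (λ a b → a ∧ not b) shallow≡shallowᵇ (contains≡containsᵇ s t u))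

Endo : ℕ → (ℕ → ℕ) → Set
Endo n f = ∀ x → x < n → f x < n

_≗[_]_ : (ℕ → ℕ) → ℕ → (ℕ → ℕ) → Set
f ≗[ n ] g = ∀ x → x < n → f x ≡ g x

wordsℕ : ℕ → ℕ → List (List ℕ)
wordsℕ n k = map toℕs (words n k)

maps : ℕ → List (List ℕ)
maps n = wordsℕ n n

words-unique : ∀ n k → Unique (words n k)
words-unique n zero    = [] ∷ []
words-unique n (suc k) = subst Unique (sym (concatMap≡cartesianProduct (allFin n)))
  (cartesianProductWith⁺ _∷_ ∷-injectiveᵛ (allFin⁺ n) (words-unique n k))
  where
  concatMap≡cartesianProduct : ∀ xs →
    concatMap (λ a → map (a ∷_) (words n k)) xs ≡ cartesianProductWith _∷_ xs (words n k)
  concatMap≡cartesianProduct []       = refl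
  concatMap≡cartesianProduct (x ∷ xs) = cong (map (x ∷_) (words n k) ++_) (concatMap≡cartesianProduct xs)
  ∷-injectiveᵛ : ∀ {a b : Fin n} {v w : Vec (Fin n) k} → _≡_ {A = Vec (Fin n) (suc k)} (a ∷ v) (b ∷ w) → a ≡ b × v ≡ w
  ∷-injectiveᵛ refl = refl , refl

toℕs-injective : ∀ {n k} {v w : Vec (Fin n) k} → toℕs v ≡ toℕs w → v ≡ w
toℕs-injective {v = []}    {[]}    e = refl
toℕs-injective {v = a ∷ v} {b ∷ w} e with ∷-injective e
... | a≡b , v≡w = cong₂ _∷_ (toℕ-injective a≡b) (toℕs-injective v≡w)

wordsℕ-unique : ∀ n k → Unique (wordsℕ n k)
wordsℕ-unique n k = map⁺ toℕs-injective (words-unique n k)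

words-complete : ∀ n k (v : Vec (Fin n) k) → v ∈ words n k
words-complete n zero    []      = here refl
words-complete n (suc k) (a ∷ v) = ∈-concatMap⁺ (λ a → map (a ∷_) (words n k))
  (Any.map (λ { refl → ∈-map⁺ (a ∷_) (words-complete n k v) }) (∈-allFin a))

wordsℕ-complete : ∀ n (ℓ : List ℕ) → All (_< n) ℓ → ℓ ∈ wordsℕ n (length ℓ)
wordsℕ-complete n ℓ ℓ<n =
  subst (_∈ wordsℕ n (length ℓ)) (toℕs-fromℕs ℓ ℓ<n) (∈-map⁺ toℕs (words-complete n (length ℓ) (fromℕs ℓ ℓ<n)))
  where
  fromℕs : (ℓ : List ℕ) → All (_< n) ℓ → Vec (Fin n) (length ℓ)
  fromℕs []      []         = []
  fromℕs (a ∷ ℓ) (a<n ∷ ℓ<n) = fromℕ< a<n ∷ fromℕs ℓ ℓ<n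
  toℕs-fromℕs : ∀ ℓ ℓ<n → toℕs (fromℕs ℓ ℓ<n) ≡ ℓ
  toℕs-fromℕs []      []         = refl
  toℕs-fromℕs (a ∷ ℓ) (a<n ∷ ℓ<n) = cong₂ _∷_ (toℕ-fromℕ< a<n) (toℕs-fromℕs ℓ ℓ<n)

wordsℕ-sound : ∀ n k ℓ → ℓ ∈ wordsℕ n k → length ℓ ≡ k × (∀ x → x < k → at ℓ x < n)
wordsℕ-sound n k ℓ ℓ∈ with ∈-map⁻ toℕs ℓ∈
... | v , _ , refl = length-toℕs v , at-toℕs v
  where
  length-toℕs : ∀ {k} (v : Vec (Fin n) k) → length (toℕs v) ≡ k
  length-toℕs []      = refl
  length-toℕs (a ∷ v) = cong suc (length-toℕs v)
  at-toℕs : ∀ {k} (v : Vec (Fin n) k) → ∀ x → x < k → at (toℕs v) x < n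
  at-toℕs (a ∷ v) zero    _         = toℕ<n a
  at-toℕs (a ∷ v) (suc x) (s<s x<k) = at-toℕs v x x<k

maps-endo : ∀ n ℓ → ℓ ∈ maps n → Endo n (at ℓ)
maps-endo n ℓ ℓ∈ = proj₂ (wordsℕ-sound n n ℓ ℓ∈)

at-applyUpTo : ∀ n h x → x < n → at (applyUpTo h n) x ≡ h x
at-applyUpTo (suc n) h zero    _         = refl
at-applyUpTo (suc n) h (suc x) (s<s x<n) = at-applyUpTo n (λ y → h (suc y)) x x<n

applyUpTo-at : ∀ n h ℓ → length ℓ ≡ n → h ≗[ n ] at ℓ → applyUpTo h n ≡ ℓ
applyUpTo-at zero    h []      _ _ = refl
applyUpTo-at (suc n) h (a ∷ ℓ) e h≗ℓ =
  cong₂ _∷_ (h≗ℓ 0 z<s) (applyUpTo-at n (λ y → h (suc y)) ℓ (suc-injective e) (λ x x<n → h≗ℓ (suc x) (s<s x<n)))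

applyUpTo∈maps : ∀ n h → Endo n h → applyUpTo h n ∈ maps n
applyUpTo∈maps n h h<n = subst (λ k → applyUpTo h n ∈ wordsℕ n k) (length-applyUpTo h n)
  (wordsℕ-complete n (applyUpTo h n) (bounded n h h<n))
  where
  bounded : ∀ k h → (∀ x → x < k → h x < n) → All (_< n) (applyUpTo h k)
  bounded zero    h h<n = []
  bounded (suc k) h h<n = h<n 0 z<s ∷ bounded k (λ y → h (suc y)) (λ x x<k → h<n (suc x) (s<s x<k))

countMaps : ℕ → ((ℕ → ℕ) → Bool) → ℕ
countMaps n P = lengthFilter (λ ℓ → P (at ℓ)) (maps n)

t≡countMaps : ∀ n σ → t n σ ≡ countMaps n (goodᵇ σ n)
t≡countMaps n σ = go (words n n)
  where
  go : ∀ vs → lengthFilter (λ v → isPerm v ∧ shallow v ∧ avoids σ v) vs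
            ≡ lengthFilter (λ ℓ → goodᵇ σ n (at ℓ)) (map toℕs vs)
  go []       = refl
  go (v ∷ vs) = trans (lengthFilter-∷ _ v vs) (trans (cong₂ _+_ (cong ⟦_⟧ (good≡goodᵇ v σ)) (go vs))
                      (sym (lengthFilter-∷ (λ ℓ → goodᵇ σ n (at ℓ)) (toℕs v) _)))

length-≤-injection : ∀ {A B : Set} (f : A → B) (xs : List A) (ys : List B) → Unique xs →
  (∀ x → x ∈ xs → f x ∈ ys) → (∀ x y → x ∈ xs → y ∈ xs → f x ≡ f y → x ≡ y) → length xs ≤ length ys
length-≤-injection f []       ys _            _    _   = z≤n
length-≤-injection f (x ∷ xs) ys (x∉xs ∷ xs!) into inj with ∈-∃++ (into x (here refl))
... | ys₁ , ys₂ , refl = begin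
  suc (length xs)               ≤⟨ s≤s (length-≤-injection f xs (ys₁ ++ ys₂) xs! into′ inj′) ⟩
  suc (length (ys₁ ++ ys₂))     ≡⟨ cong suc (length-++ ys₁) ⟩
  suc (length ys₁ + length ys₂) ≡⟨ sym (+-suc (length ys₁) (length ys₂)) ⟩
  length ys₁ + suc (length ys₂) ≡⟨ sym (length-++ ys₁) ⟩
  length (ys₁ ++ f x ∷ ys₂)     ∎
  where
  open ≤-Reasoning
  inj′ : ∀ a b → a ∈ xs → b ∈ xs → f a ≡ f b → a ≡ b
  inj′ a b a∈ b∈ = inj a b (there a∈) (there b∈)
  into′ : ∀ z → z ∈ xs → f z ∈ ys₁ ++ ys₂
  into′ z z∈ with ∈-++⁻ ys₁ (into z (there z∈))
  ... | inj₁ fz∈             = ∈-++⁺ˡ fz∈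
  ... | inj₂ (here fz≡fx)    = ⊥-elim (All.lookup x∉xs z∈ (sym (inj z x (there z∈) (here refl) fz≡fx)))
  ... | inj₂ (there fz∈)     = ∈-++⁺ʳ ys₁ fz∈

lengthFilter-bij : ∀ {A : Set} (xs ys : List A) (P Q : A → Bool) (φ ψ : A → A) → Unique xs → Unique ys →
  (∀ a → a ∈ xs → T (P a) → φ a ∈ ys × T (Q (φ a)) × ψ (φ a) ≡ a) →
  (∀ b → b ∈ ys → T (Q b) → ψ b ∈ xs × T (P (ψ b)) × φ (ψ b) ≡ b) →
  lengthFilter P xs ≡ lengthFilter Q ys
lengthFilter-bij xs ys P Q φ ψ xs! ys! φ-ok ψ-ok =
  ≤-antisym (half xs ys P Q φ ψ xs! φ-ok) (half ys xs Q P ψ φ ys! ψ-ok)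
  where
  half : ∀ {A : Set} (xs ys : List A) (P Q : A → Bool) (φ ψ : A → A) → Unique xs →
    (∀ a → a ∈ xs → T (P a) → φ a ∈ ys × T (Q (φ a)) × ψ (φ a) ≡ a) → lengthFilter P xs ≤ lengthFilter Q ys
  half xs ys P Q φ ψ xs! φ-ok = length-≤-injection φ _ _ (filter⁺ (λ a → T? (P a)) xs!) into inj
    where
    into : ∀ a → a ∈ filter (λ a → T? (P a)) xs → φ a ∈ filter (λ b → T? (Q b)) ys
    into a a∈ with ∈-filter⁻ (λ a → T? (P a)) a∈
    ... | a∈xs , Pa with φ-ok a a∈xs Pa
    ...   | φa∈ , Qφa , _ = ∈-filter⁺ (λ b → T? (Q b)) φa∈ Qφa
    inj : ∀ a b → a ∈ filter (λ a → T? (P a)) xs → b ∈ filter (λ a → T? (P a)) xs → φ a ≡ φ b → a ≡ b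
    inj a b a∈ b∈ φa≡φb with ∈-filter⁻ (λ a → T? (P a)) a∈ | ∈-filter⁻ (λ a → T? (P a)) b∈
    ... | a∈xs , Pa | b∈xs , Pb =
      trans (sym (proj₂ (proj₂ (φ-ok a a∈xs Pa)))) (trans (cong ψ φa≡φb) (proj₂ (proj₂ (φ-ok b b∈xs Pb))))

-- A map [0, n) → [0, n) is a function ℕ → ℕ with junk values from n on, so predicates and
-- transformations used for counting must not look at them.
Local : ℕ → ((ℕ → ℕ) → Bool) → Set
Local n P = ∀ f g → Endo n f → f ≗[ n ] g → P f ≡ P g

LocalMap : ℕ → ℕ → ((ℕ → ℕ) → (ℕ → ℕ)) → Set
LocalMap n m Φ = ∀ f g → Endo n f → f ≗[ n ] g → Φ f ≗[ m ] Φ g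

countMaps-bij : ∀ n m (P Q : (ℕ → ℕ) → Bool) (Φ Ψ : (ℕ → ℕ) → (ℕ → ℕ)) →
  Local n P → Local m Q → LocalMap n m Φ → LocalMap m n Ψ →
  (∀ f → Endo n f → T (P f) → Endo m (Φ f) × T (Q (Φ f)) × Ψ (Φ f) ≗[ n ] f) →
  (∀ g → Endo m g → T (Q g) → Endo n (Ψ g) × T (P (Ψ g)) × Φ (Ψ g) ≗[ m ] g) →
  countMaps n P ≡ countMaps m Q
countMaps-bij n m P Q Φ Ψ P-local Q-local Φ-local Ψ-local Φ-ok Ψ-ok =
  lengthFilter-bij (maps n) (maps m) _ _ (onLists m Φ) (onLists n Ψ) (wordsℕ-unique n n) (wordsℕ-unique m m)
    (transfer n m P Q Φ Ψ Q-local Ψ-local Φ-ok) (transfer m n Q P Ψ Φ P-local Φ-local Ψ-ok)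
  where
  onLists : ℕ → ((ℕ → ℕ) → (ℕ → ℕ)) → List ℕ → List ℕ
  onLists k Φ ℓ = applyUpTo (Φ (at ℓ)) k
  transfer : ∀ n m (P Q : (ℕ → ℕ) → Bool) (Φ Ψ : (ℕ → ℕ) → (ℕ → ℕ)) → Local m Q → LocalMap m n Ψ →
    (∀ f → Endo n f → T (P f) → Endo m (Φ f) × T (Q (Φ f)) × Ψ (Φ f) ≗[ n ] f) →
    ∀ ℓ → ℓ ∈ maps n → T (P (at ℓ)) →
    onLists m Φ ℓ ∈ maps m × T (Q (at (onLists m Φ ℓ))) × onLists n Ψ (onLists m Φ ℓ) ≡ ℓ
  transfer n m P Q Φ Ψ Q-local Ψ-local Φ-ok ℓ ℓ∈ Pℓ with Φ-ok (at ℓ) (maps-endo n ℓ ℓ∈) Pℓ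
  ... | Φℓ-endo , QΦℓ , ΨΦℓ≗ℓ =
    applyUpTo∈maps m _ Φℓ-endo ,
    subst T (Q-local _ _ Φℓ-endo (λ x x<m → sym (at-applyUpTo m _ x x<m))) QΦℓ ,
    applyUpTo-at n _ ℓ (proj₁ (wordsℕ-sound n n ℓ ℓ∈))
      (λ x x<n → trans (Ψ-local _ _ endo′ (λ y y<m → at-applyUpTo m _ y y<m) x x<n) (ΨΦℓ≗ℓ x x<n))
    where
    endo′ : Endo m (at (onLists m Φ ℓ))
    endo′ y y<m = subst (_< m) (sym (at-applyUpTo m _ y y<m)) (Φℓ-endo y y<m)

countMaps-cong : ∀ n (P Q : (ℕ → ℕ) → Bool) → (∀ f → Endo n f → P f ≡ Q f) → countMaps n P ≡ countMaps n Q
countMaps-cong n P Q P≡Q = go (maps n) (λ ℓ ℓ∈ → P≡Q (at ℓ) (maps-endo n ℓ ℓ∈))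
  where
  go : ∀ ℓs → (∀ ℓ → ℓ ∈ ℓs → P (at ℓ) ≡ Q (at ℓ)) → lengthFilter (λ ℓ → P (at ℓ)) ℓs ≡ lengthFilter (λ ℓ → Q (at ℓ)) ℓs
  go []       e = refl
  go (ℓ ∷ ℓs) e = trans (lengthFilter-∷ _ ℓ ℓs)
    (trans (cong₂ _+_ (cong ⟦_⟧ (e ℓ (here refl))) (go ℓs (λ ℓ′ ℓ′∈ → e ℓ′ (there ℓ′∈)))) (sym (lengthFilter-∷ _ ℓ ℓs)))

countMaps-false : ∀ n → countMaps n (λ _ → false) ≡ 0
countMaps-false n = go (maps n)
  where
  go : ∀ ℓs → lengthFilter (λ _ → false) ℓs ≡ 0
  go []       = refl
  go (_ ∷ ℓs) = go ℓs

countMaps-partition : ∀ n k (P : (ℕ → ℕ) → Bool) (Q : ℕ → (ℕ → ℕ) → Bool) →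
  (∀ f → Endo n f → T (P f) → count k (λ a → Q a f) ≡ 1) →
  countMaps n P ≡ ∑[ a < k ] countMaps n (λ f → P f ∧ Q a f)
countMaps-partition n k P Q unique = go (maps n) (λ ℓ ℓ∈ → unique (at ℓ) (maps-endo n ℓ ℓ∈))
  where
  split : ∀ b (q : ℕ → Bool) → (T b → count k q ≡ 1) → ⟦ b ⟧ ≡ count k (λ a → b ∧ q a)
  split true  q one = sym (one tt)
  split false q _   = sym (∑<-zero k (λ _ _ → refl))
  go : ∀ ℓs → (∀ ℓ → ℓ ∈ ℓs → T (P (at ℓ)) → count k (λ a → Q a (at ℓ)) ≡ 1) →
       lengthFilter (λ ℓ → P (at ℓ)) ℓs ≡ ∑[ a < k ] lengthFilter (λ ℓ → P (at ℓ) ∧ Q a (at ℓ)) ℓs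
  go []       _   = sym (∑<-zero k (λ _ _ → refl))
  go (ℓ ∷ ℓs) one = begin
    lengthFilter P′ (ℓ ∷ ℓs)                                        ≡⟨ lengthFilter-∷ P′ ℓ ℓs ⟩
    ⟦ P′ ℓ ⟧ + lengthFilter P′ ℓs                                    ≡⟨ cong₂ _+_ (split _ _ (one ℓ (here refl)))
                                                                          (go ℓs (λ ℓ′ ℓ′∈ → one ℓ′ (there ℓ′∈))) ⟩
    count k (λ a → PQ′ a ℓ) + ∑[ a < k ] lengthFilter (PQ′ a) ℓs     ≡⟨ sym (∑<-distrib-+ k _ _) ⟩
    ∑[ a < k ] (⟦ PQ′ a ℓ ⟧ + lengthFilter (PQ′ a) ℓs)               ≡⟨ ∑<-cong k (λ a _ → sym (lengthFilter-∷ (PQ′ a) ℓ ℓs)) ⟩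
    ∑[ a < k ] lengthFilter (PQ′ a) (ℓ ∷ ℓs)                        ∎
    where
    open ≡-Reasoning
    P′ : List ℕ → Bool
    P′ ℓ = P (at ℓ)
    PQ′ : ℕ → List ℕ → Bool
    PQ′ a ℓ = P (at ℓ) ∧ Q a (at ℓ)

InjectiveOn : ℕ → (ℕ → ℕ) → Set
InjectiveOn n f = ∀ x y → x < n → y < n → f x ≡ f y → x ≡ y

Perm : ℕ → (ℕ → ℕ) → Set
Perm n f = Endo n f × InjectiveOn n f

<1+n∧≢⇒< : ∀ {a m} → a < suc m → a ≢ m → a < m
<1+n∧≢⇒< a<1+m a≢m = ≤∧≢⇒< (s≤s⁻¹ a<1+m) a≢m

-- Deletes the value m, sitting at position j, from its cycle.
erase : ℕ → ℕ → (ℕ → ℕ) → ℕ → ℕ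
erase j m f z = if z ≡ᵇ j then f m else f z

erase-at : ∀ j m f → erase j m f j ≡ f m
erase-at j m f rewrite ≡ᵇ-refl j = refl

erase-other : ∀ j m f z → z ≢ j → erase j m f z ≡ f z
erase-other j m f z z≢j rewrite ≡ᵇ-false z≢j = refl

erase-perm : ∀ m f j → Perm (suc m) f → j < suc m → f j ≡ m → Perm m (erase j m f)
erase-perm m f j (f<n , f-inj) j<n fj≡m = endo , inj
  where
  f≢m : ∀ z → z < suc m → z ≢ j → f z ≢ m
  f≢m z z<n z≢j fz≡m = z≢j (f-inj z j z<n j<n (trans fz≡m (sym fj≡m)))
  endo : Endo m (erase j m f)
  endo z z<m with z ≟ j
  ... | yes refl = subst (_< m) (sym (erase-at z m f))
                     (<1+n∧≢⇒< (f<n m ≤-refl) (f≢m m ≤-refl (λ m≡z → <-irrefl (sym m≡z) z<m)))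
  ... | no  z≢j  = subst (_< m) (sym (erase-other j m f z z≢j)) (<1+n∧≢⇒< (f<n z (m<n⇒m<1+n z<m)) (f≢m z (m<n⇒m<1+n z<m) z≢j))
  inj : InjectiveOn m (erase j m f)
  inj x y x<m y<m e with x ≟ j | y ≟ j
  ... | yes refl | yes refl = refl
  ... | yes refl | no  y≢j  = ⊥-elim (<-irrefl (sym (f-inj m y ≤-refl (m<n⇒m<1+n y<m)
                                  (trans (sym (erase-at x m f)) (trans e (erase-other j m f y y≢j))))) y<m)
  ... | no  x≢j  | yes refl = ⊥-elim (<-irrefl (f-inj x m (m<n⇒m<1+n x<m) ≤-refl
                                  (trans (sym (erase-other j m f x x≢j)) (trans e (erase-at y m f)))) x<m)
  ... | no  x≢j  | no  y≢j  = f-inj x y (m<n⇒m<1+n x<m) (m<n⇒m<1+n y<m)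
                                  (trans (sym (erase-other j m f x x≢j)) (trans e (erase-other j m f y y≢j)))

perm-surjective : ∀ n f → Perm n f → ∀ y → y < n → ∃ λ x → x < n × f x ≡ y
perm-surjective (suc m) f P@(f<n , f-inj) y y<n with search< (suc m) (λ x → f x ≡ᵇ m)
... | inj₁ (j , j<n , fj≡ᵇm) with y ≟ m
...   | yes refl = j , j<n , ≡ᵇ⇒≡ _ _ fj≡ᵇm
...   | no  y≢m  with perm-surjective m (erase j m f) (erase-perm m f j P j<n (≡ᵇ⇒≡ _ _ fj≡ᵇm)) y (<1+n∧≢⇒< y<n y≢m)
...     | z , z<m , e with z ≟ j
...       | yes refl = m , ≤-refl , trans (sym (erase-at z m f)) e
...       | no  z≢j  = z , m<n⇒m<1+n z<m , trans (sym (erase-other j m f z z≢j)) e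
perm-surjective (suc m) f (f<n , f-inj) y y<n | inj₂ m∉f[n] = ⊥-elim (<-irrefl z≡m z<m)
  where
  f≢m : ∀ x → x < suc m → f x ≢ m
  f≢m x x<n fx≡m = m∉f[n] x x<n (≡⇒≡ᵇ _ _ fx≡m)
  restriction : Perm m f
  restriction = (λ x x<m → <1+n∧≢⇒< (f<n x (m<n⇒m<1+n x<m)) (f≢m x (m<n⇒m<1+n x<m))) ,
                (λ x y x<m y<m → f-inj x y (m<n⇒m<1+n x<m) (m<n⇒m<1+n y<m))
  preimage = perm-surjective m f restriction (f m) (<1+n∧≢⇒< (f<n m ≤-refl) (f≢m m ≤-refl))
  z = proj₁ preimage
  z<m = proj₁ (proj₂ preimage)
  z≡m : z ≡ m
  z≡m = f-inj z m (m<n⇒m<1+n z<m) ≤-refl (proj₂ (proj₂ preimage))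

inverse : ℕ → (ℕ → ℕ) → ℕ → ℕ
inverse n f y = least n (λ x → f x ≡ᵇ y)

inverse-spec : ∀ n f → Perm n f → ∀ y → y < n → inverse n f y < n × f (inverse n f y) ≡ y
inverse-spec n f P y y<n with perm-surjective n f P y y<n
... | x , x<n , fx≡y with least-spec n (λ x → f x ≡ᵇ y) x x<n (≡⇒≡ᵇ _ _ fx≡y)
...   | lt , found = lt , ≡ᵇ⇒≡ _ _ found

module Inverse (n : ℕ) (f : ℕ → ℕ) (P : Perm n f) where

  f⁻¹ : ℕ → ℕ
  f⁻¹ = inverse n f

  f⁻¹< : ∀ y → y < n → f⁻¹ y < n
  f⁻¹< y y<n = proj₁ (inverse-spec n f P y y<n)

  f∘f⁻¹ : ∀ y → y < n → f (f⁻¹ y) ≡ y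
  f∘f⁻¹ y y<n = proj₂ (inverse-spec n f P y y<n)

  f⁻¹∘f : ∀ x → x < n → f⁻¹ (f x) ≡ x
  f⁻¹∘f x x<n = proj₂ P _ _ (f⁻¹< (f x) (proj₁ P x x<n)) x<n (f∘f⁻¹ (f x) (proj₁ P x x<n))

  f⁻¹-perm : Perm n f⁻¹
  f⁻¹-perm = f⁻¹< , λ a b a<n b<n e → trans (sym (f∘f⁻¹ a a<n)) (trans (cong f e) (f∘f⁻¹ b b<n))

^-endo : ∀ n f → Endo n f → ∀ k x → x < n → f ^[ k ] x < n
^-endo n f f<n zero    x x<n = x<n
^-endo n f f<n (suc k) x x<n = f<n _ (^-endo n f f<n k x x<n)

^-+ : ∀ f a b x → f ^[ a + b ] x ≡ f ^[ a ] (f ^[ b ] x)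
^-+ f a b x = fold-+ x f a

^-* : ∀ f p x → f ^[ p ] x ≡ x → ∀ c → f ^[ c * p ] x ≡ x
^-* f p x fixed zero    = refl
^-* f p x fixed (suc c) = trans (^-+ f p (c * p) x) (trans (cong (f ^[ p ]_) (^-* f p x fixed c)) fixed)

^-injective : ∀ n f → Perm n f → ∀ a x y → x < n → y < n → f ^[ a ] x ≡ f ^[ a ] y → x ≡ y
^-injective n f P zero    x y x<n y<n e = e
^-injective n f P@(f<n , f-inj) (suc a) x y x<n y<n e =
  ^-injective n f P a x y x<n y<n (f-inj _ _ (^-endo n f f<n a x x<n) (^-endo n f f<n a y y<n) e)

period : ∀ n f → Perm n f → ∀ x → x < n → ∃ λ p → 0 < p × p ≤ n × f ^[ p ] x ≡ x
period n f P@(f<n , f-inj) x x<n with search< (suc n) (λ b → any< b (λ a → f ^[ a ] x ≡ᵇ f ^[ b ] x))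
... | inj₁ (b , b≤n , repeat) with any<⁻ b repeat
...   | a , a<b , fᵃx≡fᵇx = b ∸ a , m<n⇒0<n∸m a<b , ≤-trans (m∸n≤m b a) (s≤s⁻¹ b≤n) ,
        ^-injective n f P a _ x (^-endo n f f<n (b ∸ a) x x<n) x<n (begin
          f ^[ a ] (f ^[ b ∸ a ] x)   ≡⟨ sym (^-+ f a (b ∸ a) x) ⟩
          f ^[ a + (b ∸ a) ] x        ≡⟨ cong (λ c → f ^[ c ] x) (m+[n∸m]≡n (<⇒≤ a<b)) ⟩
          f ^[ b ] x                  ≡⟨ sym (≡ᵇ⇒≡ _ _ fᵃx≡fᵇx) ⟩
          f ^[ a ] x                  ∎)
  where open ≡-Reasoning
period n f P@(f<n , f-inj) x x<n | inj₂ no-repeat = ⊥-elim (no-repeat n ≤-refl (any<⁺ n z z<n (≡⇒≡ᵇ _ _ fᶻx≡fⁿx)))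
  where
  orbit-injective : InjectiveOn n (λ k → f ^[ k ] x)
  orbit-injective a b a<n b<n e with <-cmp a b
  ... | tri≈ _ a≡b _ = a≡b
  ... | tri< a<b _ _ = ⊥-elim (no-repeat b (m<n⇒m<1+n b<n) (any<⁺ b a a<b (≡⇒≡ᵇ _ _ e)))
  ... | tri> _ _ b<a = ⊥-elim (no-repeat a (m<n⇒m<1+n a<n) (any<⁺ a b b<a (≡⇒≡ᵇ _ _ (sym e))))
  preimage = perm-surjective n (λ k → f ^[ k ] x) ((λ k _ → ^-endo n f f<n k x x<n) , orbit-injective)
                             (f ^[ n ] x) (^-endo n f f<n n x x<n)
  z = proj₁ preimage
  z<n = proj₁ (proj₂ preimage)
  fᶻx≡fⁿx = proj₂ (proj₂ preimage)

orbit-bounded : ∀ n f → Perm n f → ∀ x → x < n → ∀ k → ∃ λ r → r < n × f ^[ k ] x ≡ f ^[ r ] x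
orbit-bounded n f P x x<n k with period n f P x x<n
... | suc q , _ , p≤n , fixed = k % suc q , <-≤-trans (m%n<n k (suc q)) p≤n , (begin
  f ^[ k ] x                                    ≡⟨ cong (λ c → f ^[ c ] x) (m≡m%n+[m/n]*n k (suc q)) ⟩
  f ^[ k % suc q + k / suc q * suc q ] x        ≡⟨ ^-+ f (k % suc q) _ x ⟩
  f ^[ k % suc q ] (f ^[ k / suc q * suc q ] x) ≡⟨ cong (f ^[ k % suc q ]_) (^-* f (suc q) x fixed (k / suc q)) ⟩
  f ^[ k % suc q ] x                            ∎)
  where open ≡-Reasoning

^-return : ∀ n f → Perm n f → ∀ x a → x < n → ∃ λ c → f ^[ c ] (f ^[ a ] x) ≡ x
^-return n f P x a x<n with period n f P x x<n
... | suc q , _ , _ , fixed = a * q , (begin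
  f ^[ a * q ] (f ^[ a ] x)   ≡⟨ sym (^-+ f (a * q) a x) ⟩
  f ^[ a * q + a ] x          ≡⟨ cong (λ c → f ^[ c ] x) (trans (+-comm (a * q) a) (sym (*-suc a q))) ⟩
  f ^[ a * suc q ] x          ≡⟨ ^-* f (suc q) x fixed a ⟩
  x                           ∎)
  where open ≡-Reasoning

∑<-permute : ∀ n f → Perm n f → ∀ h → ∑[ p < n ] h (f p) ≡ ∑< n h
∑<-permute zero    f P h = refl
∑<-permute (suc m) f P h = begin
  ∑[ p < suc m ] h (f p)            ≡⟨ ∑<-suc m _ ⟩
  ∑[ p < m ] h (f p) + h (f m)      ≡⟨ drop-top (m ≟ j) ⟩
  ∑[ p < m ] h (g p) + h m          ≡⟨ cong (_+ h m) (∑<-permute m g (erase-perm m f j P j<n fj≡m) h) ⟩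
  ∑< m h + h m                      ≡⟨ sym (∑<-suc m h) ⟩
  ∑< (suc m) h                      ∎
  where
  open ≡-Reasoning
  open Inverse (suc m) f P
  j : ℕ
  j = f⁻¹ m
  j<n : j < suc m
  j<n = f⁻¹< m ≤-refl
  fj≡m : f j ≡ m
  fj≡m = f∘f⁻¹ m ≤-refl
  g : ℕ → ℕ
  g = erase j m f
  drop-top : Dec (m ≡ j) → ∑[ p < m ] h (f p) + h (f m) ≡ ∑[ p < m ] h (g p) + h m
  drop-top (yes m≡j) = cong₂ _+_
    (∑<-cong m (λ p p<m → cong h (sym (erase-other j m f p (λ p≡j → <-irrefl (trans p≡j (sym m≡j)) p<m)))))
    (cong h (trans (cong f m≡j) fj≡m))
  drop-top (no m≢j) = begin
    ∑[ p < m ] h (f p) + h (f m)      ≡⟨ cong (λ v → ∑[ p < m ] h (f p) + h v) (sym (erase-at j m f)) ⟩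
    ∑[ p < m ] h (f p) + h (g j)      ≡⟨ ∑<-update m _ _ j (<1+n∧≢⇒< j<n (m≢j ∘ sym))
                                           (λ p _ p≢j → cong h (sym (erase-other j m f p p≢j))) ⟩
    ∑[ p < m ] h (g p) + h (f j)      ≡⟨ cong (λ v → ∑[ p < m ] h (g p) + h v) fj≡m ⟩
    ∑[ p < m ] h (g p) + h m          ∎

-- Erasing the maximum

IsCycleMin⁻ : ∀ n f → Perm n f → ∀ x → x < n → T (IsCycleMin n f x) → ∀ k → x ≤ f ^[ k ] x
IsCycleMin⁻ n f P x x<n min k with orbit-bounded n f P x x<n k
... | r , r<n , fᵏx≡fʳx = subst (x ≤_) (sym fᵏx≡fʳx)
  (≮⇒≥ (λ fʳx<x → subst T (cong not (<ᵇ-true fʳx<x)) (all<⁻ n min r r<n)))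

IsCycleMin⁺ : ∀ n f x → (∀ k → x ≤ f ^[ k ] x) → T (IsCycleMin n f x)
IsCycleMin⁺ n f x min = all<⁺ n (λ k _ → subst T (cong not (sym (<ᵇ-false (≤⇒≯ (min k))))) tt)

⟦⟧-split-<ˡ : ∀ u v b → u ≢ v → ⟦ (u <ᵇ v) ∧ b ⟧ + ⟦ (v <ᵇ u) ∧ b ⟧ ≡ ⟦ b ⟧
⟦⟧-split-<ˡ u v b u≢v with <-cmp u v
... | tri< u<v _ _ rewrite <ᵇ-true u<v | <ᵇ-false (<-asym u<v) = +-identityʳ ⟦ b ⟧
... | tri≈ _ u≡v _ = ⊥-elim (u≢v u≡v)
... | tri> _ _ v<u rewrite <ᵇ-true v<u | <ᵇ-false (<-asym v<u) = refl

⟦⟧-split-<ʳ : ∀ b u v → u ≢ v → ⟦ b ∧ (u <ᵇ v) ⟧ + ⟦ b ∧ (v <ᵇ u) ⟧ ≡ ⟦ b ⟧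
⟦⟧-split-<ʳ false u v u≢v = refl
⟦⟧-split-<ʳ true  u v u≢v with <-cmp u v
... | tri< u<v _ _ rewrite <ᵇ-true u<v | <ᵇ-false (<-asym u<v) = refl
... | tri≈ _ u≡v _ = ⊥-elim (u≢v u≡v)
... | tri> _ _ v<u rewrite <ᵇ-true v<u | <ᵇ-false (<-asym v<u) = refl

<⇒∃+suc : ∀ {a b} → a < b → ∃ λ r → a + suc r ≡ b
<⇒∃+suc {a} a<b with m≤n⇒∃[o]m+o≡n a<b
... | r , 1+a+r≡b = r , trans (+-suc a r) 1+a+r≡b

∣x+r-x∣≡r : ∀ x r → ∣ x + r - x ∣ ≡ r
∣x+r-x∣≡r x r = trans (∣-∣-comm (x + r) x) (∣m-m+n∣≡n x r)

cancel-by : ∀ {L R X Y} → L + X ≡ R + Y → X ≡ Y → L ≡ R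
cancel-by {L} {R} {X} {Y} L+X≡R+Y X≡Y = +-cancelʳ-≡ X L R (trans L+X≡R+Y (cong (R +_) (sym X≡Y)))

-- Writing j = k + 1 + r and m = j + 1 + s, add the hypotheses to both sides and cancel;
-- what remains is a ring identity.
excess-arith-< : ∀ {k j m} Df Dg If Ig A B T → k < j → j < m →
  Df + ∣ k - j ∣ ≡ Dg + ∣ m - j ∣ + ∣ k - m ∣ → If + A ≡ Ig + (m ∸ j) + B → A + B + suc j ≡ m →
  Df + (Ig + T) ≡ Dg + (If + suc T) + 2 * A
excess-arith-< {k} {_} Df Dg If Ig A B T k<j j<m hD hI hAB with <⇒∃+suc k<j | <⇒∃+suc j<m
... | r , refl | s , refl =
  cancel-by (identity Df Dg If Ig A B T r s k) (cong₂ _+_ (cong₂ _+_ (sym hD′) hI′) hAB)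
  where
  identity : ∀ Df Dg If Ig A B T r s k →
    Df + (Ig + T) + ((Dg + suc s + (suc r + suc s)) + (If + A) + (A + B + suc (k + suc r)))
      ≡ Dg + (If + suc T) + 2 * A + ((Df + suc r) + (Ig + suc s + B) + (k + suc r + suc s))
  identity = solve-∀
  j = k + suc r
  hD′ : Df + suc r ≡ Dg + suc s + (suc r + suc s)
  hD′ = begin
    Df + suc r                                   ≡⟨ cong (Df +_) (sym (∣m-m+n∣≡n k (suc r))) ⟩
    Df + ∣ k - j ∣                               ≡⟨ hD ⟩
    Dg + ∣ j + suc s - j ∣ + ∣ k - j + suc s ∣   ≡⟨ cong₂ (λ a b → Dg + a + b) (∣x+r-x∣≡r j (suc s))
                                                     (trans (cong ∣ k -_∣ (+-assoc k (suc r) (suc s))) (∣m-m+n∣≡n k _)) ⟩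
    Dg + suc s + (suc r + suc s)                 ∎
    where open ≡-Reasoning
  hI′ : If + A ≡ Ig + suc s + B
  hI′ = trans hI (cong (λ a → Ig + a + B) (m+n∸m≡n j (suc s)))

excess-arith-≥ : ∀ {k j m} Df Dg If Ig A B C T → j ≤ k → k < m →
  Df + ∣ k - j ∣ ≡ Dg + ∣ m - j ∣ + ∣ k - m ∣ → If + A ≡ Ig + (m ∸ j) + B →
  A + B + suc j ≡ m → C + B + suc k ≡ m →
  Df + (Ig + T) ≡ Dg + (If + suc T) + 2 * C
excess-arith-≥ {_} {j} Df Dg If Ig A B C T j≤k k<m hD hI hAB hCB with m≤n⇒∃[o]m+o≡n j≤k | <⇒∃+suc k<m
... | r , refl | s , refl =
  cancel-by (identity Df Dg If Ig A B C T r s j)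
    (cong₂ _+_ (cong₂ _+_ (cong₂ _+_ (sym hD′) hI′) (sym hAB)) (cong (2 *_) hCB))
  where
  identity : ∀ Df Dg If Ig A B C T r s j →
    Df + (Ig + T) + ((Dg + (r + suc s) + suc s) + (If + A) + (j + r + suc s) + 2 * (C + B + suc (j + r)))
      ≡ Dg + (If + suc T) + 2 * C + ((Df + r) + (Ig + (r + suc s) + B) + (A + B + suc j) + 2 * (j + r + suc s))
  identity = solve-∀
  k = j + r
  m−j : k + suc s ∸ j ≡ r + suc s
  m−j = trans (cong (_∸ j) (+-assoc j r (suc s))) (m+n∸m≡n j _)
  hD′ : Df + r ≡ Dg + (r + suc s) + suc s
  hD′ = begin
    Df + r                                   ≡⟨ cong (Df +_) (sym (∣x+r-x∣≡r j r)) ⟩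
    Df + ∣ k - j ∣                           ≡⟨ hD ⟩
    Dg + ∣ k + suc s - j ∣ + ∣ k - k + suc s ∣ ≡⟨ cong₂ (λ a b → Dg + a + b)
                                                 (trans (cong (∣_- j ∣) (+-assoc j r (suc s))) (∣x+r-x∣≡r j _))
                                                 (∣m-m+n∣≡n k (suc s)) ⟩
    Dg + (r + suc s) + suc s                 ∎
    where open ≡-Reasoning
  hI′ : If + A ≡ Ig + (r + suc s) + B
  hI′ = trans hI (cong (λ a → Ig + a + B) m−j)

module EraseMax (m : ℕ) (f : ℕ → ℕ) (P : Perm (suc m) f) (j : ℕ) (j<n : j < suc m) (fj≡m : f j ≡ m) where

  f<n : Endo (suc m) f
  f<n = proj₁ P

  f-inj : InjectiveOn (suc m) f
  f-inj = proj₂ P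

  k : ℕ
  k = f m

  g : ℕ → ℕ
  g = erase j m f

  g-perm : Perm m g
  g-perm = erase-perm m f j P j<n fj≡m

  g-other : ∀ z → z ≢ j → g z ≡ f z
  g-other = erase-other j m f

  g-at : g j ≡ k
  g-at = erase-at j m f

  f<m : ∀ z → z < suc m → z ≢ j → f z < m
  f<m z z<n z≢j = <1+n∧≢⇒< (f<n z z<n) (λ fz≡m → z≢j (f-inj z j z<n j<n (trans fz≡m (sym fj≡m))))

  g-orbit⊆f-orbit : ∀ x → x < m → ∀ a → ∃ λ b → g ^[ a ] x ≡ f ^[ b ] x
  g-orbit⊆f-orbit x x<m zero = 0 , refl
  g-orbit⊆f-orbit x x<m (suc a) with g-orbit⊆f-orbit x x<m a
  ... | b , gᵃx≡fᵇx with g ^[ a ] x ≟ j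
  ...   | yes gᵃx≡j = suc (suc b) , (begin
          g (g ^[ a ] x)          ≡⟨ cong g gᵃx≡j ⟩
          g j                     ≡⟨ g-at ⟩
          f m                     ≡⟨ cong f (sym fj≡m) ⟩
          f (f j)                 ≡⟨ cong (f ∘ f) (trans (sym gᵃx≡j) gᵃx≡fᵇx) ⟩
          f (f (f ^[ b ] x))      ∎)
    where open ≡-Reasoning
  ...   | no  gᵃx≢j = suc b , trans (g-other _ gᵃx≢j) (cong f gᵃx≡fᵇx)

  f-orbit⊆g-orbit : ∀ x → x < m → ∀ b → ∃ λ a → (f ^[ b ] x ≡ g ^[ a ] x) ⊎ (f ^[ b ] x ≡ m × g ^[ a ] x ≡ j)
  f-orbit⊆g-orbit x x<m zero = 0 , inj₁ refl
  f-orbit⊆g-orbit x x<m (suc b) with f-orbit⊆g-orbit x x<m b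
  ... | a , inj₁ fᵇx≡gᵃx with g ^[ a ] x ≟ j
  ...   | yes gᵃx≡j = a , inj₂ (trans (cong f (trans fᵇx≡gᵃx gᵃx≡j)) fj≡m , gᵃx≡j)
  ...   | no  gᵃx≢j = suc a , inj₁ (trans (cong f fᵇx≡gᵃx) (sym (g-other _ gᵃx≢j)))
  f-orbit⊆g-orbit x x<m (suc b) | a , inj₂ (fᵇx≡m , gᵃx≡j) =
    suc a , inj₁ (trans (cong f fᵇx≡m) (trans (sym g-at) (cong g (sym gᵃx≡j))))

  cycleMin-erase : ∀ x → x < m → IsCycleMin (suc m) f x ≡ IsCycleMin m g x
  cycleMin-erase x x<m = T⇔T⇒≡ to from
    where
    to : T (IsCycleMin (suc m) f x) → T (IsCycleMin m g x)
    to min = IsCycleMin⁺ m g x λ a → let (b , e) = g-orbit⊆f-orbit x x<m a in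
      subst (x ≤_) (sym e) (IsCycleMin⁻ (suc m) f P x (m<n⇒m<1+n x<m) min b)
    from : T (IsCycleMin m g x) → T (IsCycleMin (suc m) f x)
    from min = IsCycleMin⁺ (suc m) f x λ b → case b (f-orbit⊆g-orbit x x<m b)
      where
      case : ∀ b → (∃ λ a → (f ^[ b ] x ≡ g ^[ a ] x) ⊎ (f ^[ b ] x ≡ m × g ^[ a ] x ≡ j)) → x ≤ f ^[ b ] x
      case b (a , inj₁ e)       = subst (x ≤_) (sym e) (IsCycleMin⁻ m g g-perm x x<m min a)
      case b (a , inj₂ (e , _)) = subst (x ≤_) (sym e) (<⇒≤ x<m)

  cycleMin-top : IsCycleMin (suc m) f m ≡ (j ≡ᵇ m)
  cycleMin-top = T⇔T⇒≡ to from
    where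
    to : T (IsCycleMin (suc m) f m) → T (j ≡ᵇ m)
    to min = ≡⇒≡ᵇ j m (f-inj j m j<n ≤-refl (trans fj≡m (sym fm≡m)))
      where
      fm≡m : f m ≡ m
      fm≡m = ≤-antisym (s≤s⁻¹ (f<n m ≤-refl)) (IsCycleMin⁻ (suc m) f P m ≤-refl min 1)
    from : T (j ≡ᵇ m) → T (IsCycleMin (suc m) f m)
    from j≡ᵇm = IsCycleMin⁺ (suc m) f m (λ a → ≤-reflexive (sym (fixed a)))
      where
      fm≡m : f m ≡ m
      fm≡m = trans (cong f (sym (≡ᵇ⇒≡ j m j≡ᵇm))) fj≡m
      fixed : ∀ a → f ^[ a ] m ≡ m
      fixed zero    = refl
      fixed (suc a) = trans (cong f (fixed a)) fm≡m

  cycles-erase : cycles (suc m) f ≡ cycles m g + ⟦ j ≡ᵇ m ⟧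
  cycles-erase = trans (∑<-suc m _) (cong₂ _+_ (count-cong m cycleMin-erase) (cong ⟦_⟧ cycleMin-top))

  row : (ℕ → ℕ) → ℕ → ℕ → Bool
  row h x y = (x <ᵇ y) ∧ (h y <ᵇ h x)

  I-rows : I (suc m) f ≡ ∑[ x < m ] (count m (row f x) + ⟦ (x <ᵇ m) ∧ (k <ᵇ f x) ⟧)
  I-rows = begin
    ∑[ x < suc m ] count (suc m) (row f x)                          ≡⟨ ∑<-suc m _ ⟩
    ∑[ x < m ] count (suc m) (row f x) + count (suc m) (row f m)    ≡⟨ cong₂ _+_ (∑<-cong m (λ x _ → ∑<-suc m _)) last-row ⟩
    ∑[ x < m ] (count m (row f x) + ⟦ row f x m ⟧) + 0               ≡⟨ +-identityʳ _ ⟩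
    ∑[ x < m ] (count m (row f x) + ⟦ (x <ᵇ m) ∧ (k <ᵇ f x) ⟧)       ∎
    where
    open ≡-Reasoning
    last-row : count (suc m) (row f m) ≡ 0
    last-row = ∑<-zero (suc m) λ y y<n → cong (λ b → ⟦ b ∧ (f y <ᵇ k) ⟧) (<ᵇ-false (λ m<y → <⇒≱ m<y (s≤s⁻¹ y<n)))

  A B C : ℕ
  A = count m (λ y → (j <ᵇ y) ∧ (f y <ᵇ k))
  B = count m (λ y → (j <ᵇ y) ∧ (k <ᵇ f y))
  C = count m (λ p → (p <ᵇ j) ∧ (k <ᵇ f p))

  excess : ℕ
  excess = if k <ᵇ j then A else C

  module AtTop (j≡m : j ≡ m) where

    k≡m : k ≡ m
    k≡m = trans (cong f (sym j≡m)) fj≡m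

    g≗f : g ≗[ m ] f
    g≗f z z<m = g-other z (λ z≡j → <-irrefl (trans z≡j j≡m) z<m)

    ¬k<f : ∀ x → x < suc m → (k <ᵇ f x) ≡ false
    ¬k<f x x<n = <ᵇ-false (λ k<fx → <⇒≱ (subst (_< f x) k≡m k<fx) (s≤s⁻¹ (f<n x x<n)))

    D-top : D (suc m) f ≡ D m g
    D-top = begin
      D (suc m) f                        ≡⟨ ∑<-suc m _ ⟩
      ∑[ x < m ] ∣ f x - x ∣ + ∣ k - m ∣   ≡⟨ cong₂ _+_ (∑<-cong m (λ x x<m → cong (∣_- x ∣) (sym (g≗f x x<m))))
                                                        (trans (cong (∣_- m ∣) k≡m) (∣n-n∣≡0 m)) ⟩
      D m g + 0                          ≡⟨ +-identityʳ _ ⟩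
      D m g                              ∎
      where open ≡-Reasoning

    I-top : I (suc m) f ≡ I m g
    I-top = trans I-rows (∑<-cong m λ x x<m → begin
      count m (row f x) + ⟦ (x <ᵇ m) ∧ (k <ᵇ f x) ⟧   ≡⟨ cong₂ _+_ (count-cong m (λ y y<m → cong₂ (λ a b → (x <ᵇ y) ∧ (a <ᵇ b))
                                                          (sym (g≗f y y<m)) (sym (g≗f x x<m))))
                                                        (cong (λ b → ⟦ (x <ᵇ m) ∧ b ⟧) (¬k<f x (m<n⇒m<1+n x<m))) ⟩
      count m (row g x) + ⟦ (x <ᵇ m) ∧ false ⟧         ≡⟨ cong (λ b → count m (row g x) + ⟦ b ⟧) (∧-zeroʳ _) ⟩
      count m (row g x) + 0                            ≡⟨ +-identityʳ _ ⟩
      count m (row g x)                                ∎)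
      where open ≡-Reasoning

    IT-top : IT (suc m) f ≡ IT m g
    IT-top = cong₂ (λ i c → i + (suc m ∸ c)) I-top
      (trans cycles-erase (trans (cong (λ b → cycles m g + ⟦ b ⟧) (trans (cong (_≡ᵇ m) j≡m) (≡ᵇ-refl m)))
                                 (+-comm _ 1)))

    excess-top : excess ≡ 0
    excess-top rewrite <ᵇ-false {k} {j} (λ k<j → <-irrefl (trans k≡m (sym j≡m)) k<j) =
      ∑<-zero m (λ p p<m → trans (cong (λ b → ⟦ (p <ᵇ j) ∧ b ⟧) (¬k<f p (m<n⇒m<1+n p<m))) (cong ⟦_⟧ (∧-zeroʳ _)))

  module Inside (j<m : j < m) where

    k<m : k < m
    k<m = f<m m ≤-refl (λ m≡j → <-irrefl (sym m≡j) j<m)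

    f≢k : ∀ y → y < m → f y ≢ k
    f≢k y y<m fy≡k = <-irrefl (f-inj y m (m<n⇒m<1+n y<m) ≤-refl fy≡k) y<m

    D-inside : D (suc m) f + ∣ k - j ∣ ≡ D m g + ∣ m - j ∣ + ∣ k - m ∣
    D-inside = begin
      D (suc m) f + ∣ k - j ∣                       ≡⟨ cong (_+ ∣ k - j ∣) (∑<-suc m _) ⟩
      ∑[ x < m ] ∣ f x - x ∣ + ∣ k - m ∣ + ∣ k - j ∣  ≡⟨ xy∙z≈xz∙y (∑[ x < m ] ∣ f x - x ∣) _ _ ⟩
      ∑[ x < m ] ∣ f x - x ∣ + ∣ k - j ∣ + ∣ k - m ∣  ≡⟨ cong (λ v → ∑[ x < m ] ∣ f x - x ∣ + ∣ v - j ∣ + ∣ k - m ∣) (sym g-at) ⟩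
      ∑[ x < m ] ∣ f x - x ∣ + ∣ g j - j ∣ + ∣ k - m ∣ ≡⟨ cong (_+ ∣ k - m ∣) (∑<-update m _ _ j j<m
                                                         (λ x _ x≢j → cong (∣_- x ∣) (sym (g-other x x≢j)))) ⟩
      D m g + ∣ f j - j ∣ + ∣ k - m ∣                ≡⟨ cong (λ v → D m g + ∣ v - j ∣ + ∣ k - m ∣) fj≡m ⟩
      D m g + ∣ m - j ∣ + ∣ k - m ∣                  ∎
      where open ≡-Reasoning

    row-other : ∀ x → x < m → x ≢ j →
      count m (row f x) + ⟦ (x <ᵇ m) ∧ (k <ᵇ f x) ⟧ ≡ count m (row g x) + ⟦ (j <ᵇ x) ∧ (k <ᵇ f x) ⟧
    row-other x x<m x≢j = begin
      Rf + ⟦ (x <ᵇ m) ∧ k<fx ⟧              ≡⟨ cong (λ b → Rf + ⟦ b ∧ k<fx ⟧) (<ᵇ-true x<m) ⟩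
      Rf + ⟦ k<fx ⟧                         ≡⟨ cong (Rf +_) (sym (⟦⟧-split-<ˡ x j k<fx x≢j)) ⟩
      Rf + (⟦ (x <ᵇ j) ∧ k<fx ⟧ + ⟦ after ⟧)  ≡⟨ sym (+-assoc Rf _ _) ⟩
      Rf + ⟦ (x <ᵇ j) ∧ k<fx ⟧ + ⟦ after ⟧    ≡⟨ cong (λ b → Rf + ⟦ b ⟧ + ⟦ after ⟧) (sym row-g-x-j) ⟩
      Rf + ⟦ row g x j ⟧ + ⟦ after ⟧         ≡⟨ cong (_+ ⟦ after ⟧) (∑<-update m _ _ j j<m rows-agree) ⟩
      Rg + ⟦ row f x j ⟧ + ⟦ after ⟧         ≡⟨ cong (λ b → Rg + ⟦ b ⟧ + ⟦ after ⟧) row-f-x-j ⟩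
      Rg + 0 + ⟦ after ⟧                     ≡⟨ cong (_+ ⟦ after ⟧) (+-identityʳ Rg) ⟩
      Rg + ⟦ after ⟧                         ∎
      where
      open ≡-Reasoning
      Rf Rg : ℕ
      Rf = count m (row f x)
      Rg = count m (row g x)
      k<fx after : Bool
      k<fx  = k <ᵇ f x
      after = (j <ᵇ x) ∧ (k <ᵇ f x)
      row-g-x-j : row g x j ≡ (x <ᵇ j) ∧ k<fx
      row-g-x-j = cong₂ (λ a b → (x <ᵇ j) ∧ (a <ᵇ b)) g-at (g-other x x≢j)
      rows-agree : ∀ y → y < m → y ≢ j → ⟦ row f x y ⟧ ≡ ⟦ row g x y ⟧
      rows-agree y _ y≢j = cong₂ (λ a b → ⟦ (x <ᵇ y) ∧ (a <ᵇ b) ⟧) (sym (g-other y y≢j)) (sym (g-other x x≢j))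
      row-f-x-j : row f x j ≡ false
      row-f-x-j rewrite fj≡m | <ᵇ-false (<-asym (f<m x (m<n⇒m<1+n x<m) x≢j)) = ∧-zeroʳ _

    row-j : count m (row f j) + ⟦ (j <ᵇ m) ∧ (k <ᵇ f j) ⟧ ≡ m ∸ j
    row-j = begin
      count m (row f j) + ⟦ (j <ᵇ m) ∧ (k <ᵇ f j) ⟧   ≡⟨ cong₂ _+_ (count-cong m above) (cong₂ (λ a b → ⟦ a ∧ b ⟧) (<ᵇ-true j<m)
                                                                                      (trans (cong (k <ᵇ_) fj≡m) (<ᵇ-true k<m))) ⟩
      count m (j <ᵇ_) + 1                              ≡⟨ cong (_+ 1) (count-above m j) ⟩
      m ∸ suc j + 1                                    ≡⟨ +-comm _ 1 ⟩
      suc (m ∸ suc j)                                  ≡⟨ sym (n∸x≡1+n∸1+x m j j<m) ⟩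
      m ∸ j                                            ∎
      where
      open ≡-Reasoning
      above : ∀ y → y < m → row f j y ≡ (j <ᵇ y)
      above y y<m with y ≟ j
      ... | yes refl rewrite <ᵇ-false (<-irrefl {y} refl) = refl
      ... | no  y≢j  rewrite fj≡m | <ᵇ-true (f<m y (m<n⇒m<1+n y<m) y≢j) = ∧-identityʳ _

    row-j-erased : count m (row g j) ≡ A
    row-j-erased = count-cong m λ y y<m → case (y ≟ j)
      where
      case : ∀ {y} → Dec (y ≡ j) → row g j y ≡ ((j <ᵇ y) ∧ (f y <ᵇ k))
      case (yes refl) rewrite <ᵇ-false (<-irrefl {j} refl) = refl
      case {y} (no y≢j) = cong₂ (λ a b → (j <ᵇ y) ∧ (a <ᵇ b)) (g-other y y≢j) g-at

    I-inside : I (suc m) f + A ≡ I m g + (m ∸ j) + B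
    I-inside = begin
      I (suc m) f + A           ≡⟨ cong₂ _+_ I-rows (sym G′-j) ⟩
      ∑< m F + G′ j             ≡⟨ ∑<-update m F G′ j j<m row-other ⟩
      ∑< m G′ + F j             ≡⟨ cong₂ _+_ (∑<-distrib-+ m _ _) row-j ⟩
      I m g + B + (m ∸ j)       ≡⟨ xy∙z≈xz∙y (I m g) B (m ∸ j) ⟩
      I m g + (m ∸ j) + B       ∎
      where
      open ≡-Reasoning
      F G′ : ℕ → ℕ
      F x  = count m (row f x) + ⟦ (x <ᵇ m) ∧ (k <ᵇ f x) ⟧
      G′ x = count m (row g x) + ⟦ (j <ᵇ x) ∧ (k <ᵇ f x) ⟧
      G′-j : G′ j ≡ A
      G′-j rewrite <ᵇ-false (<-irrefl {j} refl) = trans (+-identityʳ _) row-j-erased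

    A+B : A + B + suc j ≡ m
    A+B = begin
      A + B + suc j                   ≡⟨ cong (_+ suc j) (sym (∑<-distrib-+ m _ _)) ⟩
      ∑[ y < m ] (⟦ (j <ᵇ y) ∧ (f y <ᵇ k) ⟧ + ⟦ (j <ᵇ y) ∧ (k <ᵇ f y) ⟧) + suc j
                                      ≡⟨ cong (_+ suc j) (∑<-cong m (λ y y<m → ⟦⟧-split-<ʳ (j <ᵇ y) (f y) k (f≢k y y<m))) ⟩
      count m (j <ᵇ_) + suc j         ≡⟨ cong (_+ suc j) (count-above m j) ⟩
      m ∸ suc j + suc j               ≡⟨ m∸n+n≡m j<m ⟩
      m                               ∎
      where open ≡-Reasoning

    C+B : C + B + suc k ≡ m
    C+B = begin
      C + B + suc k                                        ≡⟨ cong (_+ suc k) (sym above-k-by-position) ⟩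
      ∑[ p < suc m ] ⟦ (k <ᵇ f p) ∧ (f p <ᵇ m) ⟧ + suc k  ≡⟨ cong (_+ suc k) (∑<-permute (suc m) f P (λ v → ⟦ (k <ᵇ v) ∧ (v <ᵇ m) ⟧)) ⟩
      ∑[ v < suc m ] ⟦ (k <ᵇ v) ∧ (v <ᵇ m) ⟧ + suc k      ≡⟨ cong (_+ suc k) above-k-by-value ⟩
      m ∸ suc k + suc k                                    ≡⟨ m∸n+n≡m k<m ⟩
      m                                                    ∎
      where
      open ≡-Reasoning
      above-k-by-position : ∑[ p < suc m ] ⟦ (k <ᵇ f p) ∧ (f p <ᵇ m) ⟧ ≡ C + B
      above-k-by-position = begin
        ∑[ p < suc m ] ⟦ (k <ᵇ f p) ∧ (f p <ᵇ m) ⟧                ≡⟨ ∑<-suc m _ ⟩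
        ∑[ p < m ] ⟦ (k <ᵇ f p) ∧ (f p <ᵇ m) ⟧ + ⟦ (k <ᵇ k) ∧ (k <ᵇ m) ⟧
                                                                   ≡⟨ cong₂ _+_ (∑<-cong m split) (cong (λ b → ⟦ b ∧ (k <ᵇ m) ⟧) (<ᵇ-false (<-irrefl {k} refl))) ⟩
        ∑[ p < m ] (⟦ (p <ᵇ j) ∧ (k <ᵇ f p) ⟧ + ⟦ (j <ᵇ p) ∧ (k <ᵇ f p) ⟧) + 0
                                                                   ≡⟨ trans (+-identityʳ _) (∑<-distrib-+ m _ _) ⟩
        C + B                                                      ∎
        where
        split : ∀ p → p < m → ⟦ (k <ᵇ f p) ∧ (f p <ᵇ m) ⟧ ≡ ⟦ (p <ᵇ j) ∧ (k <ᵇ f p) ⟧ + ⟦ (j <ᵇ p) ∧ (k <ᵇ f p) ⟧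
        split p p<m with p ≟ j
        ... | yes refl rewrite fj≡m | <ᵇ-false (<-irrefl {m} refl) | <ᵇ-false (<-irrefl {p} refl) = cong ⟦_⟧ (∧-zeroʳ _)
        ... | no  p≢j  rewrite <ᵇ-true (f<m p (m<n⇒m<1+n p<m) p≢j) =
          trans (cong ⟦_⟧ (∧-identityʳ _)) (sym (⟦⟧-split-<ˡ p j _ p≢j))
      above-k-by-value : ∑[ v < suc m ] ⟦ (k <ᵇ v) ∧ (v <ᵇ m) ⟧ ≡ m ∸ suc k
      above-k-by-value = begin
        ∑[ v < suc m ] ⟦ (k <ᵇ v) ∧ (v <ᵇ m) ⟧            ≡⟨ ∑<-suc m _ ⟩
        ∑[ v < m ] ⟦ (k <ᵇ v) ∧ (v <ᵇ m) ⟧ + ⟦ (k <ᵇ m) ∧ (m <ᵇ m) ⟧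
                                                          ≡⟨ cong₂ _+_ (∑<-cong m below-m) at-m ⟩
        count m (k <ᵇ_) + 0                               ≡⟨ trans (+-identityʳ _) (count-above m k) ⟩
        m ∸ suc k                                         ∎
        where
        below-m : ∀ v → v < m → ⟦ (k <ᵇ v) ∧ (v <ᵇ m) ⟧ ≡ ⟦ k <ᵇ v ⟧
        below-m v v<m rewrite <ᵇ-true v<m = cong ⟦_⟧ (∧-identityʳ _)
        at-m : ⟦ (k <ᵇ m) ∧ (m <ᵇ m) ⟧ ≡ 0
        at-m rewrite <ᵇ-false (<-irrefl {m} refl) = cong ⟦_⟧ (∧-zeroʳ _)

    IT-inside : IT (suc m) f ≡ I (suc m) f + suc (m ∸ cycles m g)
    IT-inside = begin
      I (suc m) f + (suc m ∸ cycles (suc m) f)          ≡⟨ cong (λ c → I (suc m) f + (suc m ∸ c)) cycles-erase ⟩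
      I (suc m) f + (suc m ∸ (cycles m g + ⟦ j ≡ᵇ m ⟧))  ≡⟨ cong (λ b → I (suc m) f + (suc m ∸ (cycles m g + ⟦ b ⟧))) (≡ᵇ-false (<⇒≢ j<m)) ⟩
      I (suc m) f + (suc m ∸ (cycles m g + 0))          ≡⟨ cong (λ c → I (suc m) f + (suc m ∸ c)) (+-identityʳ (cycles m g)) ⟩
      I (suc m) f + (suc m ∸ cycles m g)                ≡⟨ cong (I (suc m) f +_) (+-∸-assoc 1 (count≤ m _)) ⟩
      I (suc m) f + suc (m ∸ cycles m g)                ∎
      where open ≡-Reasoning

    key : D (suc m) f + IT m g ≡ D m g + IT (suc m) f + 2 * excess
    key rewrite IT-inside with <-cmp k j
    ... | tri< k<j _ _ rewrite <ᵇ-true k<j =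
      excess-arith-< (D (suc m) f) (D m g) (I (suc m) f) (I m g) A B (m ∸ cycles m g) k<j j<m D-inside I-inside A+B
    ... | tri≈ _ k≡j _ rewrite <ᵇ-false (<-irrefl k≡j) =
      excess-arith-≥ (D (suc m) f) (D m g) (I (suc m) f) (I m g) A B C (m ∸ cycles m g) (≤-reflexive (sym k≡j)) k<m D-inside I-inside A+B C+B
    ... | tri> _ _ j<k rewrite <ᵇ-false (<-asym j<k) =
      excess-arith-≥ (D (suc m) f) (D m g) (I (suc m) f) (I m g) A B C (m ∸ cycles m g) (<⇒≤ j<k) k<m D-inside I-inside A+B C+B

  excess-identity : D (suc m) f + IT m g ≡ D m g + IT (suc m) f + 2 * excess
  excess-identity with m ≟ j
  ... | yes m≡j = begin
    D (suc m) f + IT m g                  ≡⟨ cong₂ _+_ D-top (sym IT-top) ⟩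
    D m g + IT (suc m) f                  ≡⟨ sym (+-identityʳ _) ⟩
    D m g + IT (suc m) f + 0              ≡⟨ cong (λ e → D m g + IT (suc m) f + 2 * e) (sym excess-top) ⟩
    D m g + IT (suc m) f + 2 * excess     ∎
    where
    open ≡-Reasoning
    open AtTop (sym m≡j)
  ... | no m≢j = Inside.key (<1+n∧≢⇒< j<n (m≢j ∘ sym))

Shallow : ℕ → (ℕ → ℕ) → Set
Shallow n f = IT n f ≡ D n f

IT≤D : ∀ n f → Perm n f → IT n f ≤ D n f
IT≤D zero    f P = z≤n
IT≤D (suc m) f P = +-cancelʳ-≤ (IT m g) (IT (suc m) f) (D (suc m) f) (begin
  IT (suc m) f + IT m g                   ≤⟨ +-monoʳ-≤ (IT (suc m) f) (IT≤D m g g-perm) ⟩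
  IT (suc m) f + D m g                    ≡⟨ +-comm (IT (suc m) f) (D m g) ⟩
  D m g + IT (suc m) f                    ≤⟨ m≤m+n _ (2 * excess) ⟩
  D m g + IT (suc m) f + 2 * excess       ≡⟨ sym excess-identity ⟩
  D (suc m) f + IT m g                    ∎)
  where
  open ≤-Reasoning
  open Inverse (suc m) f P
  open EraseMax m f P (f⁻¹ m) (f⁻¹< m ≤-refl) (f∘f⁻¹ m ≤-refl)

module ShallowErase (m : ℕ) (f : ℕ → ℕ) (P : Perm (suc m) f) (j : ℕ) (j<n : j < suc m) (fj≡m : f j ≡ m) where
  open EraseMax m f P j j<n fj≡m public

  shallow⇒ : Shallow (suc m) f → Shallow m g × excess ≡ 0
  shallow⇒ shallow = ≤-antisym (IT≤D m g g-perm) Dg≤ITg , double≤0⇒≡0 excess twice-excess≤0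
    where
    open ≤-Reasoning
    Dg+2e≤ITg : D m g + 2 * excess ≤ IT m g
    Dg+2e≤ITg = +-cancelˡ-≤ (D (suc m) f) _ _ (begin
      D (suc m) f + (D m g + 2 * excess)    ≡⟨ x∙yz≈yx∙z (D (suc m) f) (D m g) _ ⟩
      D m g + D (suc m) f + 2 * excess      ≡⟨ cong (λ d → D m g + d + 2 * excess) (sym shallow) ⟩
      D m g + IT (suc m) f + 2 * excess     ≡⟨ sym excess-identity ⟩
      D (suc m) f + IT m g                  ∎)
    Dg≤ITg : D m g ≤ IT m g
    Dg≤ITg = ≤-trans (m≤m+n (D m g) _) Dg+2e≤ITg
    twice-excess≤0 : 2 * excess ≤ 0
    twice-excess≤0 = +-cancelˡ-≤ (D m g) _ 0 (begin
      D m g + 2 * excess   ≤⟨ Dg+2e≤ITg ⟩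
      IT m g               ≤⟨ IT≤D m g g-perm ⟩
      D m g                ≡⟨ sym (+-identityʳ _) ⟩
      D m g + 0            ∎)
    double≤0⇒≡0 : ∀ e → 2 * e ≤ 0 → e ≡ 0
    double≤0⇒≡0 zero _ = refl

  shallow⇐ : Shallow m g → excess ≡ 0 → Shallow (suc m) f
  shallow⇐ shallow-g excess≡0 = sym (+-cancelʳ-≡ (IT m g) _ _ (begin
    D (suc m) f + IT m g                   ≡⟨ excess-identity ⟩
    D m g + IT (suc m) f + 2 * excess      ≡⟨ cong (λ e → D m g + IT (suc m) f + 2 * e) excess≡0 ⟩
    D m g + IT (suc m) f + 0               ≡⟨ +-identityʳ _ ⟩
    D m g + IT (suc m) f                   ≡⟨ +-comm (D m g) _ ⟩
    IT (suc m) f + D m g                   ≡⟨ cong (IT (suc m) f +_) (sym shallow-g) ⟩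
    IT (suc m) f + IT m g                  ∎))
    where open ≡-Reasoning

  unshallow : (k < j → ∃ λ y → j < y × y < m × f y < k) → (j ≤ k → ∃ λ p → p < j × k < f p) → ¬ Shallow (suc m) f
  unshallow below-right above-left shallow with proj₂ (shallow⇒ shallow) | k <? j
  ... | excess≡0 | yes k<j with below-right k<j
  ...   | y , j<y , y<m , fy<k = 0<A (subst (λ b → (if b then A else C) ≡ 0) (<ᵇ-true k<j) excess≡0)
    where
    0<A : A ≢ 0
    0<A A≡0 = <-irrefl (sym A≡0) (count-pos m _ y y<m (Equivalence.from T-∧ (<⇒<ᵇ j<y , <⇒<ᵇ fy<k)))
  unshallow below-right above-left shallow | excess≡0 | no k≮j with above-left (≮⇒≥ k≮j)
  ...   | p , p<j , k<fp = 0<C (subst (λ b → (if b then A else C) ≡ 0) (<ᵇ-false k≮j) excess≡0)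
    where
    0<C : C ≢ 0
    0<C C≡0 = <-irrefl (sym C≡0) (count-pos m _ p (<-≤-trans p<j (s≤s⁻¹ j<n)) (Equivalence.from T-∧ (<⇒<ᵇ p<j , <⇒<ᵇ k<fp)))

-- Reverse-complement and inverse

opposite : ℕ → ℕ → ℕ
opposite n x = n ∸ suc x

opposite< : ∀ n x → x < n → opposite n x < n
opposite< (suc n) x _ = s≤s (m∸n≤m n x)

opposite-involutive : ∀ n x → x < n → opposite n (opposite n x) ≡ x
opposite-involutive (suc n) x x<n = m∸[m∸n]≡n (s≤s⁻¹ x<n)

opposite-injective : ∀ n a b → a < n → b < n → opposite n a ≡ opposite n b → a ≡ b
opposite-injective n a b a<n b<n e =
  trans (sym (opposite-involutive n a a<n)) (trans (cong (opposite n) e) (opposite-involutive n b b<n))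

opposite-mono-< : ∀ n a b → a < b → b < n → opposite n b < opposite n a
opposite-mono-< (suc n) a b a<b b<n = ∸-monoʳ-< a<b (s≤s⁻¹ b<n)

opposite-cancel-< : ∀ n a b → opposite n a < opposite n b → b < a
opposite-cancel-< (suc n) a b lt = ∸-cancelʳ-< {a} {b} {n} lt

opposite-<ᵇ : ∀ n a b → a < n → b < n → (opposite n a <ᵇ opposite n b) ≡ (b <ᵇ a)
opposite-<ᵇ n a b a<n b<n = T⇔T⇒≡
  (λ lt → <⇒<ᵇ (opposite-cancel-< n a b (<ᵇ⇒< _ _ lt)))
  (λ lt → <⇒<ᵇ (opposite-mono-< n b a (<ᵇ⇒< _ _ lt) a<n))

∣opposite-opposite∣ : ∀ n a b → a < n → b < n → ∣ opposite n a - opposite n b ∣ ≡ ∣ a - b ∣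
∣opposite-opposite∣ (suc n) a b a<n b<n = begin
  ∣ n ∸ a - n ∸ b ∣                          ≡⟨ sym (∣m+n-m+o∣≡∣n-o∣ (a + b) (n ∸ a) (n ∸ b)) ⟩
  ∣ (a + b) + (n ∸ a) - (a + b) + (n ∸ b) ∣  ≡⟨ cong₂ ∣_-_∣ (trans (cong (_+ (n ∸ a)) (+-comm a b)) (shift b a (s≤s⁻¹ a<n)))
                                                         (shift a b (s≤s⁻¹ b<n)) ⟩
  ∣ b + n - a + n ∣                          ≡⟨ cong₂ ∣_-_∣ (+-comm b n) (+-comm a n) ⟩
  ∣ n + b - n + a ∣                          ≡⟨ ∣m+n-m+o∣≡∣n-o∣ n b a ⟩
  ∣ b - a ∣                                  ≡⟨ ∣-∣-comm b a ⟩
  ∣ a - b ∣                                  ∎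
  where
  open ≡-Reasoning
  shift : ∀ x y → y ≤ n → (x + y) + (n ∸ y) ≡ x + n
  shift x y y≤n = trans (+-assoc x y (n ∸ y)) (cong (x +_) (m+[n∸m]≡n y≤n))

rc : ℕ → (ℕ → ℕ) → ℕ → ℕ
rc n f x = opposite n (f (opposite n x))

rc-perm : ∀ n f → Perm n f → Perm n (rc n f)
rc-perm n f (f<n , f-inj) = (λ x x<n → opposite< n _ (f<n _ (opposite< n x x<n))) , λ x y x<n y<n e →
  opposite-injective n x y x<n y<n (f-inj _ _ (opposite< n x x<n) (opposite< n y y<n)
    (opposite-injective n _ _ (f<n _ (opposite< n x x<n)) (f<n _ (opposite< n y y<n)) e))

rc-involutive : ∀ n f → Endo n f → rc n (rc n f) ≗[ n ] f
rc-involutive n f f<n x x<n =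
  trans (opposite-involutive n _ (f<n _ (opposite< n _ (opposite< n x x<n)))) (cong f (opposite-involutive n x x<n))

D-rc : ∀ n f → Endo n f → D n (rc n f) ≡ D n f
D-rc n f f<n = begin
  ∑[ x < n ] ∣ opposite n (f (opposite n x)) - x ∣                    ≡⟨ ∑<-cong n (λ x x<n → cong (∣ opposite n (f (opposite n x)) -_∣)
                                                                            (sym (opposite-involutive n x x<n))) ⟩
  ∑[ x < n ] ∣ opposite n (f (opposite n x)) - opposite n (opposite n x) ∣ ≡⟨ ∑<-reverse n (λ y → ∣ opposite n (f y) - opposite n y ∣) ⟩
  ∑[ y < n ] ∣ opposite n (f y) - opposite n y ∣                      ≡⟨ ∑<-cong n (λ y y<n → ∣opposite-opposite∣ n (f y) y (f<n y y<n) y<n) ⟩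
  D n f                                                               ∎
  where open ≡-Reasoning

I-rc : ∀ n f → Endo n f → I n (rc n f) ≡ I n f
I-rc n f f<n = begin
  ∑[ x < n ] ∑[ y < n ] ⟦ (x <ᵇ y) ∧ (rc n f y <ᵇ rc n f x) ⟧
    ≡⟨ ∑<-cong n (λ x x<n → ∑<-cong n (λ y y<n → cong ⟦_⟧ (cong₂ _∧_ (positions x y x<n y<n) (values x y x<n y<n)))) ⟩
  ∑[ x < n ] ∑[ y < n ] ⟦ (opposite n y <ᵇ opposite n x) ∧ (f (opposite n x) <ᵇ f (opposite n y)) ⟧
    ≡⟨ ∑<-cong n (λ x _ → ∑<-reverse n (λ y → ⟦ (y <ᵇ opposite n x) ∧ (f (opposite n x) <ᵇ f y) ⟧)) ⟩
  ∑[ x < n ] ∑[ y < n ] ⟦ (y <ᵇ opposite n x) ∧ (f (opposite n x) <ᵇ f y) ⟧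
    ≡⟨ ∑<-reverse n (λ x → ∑[ y < n ] ⟦ (y <ᵇ x) ∧ (f x <ᵇ f y) ⟧) ⟩
  ∑[ x < n ] ∑[ y < n ] ⟦ (y <ᵇ x) ∧ (f x <ᵇ f y) ⟧
    ≡⟨ ∑<-comm n n (λ x y → ⟦ (y <ᵇ x) ∧ (f x <ᵇ f y) ⟧) ⟩
  I n f ∎
  where
  open ≡-Reasoning
  positions : ∀ x y → x < n → y < n → (x <ᵇ y) ≡ (opposite n y <ᵇ opposite n x)
  positions x y x<n y<n = trans (cong₂ _<ᵇ_ (sym (opposite-involutive n x x<n)) (sym (opposite-involutive n y y<n)))
                                (opposite-<ᵇ n (opposite n x) (opposite n y) (opposite< n x x<n) (opposite< n y y<n))
  values : ∀ x y → x < n → y < n → (rc n f y <ᵇ rc n f x) ≡ (f (opposite n x) <ᵇ f (opposite n y))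
  values x y x<n y<n = opposite-<ᵇ n _ _ (f<n _ (opposite< n y y<n)) (f<n _ (opposite< n x x<n))

^-rc : ∀ n f → Endo n f → ∀ k x → x < n → rc n f ^[ k ] x ≡ opposite n (f ^[ k ] (opposite n x))
^-rc n f f<n zero    x x<n = sym (opposite-involutive n x x<n)
^-rc n f f<n (suc k) x x<n = trans (cong (rc n f) (^-rc n f f<n k x x<n))
  (cong (opposite n ∘ f) (opposite-involutive n _ (^-endo n f f<n k (opposite n x) (opposite< n x x<n))))

IsCycleMax : ℕ → (ℕ → ℕ) → ℕ → Bool
IsCycleMax n f x = all< n (λ k → not (x <ᵇ f ^[ k ] x))

cycleMaxima : ℕ → (ℕ → ℕ) → ℕ
cycleMaxima n f = count n (IsCycleMax n f)

IsCycleMax⁻ : ∀ n f → Perm n f → ∀ x → x < n → T (IsCycleMax n f x) → ∀ k → f ^[ k ] x ≤ x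
IsCycleMax⁻ n f P x x<n max k with orbit-bounded n f P x x<n k
... | r , r<n , fᵏx≡fʳx = subst (_≤ x) (sym fᵏx≡fʳx)
  (≮⇒≥ (λ x<fʳx → subst T (cong not (<ᵇ-true x<fʳx)) (all<⁻ n max r r<n)))

IsCycleMax⁺ : ∀ n f x → (∀ k → f ^[ k ] x ≤ x) → T (IsCycleMax n f x)
IsCycleMax⁺ n f x max = all<⁺ n (λ k _ → subst T (cong not (sym (<ᵇ-false (≤⇒≯ (max k))))) tt)

cycles-rc≡cycleMaxima : ∀ n f → Endo n f → cycles n (rc n f) ≡ cycleMaxima n f
cycles-rc≡cycleMaxima n f f<n =
  trans (∑<-cong n (λ x x<n → cong ⟦_⟧ (min≡max x x<n))) (∑<-reverse n (λ y → ⟦ IsCycleMax n f y ⟧))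
  where
  min≡max : ∀ x → x < n → IsCycleMin n (rc n f) x ≡ IsCycleMax n f (opposite n x)
  min≡max x x<n = all<-cong n λ k _ → cong not (begin
    rc n f ^[ k ] x <ᵇ x                                     ≡⟨ cong₂ _<ᵇ_ (^-rc n f f<n k x x<n) (sym (opposite-involutive n x x<n)) ⟩
    opposite n (f ^[ k ] (opposite n x)) <ᵇ opposite n (opposite n x) ≡⟨ opposite-<ᵇ n _ _ (^-endo n f f<n k _ (opposite< n x x<n))
                                                                                         (opposite< n x x<n) ⟩
    opposite n x <ᵇ f ^[ k ] (opposite n x)                  ∎)
    where open ≡-Reasoning

argmax : ∀ n (h : ℕ → ℕ) → 0 < n → ∃ λ b → b < n × (∀ b′ → b′ < n → h b′ ≤ h b)
argmax (suc zero)    h _ = 0 , z<s , λ { zero _ → ≤-refl ; (suc b′) (s<s ()) }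
argmax (suc (suc n)) h _ with argmax (suc n) h z<s
... | b , b<n , max with h b ≤? h (suc n)
...   | yes hb≤ = suc n , ≤-refl , λ b′ b′<n → case (b′ ≟ suc n) b′<n
  where
  case : ∀ {b′} → Dec (b′ ≡ suc n) → b′ < suc (suc n) → h b′ ≤ h (suc n)
  case (yes refl) _     = ≤-refl
  case (no  b′≢)  b′<n = ≤-trans (max _ (<1+n∧≢⇒< b′<n b′≢)) hb≤
...   | no  hb≰ = b , m<n⇒m<1+n b<n , λ b′ b′<n → case (b′ ≟ suc n) b′<n
  where
  case : ∀ {b′} → Dec (b′ ≡ suc n) → b′ < suc (suc n) → h b′ ≤ h b
  case (yes refl) _     = <⇒≤ (≰⇒> hb≰)
  case (no  b′≢)  b′<n = max _ (<1+n∧≢⇒< b′<n b′≢)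

module CycleMaximaErase (m : ℕ) (f : ℕ → ℕ) (P : Perm (suc m) f) (j : ℕ) (j<n : j < suc m) (fj≡m : f j ≡ m) where
  open EraseMax m f P j j<n fj≡m

  reaches-j : ℕ → Bool
  reaches-j x = any< m (λ b → g ^[ b ] x ≡ᵇ j)

  max-erase : ∀ x → x < m → ⟦ IsCycleMax (suc m) f x ⟧ + ⟦ IsCycleMax m g x ∧ reaches-j x ⟧ ≡ ⟦ IsCycleMax m g x ⟧
  max-erase x x<m with reaches-j x in reach
  ... | true  = cong₂ _+_ (⟦⟧-false not-max) (cong ⟦_⟧ (∧-identityʳ _))
    where
    not-max : ¬ T (IsCycleMax (suc m) f x)
    not-max max with any<⁻ m (subst T (sym reach) tt)
    ... | b , _ , gᵇx≡ᵇj with g-orbit⊆f-orbit x x<m b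
    ...   | b′ , gᵇx≡fᵇ′x = <⇒≱ x<m (subst (_≤ x) f-reaches-m (IsCycleMax⁻ (suc m) f P x (m<n⇒m<1+n x<m) max (suc b′)))
      where
      f-reaches-m : f ^[ suc b′ ] x ≡ m
      f-reaches-m = trans (cong f (trans (sym gᵇx≡fᵇ′x) (≡ᵇ⇒≡ _ _ gᵇx≡ᵇj))) fj≡m
  ... | false = trans (cong₂ _+_ (cong ⟦_⟧ same) (cong ⟦_⟧ (∧-zeroʳ _))) (+-identityʳ _)
    where
    same : IsCycleMax (suc m) f x ≡ IsCycleMax m g x
    same = T⇔T⇒≡ to from
      where
      to : T (IsCycleMax (suc m) f x) → T (IsCycleMax m g x)
      to max = IsCycleMax⁺ m g x λ a → let (b , e) = g-orbit⊆f-orbit x x<m a in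
        subst (_≤ x) (sym e) (IsCycleMax⁻ (suc m) f P x (m<n⇒m<1+n x<m) max b)
      from : T (IsCycleMax m g x) → T (IsCycleMax (suc m) f x)
      from max = IsCycleMax⁺ (suc m) f x λ b → case b (f-orbit⊆g-orbit x x<m b)
        where
        case : ∀ b → (∃ λ a → (f ^[ b ] x ≡ g ^[ a ] x) ⊎ (f ^[ b ] x ≡ m × g ^[ a ] x ≡ j)) → f ^[ b ] x ≤ x
        case b (a , inj₁ e) = subst (_≤ x) (sym e) (IsCycleMax⁻ m g g-perm x x<m max a)
        case b (a , inj₂ (_ , gᵃx≡j)) with orbit-bounded m g g-perm x x<m a
        ... | r , r<m , gᵃx≡gʳx = ⊥-elim (subst T reach (any<⁺ m r r<m (≡⇒≡ᵇ _ _ (trans (sym gᵃx≡gʳx) gᵃx≡j))))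

  module OrbitOfJ (j<m : j < m) where

    highest : ∃ λ b → b < m × (∀ b′ → b′ < m → g ^[ b′ ] j ≤ g ^[ b ] j)
    highest = argmax m (λ b → g ^[ b ] j) (≤-<-trans z≤n j<m)

    b₀ M : ℕ
    b₀ = proj₁ highest
    M = g ^[ b₀ ] j

    M<m : M < m
    M<m = ^-endo m g (proj₁ g-perm) b₀ j j<m

    below-M : ∀ c → g ^[ c ] j ≤ M
    below-M c = let (r , r<m , e) = orbit-bounded m g g-perm j j<m c in subst (_≤ M) (sym e) (proj₂ (proj₂ highest) r r<m)

    M-max-reaching : T (IsCycleMax m g M ∧ reaches-j M)
    M-max-reaching = Equivalence.from (T-∧ {IsCycleMax m g M} {reaches-j M}) (M-max , M-reaches)
      where
      M-max : T (IsCycleMax m g M)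
      M-max = IsCycleMax⁺ m g M (λ a → subst (_≤ M) (^-+ g a b₀ j) (below-M (a + b₀)))
      M-reaches : T (reaches-j M)
      M-reaches with ^-return m g g-perm j b₀ j<m
      ... | c , gᶜM≡j with orbit-bounded m g g-perm M M<m c
      ...   | r , r<m , gᶜM≡gʳM = any<⁺ m r r<m (≡⇒≡ᵇ _ _ (trans (sym gᶜM≡gʳM) gᶜM≡j))

    only-M : ∀ x → x < m → x ≢ M → ⟦ IsCycleMax m g x ∧ reaches-j x ⟧ ≡ 0
    only-M x x<m x≢M with IsCycleMax m g x in max | reaches-j x in reach
    ... | false | _     = refl
    ... | true  | false = refl
    ... | true  | true  = ⊥-elim (x≢M (≤-antisym x≤M M≤x))
      where
      witness = any<⁻ m (subst T (sym reach) tt)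
      a = proj₁ witness
      gᵃx≡j : g ^[ a ] x ≡ j
      gᵃx≡j = ≡ᵇ⇒≡ _ _ (proj₂ (proj₂ witness))
      M≤x : M ≤ x
      M≤x = subst (_≤ x) (trans (^-+ g b₀ a x) (cong (g ^[ b₀ ]_) gᵃx≡j))
                  (IsCycleMax⁻ m g g-perm x x<m (subst T (sym max) tt) (b₀ + a))
      x≤M : x ≤ M
      x≤M with ^-return m g g-perm x a x<m
      ... | c , gᶜj≡x = subst (_≤ M) (trans (cong (g ^[ c ]_) (sym gᵃx≡j)) gᶜj≡x) (below-M c)

    one-maximum-reaching-j : ∑[ x < m ] ⟦ IsCycleMax m g x ∧ reaches-j x ⟧ ≡ 1
    one-maximum-reaching-j = trans (∑<-single m _ M M<m only-M) (⟦⟧-true M-max-reaching)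

  maxima-reaching-j : ∑[ x < m ] ⟦ IsCycleMax m g x ∧ reaches-j x ⟧ ≡ ⟦ j <ᵇ m ⟧
  maxima-reaching-j with m ≟ j
  ... | yes refl rewrite <ᵇ-false (<-irrefl {m} refl) = ∑<-zero m λ x x<m →
    cong ⟦_⟧ (trans (cong (IsCycleMax m g x ∧_) (unreachable x x<m)) (∧-zeroʳ _))
    where
    unreachable : ∀ x → x < m → reaches-j x ≡ false
    unreachable x x<m = T⇔T⇒≡ (λ reach → let (b , _ , gᵇx≡ᵇm) = any<⁻ m reach in
      <-irrefl (≡ᵇ⇒≡ _ _ gᵇx≡ᵇm) (^-endo m g (proj₁ g-perm) b x x<m)) (λ ())
  ... | no m≢j = trans (OrbitOfJ.one-maximum-reaching-j j<m) (cong ⟦_⟧ (sym (<ᵇ-true j<m)))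
    where
    j<m : j < m
    j<m = <1+n∧≢⇒< j<n (m≢j ∘ sym)

  top-is-max : T (IsCycleMax (suc m) f m)
  top-is-max = IsCycleMax⁺ (suc m) f m (λ k → s≤s⁻¹ (^-endo (suc m) f f<n k m ≤-refl))

  cycleMaxima-erase : cycleMaxima (suc m) f ≡ cycleMaxima m g + ⟦ j ≡ᵇ m ⟧
  cycleMaxima-erase = +-cancelʳ-≡ ⟦ j <ᵇ m ⟧ _ _ (begin
    cycleMaxima (suc m) f + ⟦ j <ᵇ m ⟧                  ≡⟨ cong (_+ ⟦ j <ᵇ m ⟧) (trans (∑<-suc m _) (cong (Sf +_) (⟦⟧-true top-is-max))) ⟩
    Sf + 1 + ⟦ j <ᵇ m ⟧                                 ≡⟨ xy∙z≈xz∙y Sf 1 _ ⟩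
    Sf + ⟦ j <ᵇ m ⟧ + 1                                 ≡⟨ cong (λ s → Sf + s + 1) (sym maxima-reaching-j) ⟩
    Sf + ∑[ x < m ] ⟦ IsCycleMax m g x ∧ reaches-j x ⟧ + 1 ≡⟨ cong (_+ 1) (trans (sym (∑<-distrib-+ m _ _)) (∑<-cong m max-erase)) ⟩
    cycleMaxima m g + 1                                 ≡⟨ cong (cycleMaxima m g +_) (sym (one-of (<-cmp j m))) ⟩
    cycleMaxima m g + (⟦ j ≡ᵇ m ⟧ + ⟦ j <ᵇ m ⟧)          ≡⟨ sym (+-assoc (cycleMaxima m g) _ _) ⟩
    cycleMaxima m g + ⟦ j ≡ᵇ m ⟧ + ⟦ j <ᵇ m ⟧            ∎)
    where
    open ≡-Reasoning
    Sf = ∑[ x < m ] ⟦ IsCycleMax (suc m) f x ⟧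
    one-of : Tri (j < m) (j ≡ m) (j > m) → ⟦ j ≡ᵇ m ⟧ + ⟦ j <ᵇ m ⟧ ≡ 1
    one-of (tri< j<m j≢m _) rewrite ≡ᵇ-false j≢m | <ᵇ-true j<m = refl
    one-of (tri≈ _ refl _)  rewrite ≡ᵇ-refl j | <ᵇ-false (<-irrefl {j} refl) = refl
    one-of (tri> _ _ m<j)   = ⊥-elim (<⇒≱ m<j (s≤s⁻¹ j<n))

cycleMaxima≡cycles : ∀ n f → Perm n f → cycleMaxima n f ≡ cycles n f
cycleMaxima≡cycles zero    f P = refl
cycleMaxima≡cycles (suc m) f P = begin
  cycleMaxima (suc m) f          ≡⟨ cycleMaxima-erase ⟩
  cycleMaxima m g + ⟦ j ≡ᵇ m ⟧   ≡⟨ cong (_+ ⟦ j ≡ᵇ m ⟧) (cycleMaxima≡cycles m g g-perm) ⟩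
  cycles m g + ⟦ j ≡ᵇ m ⟧        ≡⟨ sym cycles-erase ⟩
  cycles (suc m) f               ∎
  where
  open ≡-Reasoning
  open Inverse (suc m) f P
  j : ℕ
  j = f⁻¹ m
  open EraseMax m f P j (f⁻¹< m ≤-refl) (f∘f⁻¹ m ≤-refl)
  open CycleMaximaErase m f P j (f⁻¹< m ≤-refl) (f∘f⁻¹ m ≤-refl)

IT-rc : ∀ n f → Perm n f → IT n (rc n f) ≡ IT n f
IT-rc n f P = cong₂ (λ i c → i + (n ∸ c)) (I-rc n f (proj₁ P))
  (trans (cycles-rc≡cycleMaxima n f (proj₁ P)) (cycleMaxima≡cycles n f P))

shallow-rc : ∀ n f → Perm n f → Shallow n f → Shallow n (rc n f)
shallow-rc n f P shallow = trans (IT-rc n f P) (trans shallow (sym (D-rc n f (proj₁ P))))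

shallow-rc⁻ : ∀ n f → Perm n f → Shallow n (rc n f) → Shallow n f
shallow-rc⁻ n f P shallow = trans (sym (IT-rc n f P)) (trans shallow (D-rc n f (proj₁ P)))

D-inverse : ∀ n f → Perm n f → D n (inverse n f) ≡ D n f
D-inverse n f P = trans (sym (∑<-permute n f P (λ y → ∣ f⁻¹ y - y ∣)))
  (∑<-cong n (λ x x<n → trans (cong (∣_- f x ∣) (f⁻¹∘f x x<n)) (∣-∣-comm x (f x))))
  where open Inverse n f P

I-inverse : ∀ n f → Perm n f → I n (inverse n f) ≡ I n f
I-inverse n f P = begin
  ∑[ u < n ] count n (λ v → (u <ᵇ v) ∧ (f⁻¹ v <ᵇ f⁻¹ u))               ≡⟨ sym (∑<-permute n f P _) ⟩
  ∑[ x < n ] count n (λ v → (f x <ᵇ v) ∧ (f⁻¹ v <ᵇ f⁻¹ (f x)))        ≡⟨ ∑<-cong n (λ x _ → sym (∑<-permute n f P _)) ⟩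
  ∑[ x < n ] ∑[ y < n ] ⟦ (f x <ᵇ f y) ∧ (f⁻¹ (f y) <ᵇ f⁻¹ (f x)) ⟧  ≡⟨ ∑<-cong n (λ x x<n → ∑<-cong n (λ y y<n → cong ⟦_⟧
                                                                            (trans (cong₂ (λ a b → (f x <ᵇ f y) ∧ (a <ᵇ b)) (f⁻¹∘f y y<n) (f⁻¹∘f x x<n))
                                                                                   (∧-comm (f x <ᵇ f y) (y <ᵇ x))))) ⟩
  ∑[ x < n ] ∑[ y < n ] ⟦ (y <ᵇ x) ∧ (f x <ᵇ f y) ⟧                  ≡⟨ ∑<-comm n n _ ⟩
  I n f                                                                ∎
  where
  open ≡-Reasoning
  open Inverse n f P

cycles-inverse : ∀ n f → Perm n f → cycles n (inverse n f) ≡ cycles n f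
cycles-inverse n f P = count-cong n λ x x<n → T⇔T⇒≡ (min-transfer f⁻¹ f f⁻¹-perm P f∘f⁻¹ x x<n) (min-transfer f f⁻¹ P f⁻¹-perm f⁻¹∘f x x<n)
  where
  open Inverse n f P
  orbit-of-inverse : ∀ h h′ → Perm n h → (∀ y → y < n → h′ (h y) ≡ y) → ∀ x → x < n → ∀ r → ∃ λ k → h′ ^[ r ] x ≡ h ^[ k ] x
  orbit-of-inverse h h′ h-perm h′∘h x x<n zero = 0 , refl
  orbit-of-inverse h h′ h-perm h′∘h x x<n (suc r) with orbit-of-inverse h h′ h-perm h′∘h x x<n r
  ... | k , e with period n h h-perm (h ^[ k ] x) (^-endo n h (proj₁ h-perm) k x x<n)
  ...   | suc q , _ , _ , cycle = q + k , (begin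
    h′ (h′ ^[ r ] x)               ≡⟨ cong h′ (trans e (sym cycle)) ⟩
    h′ (h (h ^[ q ] (h ^[ k ] x))) ≡⟨ h′∘h _ (^-endo n h (proj₁ h-perm) q _ (^-endo n h (proj₁ h-perm) k x x<n)) ⟩
    h ^[ q ] (h ^[ k ] x)          ≡⟨ sym (^-+ h q k x) ⟩
    h ^[ q + k ] x                 ∎)
    where open ≡-Reasoning
  min-transfer : ∀ h h′ → Perm n h → Perm n h′ → (∀ y → y < n → h′ (h y) ≡ y) →
                 ∀ x → x < n → T (IsCycleMin n h x) → T (IsCycleMin n h′ x)
  min-transfer h h′ h-perm h′-perm h′∘h x x<n min = IsCycleMin⁺ n h′ x λ r →
    let (k , e) = orbit-of-inverse h h′ h-perm h′∘h x x<n r in subst (x ≤_) (sym e) (IsCycleMin⁻ n h h-perm x x<n min k)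

IT-inverse : ∀ n f → Perm n f → IT n (inverse n f) ≡ IT n f
IT-inverse n f P = cong₂ (λ i c → i + (n ∸ c)) (I-inverse n f P) (cycles-inverse n f P)

shallow-inverse : ∀ n f → Perm n f → Shallow n f → Shallow n (inverse n f)
shallow-inverse n f P shallow = trans (IT-inverse n f P) (trans shallow (sym (D-inverse n f P)))

inverse-involutive : ∀ n f → Perm n f → inverse n (inverse n f) ≗[ n ] f
inverse-involutive n f P y y<n = trans (cong (inverse n f⁻¹) (sym (f⁻¹∘f y y<n)))
  (Inverse.f⁻¹∘f n f⁻¹ f⁻¹-perm (f y) (proj₁ P y y<n))
  where open Inverse n f P

inverse-local : ∀ n → LocalMap n n (inverse n)
inverse-local n f f′ _ f≗f′ y _ = least-cong n _ _ (λ x x<n → cong (_≡ᵇ y) (f≗f′ x x<n))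

Contains132 : ℕ → (ℕ → ℕ) → Set
Contains132 n f = ∃ λ x → ∃ λ y → ∃ λ z → x < y × y < z × z < n × f x < f z × f z < f y

Contains213 : ℕ → (ℕ → ℕ) → Set
Contains213 n f = ∃ λ x → ∃ λ y → ∃ λ z → x < y × y < z × z < n × f y < f x × f x < f z

sameOrder-132⁻ : ∀ a b c → T (sameOrder a b c 1 3 2) → a < c × c < b
sameOrder-132⁻ a b c with a <ᵇ b | b <ᵇ a | a <ᵇ c in a<c | c <ᵇ a | b <ᵇ c | c <ᵇ b in c<b
... | true  | false | true  | false | false | true  = λ _ → <ᵇ⇒< a c (subst T (sym a<c) tt) , <ᵇ⇒< c b (subst T (sym c<b) tt)
... | false | _     | _     | _     | _     | _     = λ ()
... | true  | true  | _     | _     | _     | _     = λ ()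
... | true  | false | false | _     | _     | _     = λ ()
... | true  | false | true  | true  | _     | _     = λ ()
... | true  | false | true  | false | true  | _     = λ ()
... | true  | false | true  | false | false | false = λ ()

sameOrder-132⁺ : ∀ a b c → a < c → c < b → T (sameOrder a b c 1 3 2)
sameOrder-132⁺ a b c a<c c<b
  rewrite <ᵇ-true (<-trans a<c c<b) | <ᵇ-false (<-asym (<-trans a<c c<b)) | <ᵇ-true a<c | <ᵇ-false (<-asym a<c)
        | <ᵇ-false (<-asym c<b) | <ᵇ-true c<b = tt

sameOrder-213⁻ : ∀ a b c → T (sameOrder a b c 2 1 3) → b < a × a < c
sameOrder-213⁻ a b c with a <ᵇ b | b <ᵇ a in b<a | a <ᵇ c in a<c | c <ᵇ a | b <ᵇ c | c <ᵇ b
... | false | true  | true  | false | true  | false = λ _ → <ᵇ⇒< b a (subst T (sym b<a) tt) , <ᵇ⇒< a c (subst T (sym a<c) tt)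
... | true  | _     | _     | _     | _     | _     = λ ()
... | false | false | _     | _     | _     | _     = λ ()
... | false | true  | false | _     | _     | _     = λ ()
... | false | true  | true  | true  | _     | _     = λ ()
... | false | true  | true  | false | false | _     = λ ()
... | false | true  | true  | false | true  | true  = λ ()

sameOrder-213⁺ : ∀ a b c → b < a → a < c → T (sameOrder a b c 2 1 3)
sameOrder-213⁺ a b c b<a a<c
  rewrite <ᵇ-false (<-asym b<a) | <ᵇ-true b<a | <ᵇ-true a<c | <ᵇ-false (<-asym a<c)
        | <ᵇ-true (<-trans b<a a<c) | <ᵇ-false (<-asym (<-trans b<a a<c)) = tt

containsᵇ⁻ : ∀ s t u n f → T (containsᵇ s t u n f) →
  ∃ λ x → ∃ λ y → ∃ λ z → x < y × y < z × z < n × T (sameOrder (f x) (f y) (f z) s t u)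
containsᵇ⁻ s t u n f found with any<⁻ n found
... | x , _ , found-x with any<⁻ n found-x
...   | y , _ , found-xy with any<⁻ n found-xy
...     | z , z<n , found-xyz with Equivalence.to T-∧ found-xyz
...       | x<ᵇy , rest with Equivalence.to (T-∧ {y <ᵇ z}) rest
...         | y<ᵇz , order = x , y , z , <ᵇ⇒< x y x<ᵇy , <ᵇ⇒< y z y<ᵇz , z<n , order

containsᵇ⁺ : ∀ s t u n f x y z → x < y → y < z → z < n → T (sameOrder (f x) (f y) (f z) s t u) → T (containsᵇ s t u n f)
containsᵇ⁺ s t u n f x y z x<y y<z z<n order =
  any<⁺ n x x<n (any<⁺ n y y<n (any<⁺ n z z<n
    (Equivalence.from T-∧ (<⇒<ᵇ x<y , Equivalence.from T-∧ (<⇒<ᵇ y<z , order)))))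
  where
  y<n = <-trans y<z z<n
  x<n = <-trans x<y y<n

contains132⁻ : ∀ n f → T (containsᵇ 1 3 2 n f) → Contains132 n f
contains132⁻ n f found with containsᵇ⁻ 1 3 2 n f found
... | x , y , z , x<y , y<z , z<n , order = x , y , z , x<y , y<z , z<n , sameOrder-132⁻ (f x) (f y) (f z) order

contains132⁺ : ∀ n f → Contains132 n f → T (containsᵇ 1 3 2 n f)
contains132⁺ n f (x , y , z , x<y , y<z , z<n , fx<fz , fz<fy) =
  containsᵇ⁺ 1 3 2 n f x y z x<y y<z z<n (sameOrder-132⁺ (f x) (f y) (f z) fx<fz fz<fy)

contains213⁻ : ∀ n f → T (containsᵇ 2 1 3 n f) → Contains213 n f
contains213⁻ n f found with containsᵇ⁻ 2 1 3 n f found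
... | x , y , z , x<y , y<z , z<n , order = x , y , z , x<y , y<z , z<n , sameOrder-213⁻ (f x) (f y) (f z) order

contains213⁺ : ∀ n f → Contains213 n f → T (containsᵇ 2 1 3 n f)
contains213⁺ n f (x , y , z , x<y , y<z , z<n , fy<fx , fx<fz) =
  containsᵇ⁺ 2 1 3 n f x y z x<y y<z z<n (sameOrder-213⁺ (f x) (f y) (f z) fy<fx fx<fz)

permᵇ⁻ : ∀ n f → Endo n f → T (permᵇ n f) → Perm n f
permᵇ⁻ n f f<n distinct = f<n , inj
  where
  distinct-at : ∀ x y → x < n → y < n → T (not (x <ᵇ y) ∨ not (f x ≡ᵇ f y))
  distinct-at x y x<n y<n = all<⁻ n (all<⁻ n distinct x x<n) y y<n
  ordered : ∀ x y → x < n → y < n → x < y → f x ≢ f y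
  ordered x y x<n y<n x<y fx≡fy with Equivalence.to T-∨ (distinct-at x y x<n y<n)
  ... | inj₁ x≮y   = subst T (cong not (<ᵇ-true x<y)) x≮y
  ... | inj₂ fx≢fy = subst T (cong not (trans (cong (f x ≡ᵇ_) (sym fx≡fy)) (≡ᵇ-refl (f x)))) fx≢fy
  inj : InjectiveOn n f
  inj x y x<n y<n fx≡fy with <-cmp x y
  ... | tri< x<y _ _ = ⊥-elim (ordered x y x<n y<n x<y fx≡fy)
  ... | tri≈ _ x≡y _ = x≡y
  ... | tri> _ _ y<x = ⊥-elim (ordered y x y<n x<n y<x (sym fx≡fy))

permᵇ⁺ : ∀ n f → Perm n f → T (permᵇ n f)
permᵇ⁺ n f (_ , f-inj) = all<⁺ n λ x x<n → all<⁺ n λ y y<n → distinct x y x<n y<n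
  where
  distinct : ∀ x y → x < n → y < n → T (not (x <ᵇ y) ∨ not (f x ≡ᵇ f y))
  distinct x y x<n y<n with x <? y
  ... | yes x<y = Equivalence.from (T-∨ {not (x <ᵇ y)}) (inj₂ (subst T (cong not (sym (≡ᵇ-false (x≢y ∘ f-inj x y x<n y<n)))) tt))
    where x≢y = <⇒≢ x<y
  ... | no  x≮y = Equivalence.from T-∨ (inj₁ (subst T (cong not (sym (<ᵇ-false x≮y))) tt))

Good132 : ℕ → (ℕ → ℕ) → Set
Good132 n f = Perm n f × Shallow n f × ¬ Contains132 n f

Good213 : ℕ → (ℕ → ℕ) → Set
Good213 n f = Perm n f × Shallow n f × ¬ Contains213 n f

good132ᵇ good213ᵇ : ℕ → (ℕ → ℕ) → Bool
good132ᵇ = goodᵇ (1 ∷ 3 ∷ 2 ∷ [])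
good213ᵇ = goodᵇ (2 ∷ 1 ∷ 3 ∷ [])

goodᵇ⁻ : ∀ s t u n f → Endo n f → T (goodᵇ (s ∷ t ∷ u ∷ []) n f) → Perm n f × Shallow n f × ¬ T (containsᵇ s t u n f)
goodᵇ⁻ s t u n f f<n good with Equivalence.to T-∧ good
... | perm , rest with Equivalence.to (T-∧ {shallowᵇ n f}) rest
...   | shallow , avoids = permᵇ⁻ n f f<n perm , ≡ᵇ⇒≡ _ _ shallow ,
                           λ c → subst T (Equivalence.to T-not-≡ avoids) c

goodᵇ⁺ : ∀ s t u n f → Perm n f → Shallow n f → ¬ T (containsᵇ s t u n f) → T (goodᵇ (s ∷ t ∷ u ∷ []) n f)
goodᵇ⁺ s t u n f P shallow avoids = Equivalence.from T-∧ (permᵇ⁺ n f P ,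
  Equivalence.from T-∧ (≡⇒≡ᵇ _ _ shallow , Equivalence.from T-not-≡ (T⇔T⇒≡ (⊥-elim ∘ avoids) λ ())))

good132⁻ : ∀ n f → Endo n f → T (good132ᵇ n f) → Good132 n f
good132⁻ n f f<n good with goodᵇ⁻ 1 3 2 n f f<n good
... | P , shallow , avoids = P , shallow , avoids ∘ contains132⁺ n f

good132⁺ : ∀ n f → Good132 n f → T (good132ᵇ n f)
good132⁺ n f (P , shallow , avoids) = goodᵇ⁺ 1 3 2 n f P shallow (avoids ∘ contains132⁻ n f)

good213⁻ : ∀ n f → Endo n f → T (good213ᵇ n f) → Good213 n f
good213⁻ n f f<n good with goodᵇ⁻ 2 1 3 n f f<n good
... | P , shallow , avoids = P , shallow , avoids ∘ contains213⁺ n f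

good213⁺ : ∀ n f → Good213 n f → T (good213ᵇ n f)
good213⁺ n f (P , shallow , avoids) = goodᵇ⁺ 2 1 3 n f P shallow (avoids ∘ contains213⁻ n f)

^-cong : ∀ n f g → Endo n f → f ≗[ n ] g → ∀ k x → x < n → f ^[ k ] x ≡ g ^[ k ] x
^-cong n f g f<n f≗g zero    x x<n = refl
^-cong n f g f<n f≗g (suc k) x x<n = trans (f≗g _ (^-endo n f f<n k x x<n)) (cong g (^-cong n f g f<n f≗g k x x<n))

IT-cong : ∀ n f g → Endo n f → f ≗[ n ] g → IT n f ≡ IT n g
IT-cong n f g f<n f≗g = cong₂ (λ i c → i + (n ∸ c))
  (∑<-cong n λ x x<n → count-cong n λ y y<n → cong₂ (λ a b → (x <ᵇ y) ∧ (a <ᵇ b)) (f≗g y y<n) (f≗g x x<n))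
  (count-cong n λ x x<n → all<-cong n λ k _ → cong (λ a → not (a <ᵇ x)) (^-cong n f g f<n f≗g k x x<n))

D-cong : ∀ n f g → f ≗[ n ] g → D n f ≡ D n g
D-cong n f g f≗g = ∑<-cong n λ x x<n → cong (∣_- x ∣) (f≗g x x<n)

shallow-cong : ∀ n f g → Endo n f → f ≗[ n ] g → Shallow n f → Shallow n g
shallow-cong n f g f<n f≗g shallow = trans (sym (IT-cong n f g f<n f≗g)) (trans shallow (D-cong n f g f≗g))

goodᵇ-local : ∀ σ n → Local n (goodᵇ σ n)
goodᵇ-local (s ∷ t ∷ u ∷ []) n f g f<n f≗g = cong₂ _∧_ perm-eq (cong₂ _∧_ shallow-eq (cong not contains-eq))
  where
  perm-eq : permᵇ n f ≡ permᵇ n g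
  perm-eq = all<-cong n λ x x<n → all<-cong n λ y y<n → cong₂ (λ a b → not (x <ᵇ y) ∨ not (a ≡ᵇ b)) (f≗g x x<n) (f≗g y y<n)
  shallow-eq : shallowᵇ n f ≡ shallowᵇ n g
  shallow-eq = cong₂ _≡ᵇ_ (IT-cong n f g f<n f≗g) (D-cong n f g f≗g)
  contains-eq : containsᵇ s t u n f ≡ containsᵇ s t u n g
  contains-eq = any<-cong n λ x x<n → any<-cong n λ y y<n → any<-cong n λ z z<n →
    cong (λ w → (x <ᵇ y) ∧ (y <ᵇ z) ∧ w)
      (cong₃ (λ a b c → sameOrder a b c s t u) (f≗g x x<n) (f≗g y y<n) (f≗g z z<n))
    where
    cong₃ : ∀ {a b c a′ b′ c′ : ℕ} (h : ℕ → ℕ → ℕ → Bool) → a ≡ a′ → b ≡ b′ → c ≡ c′ → h a b c ≡ h a′ b′ c′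
    cong₃ h refl refl refl = refl

rc-local : ∀ n → LocalMap n n (rc n)
rc-local n f f′ _ f≗f′ x x<n = cong (opposite n) (f≗f′ (opposite n x) (opposite< n x x<n))

rc-132→213 : ∀ n f → Endo n f → Contains132 n (rc n f) → Contains213 n f
rc-132→213 n f f<n (x , y , z , x<y , y<z , z<n , v₁ , v₂) =
  opposite n z , opposite n y , opposite n x ,
  opposite-mono-< n y z y<z z<n , opposite-mono-< n x y x<y y<n , opposite< n x x<n ,
  opposite-cancel-< n _ _ v₂ , opposite-cancel-< n _ _ v₁
  where
  y<n = <-trans y<z z<n
  x<n = <-trans x<y y<n

rc-213→132 : ∀ n f → Endo n f → Contains213 n (rc n f) → Contains132 n f
rc-213→132 n f f<n (x , y , z , x<y , y<z , z<n , v₁ , v₂) =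
  opposite n z , opposite n y , opposite n x ,
  opposite-mono-< n y z y<z z<n , opposite-mono-< n x y x<y y<n , opposite< n x x<n ,
  opposite-cancel-< n _ _ v₂ , opposite-cancel-< n _ _ v₁
  where
  y<n = <-trans y<z z<n
  x<n = <-trans x<y y<n

count213≡count132 : ∀ n → countMaps n (good213ᵇ n) ≡ countMaps n (good132ᵇ n)
count213≡count132 n = countMaps-bij n n (good213ᵇ n) (good132ᵇ n) (rc n) (rc n)
  (goodᵇ-local (2 ∷ 1 ∷ 3 ∷ []) n) (goodᵇ-local (1 ∷ 3 ∷ 2 ∷ []) n) (rc-local n) (rc-local n) to from
  where
  to : ∀ f → Endo n f → T (good213ᵇ n f) → Endo n (rc n f) × T (good132ᵇ n (rc n f)) × rc n (rc n f) ≗[ n ] f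
  to f f<n good with good213⁻ n f f<n good
  ... | P , shallow , avoids = proj₁ (rc-perm n f P) ,
    good132⁺ n (rc n f) (rc-perm n f P , shallow-rc n f P shallow , avoids ∘ rc-132→213 n f f<n) ,
    rc-involutive n f f<n
  from : ∀ g → Endo n g → T (good132ᵇ n g) → Endo n (rc n g) × T (good213ᵇ n (rc n g)) × rc n (rc n g) ≗[ n ] g
  from g g<n good with good132⁻ n g g<n good
  ... | P , shallow , avoids = proj₁ (rc-perm n g P) ,
    good213⁺ n (rc n g) (rc-perm n g P , shallow-rc n g P shallow , avoids ∘ rc-213→132 n g g<n) ,
    rc-involutive n g g<n

-- Stripping the first and last entries

-- When f 0 = m the middle values are {1, …, m+1} ∖ {m}; the clamp sends m + 1 to m − 1, closing the gap.
strip : ℕ → (ℕ → ℕ) → ℕ → ℕ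
strip m f x = (f (suc x) ∸ 1) ⊓ (m ∸ 1)

module Strip (m : ℕ) (f : ℕ → ℕ) (P : Perm (suc (suc m)) f) (last≡0 : f (suc m) ≡ 0) (m≤first : m ≤ f 0) where

  private
    n : ℕ
    n = suc (suc m)
    f<n : Endo n f
    f<n = proj₁ P
    f-inj : InjectiveOn n f
    f-inj = proj₂ P

  -- Erasing the maximum of rc f (sitting at position 0) and applying rc again deletes the entry 0 at the end of f.
  f₁ : ℕ → ℕ
  f₁ = rc n f

  f₁0≡1+m : f₁ 0 ≡ suc m
  f₁0≡1+m = cong (suc m ∸_) last≡0
  module E₁ = ShallowErase (suc m) f₁ (rc-perm n f P) 0 z<s f₁0≡1+m

  excess₁≡0 : E₁.excess ≡ 0
  excess₁≡0 rewrite <ᵇ-false {E₁.k} {0} (λ ()) = ∑<-zero (suc m) λ p _ → cong (λ b → ⟦ b ∧ (E₁.k <ᵇ f₁ p) ⟧) (<ᵇ-false {p} {0} (λ ()))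

  f₂ : ℕ → ℕ
  f₂ = rc (suc m) E₁.g

  f₂-perm : Perm (suc m) f₂
  f₂-perm = rc-perm (suc m) E₁.g E₁.g-perm

  f-middle≢0 : ∀ x → x < m → f (suc x) ≢ 0
  f-middle≢0 x x<m e = <-irrefl (suc-injective (f-inj (suc x) (suc m) (s<s (m<n⇒m<1+n x<m)) ≤-refl (trans e (sym last≡0)))) x<m

  f-first≢0 : f 0 ≢ 0
  f-first≢0 e = 0≢1+n (f-inj 0 (suc m) z<s ≤-refl (trans e (sym last≡0)))

  m∸[1+m∸v]≡v∸1 : ∀ v → v ≢ 0 → v ≤ suc m → m ∸ (suc m ∸ v) ≡ v ∸ 1
  m∸[1+m∸v]≡v∸1 zero    v≢0 _   = ⊥-elim (v≢0 refl)
  m∸[1+m∸v]≡v∸1 (suc w) _   v≤n = m∸[m∸n]≡n (s≤s⁻¹ v≤n)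

  f₂-middle : ∀ x → x < m → f₂ x ≡ f (suc x) ∸ 1
  f₂-middle x x<m = begin
    m ∸ E₁.g (m ∸ x)                      ≡⟨ cong (m ∸_) (E₁.g-other (m ∸ x) (λ e → <-irrefl (sym e) (m<n⇒0<n∸m x<m))) ⟩
    m ∸ (suc m ∸ f (suc m ∸ (m ∸ x)))     ≡⟨ cong (λ z → m ∸ (suc m ∸ f z)) (trans (+-∸-assoc 1 (m∸n≤m m x)) (cong suc (m∸[m∸n]≡n (<⇒≤ x<m)))) ⟩
    m ∸ (suc m ∸ f (suc x))               ≡⟨ m∸[1+m∸v]≡v∸1 (f (suc x)) (f-middle≢0 x x<m) (s≤s⁻¹ (f<n (suc x) (s<s (m<n⇒m<1+n x<m)))) ⟩
    f (suc x) ∸ 1                         ∎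
    where open ≡-Reasoning

  f₂-last : f₂ m ≡ f 0 ∸ 1
  f₂-last = begin
    m ∸ E₁.g (m ∸ m)          ≡⟨ cong (λ z → m ∸ E₁.g z) (n∸n≡0 m) ⟩
    m ∸ E₁.g 0                ≡⟨ cong (m ∸_) E₁.g-at ⟩
    m ∸ (suc m ∸ f (n ∸ n))   ≡⟨ cong (λ z → m ∸ (suc m ∸ f z)) (n∸n≡0 n) ⟩
    m ∸ (suc m ∸ f 0)         ≡⟨ m∸[1+m∸v]≡v∸1 (f 0) f-first≢0 (s≤s⁻¹ (f<n 0 z<s)) ⟩
    f 0 ∸ 1                   ∎
    where open ≡-Reasoning

  shallow⇔f₂ : (Shallow n f → Shallow (suc m) f₂) × (Shallow (suc m) f₂ → Shallow n f)
  shallow⇔f₂ = (λ shallow → shallow-rc (suc m) E₁.g E₁.g-perm (proj₁ (E₁.shallow⇒ (shallow-rc n f P shallow)))) ,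
               (λ shallow → shallow-rc⁻ n f P (E₁.shallow⇐ (shallow-rc⁻ (suc m) E₁.g E₁.g-perm shallow) excess₁≡0))

  first≡m : f 0 ≢ suc m → f 0 ≡ m
  first≡m first≢1+m = ≤-antisym (s≤s⁻¹ (<1+n∧≢⇒< (f<n 0 z<s) first≢1+m)) m≤first

  j₂ : ℕ
  j₂ = Inverse.f⁻¹ (suc m) f₂ f₂-perm m
  j₂<1+m : j₂ < suc m
  j₂<1+m = Inverse.f⁻¹< (suc m) f₂ f₂-perm m ≤-refl
  f₂j₂≡m : f₂ j₂ ≡ m
  f₂j₂≡m = Inverse.f∘f⁻¹ (suc m) f₂ f₂-perm m ≤-refl
  module E₂ = ShallowErase m f₂ f₂-perm j₂ j₂<1+m f₂j₂≡m

  module Inside₂ (j₂<m : j₂ < m) where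
    first≡m′ : f 0 ≡ m
    first≡m′ = first≡m λ first≡1+m → <-irrefl (E₂.f-inj j₂ m j₂<1+m ≤-refl (trans f₂j₂≡m (sym (trans f₂-last (cong (_∸ 1) first≡1+m))))) j₂<m
    k≡m∸1 : E₂.k ≡ m ∸ 1
    k≡m∸1 = trans f₂-last (cong (_∸ 1) first≡m′)
    excess≡0 : E₂.excess ≡ 0
    excess≡0 rewrite k≡m∸1 | <ᵇ-false (≤⇒≯ (∸-monoˡ-≤ 1 j₂<m)) = ∑<-zero m λ p p<m → below p p<m
      where
      below : ∀ p → p < m → ⟦ (p <ᵇ j₂) ∧ (m ∸ 1 <ᵇ f₂ p) ⟧ ≡ 0
      below p p<m with p ≟ j₂
      ... | yes refl rewrite <ᵇ-false (<-irrefl {p} refl) = refl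
      ... | no  p≢j₂ rewrite <ᵇ-false (≤⇒≯ (∸-monoˡ-≤ 1 (E₂.f<m p (m<n⇒m<1+n p<m) p≢j₂))) = cong ⟦_⟧ (∧-zeroʳ _)

  excess₂≡0 : E₂.excess ≡ 0
  excess₂≡0 with j₂ ≟ m
  ... | yes j₂≡m = E₂.AtTop.excess-top j₂≡m
  ... | no  j₂≢m = Inside₂.excess≡0 (<1+n∧≢⇒< j₂<1+m j₂≢m)

  g₂≗strip : E₂.g ≗[ m ] strip m f
  g₂≗strip x x<m with x ≟ j₂
  ... | yes refl = begin
    E₂.g x                          ≡⟨ E₂.g-at ⟩
    E₂.k                            ≡⟨ Inside₂.k≡m∸1 x<m ⟩
    m ∸ 1                           ≡⟨ sym (m≥n⇒m⊓n≡n (m∸n≤m m 1)) ⟩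
    m ⊓ (m ∸ 1)                     ≡⟨ cong (_⊓ (m ∸ 1)) (trans (sym f₂j₂≡m) (f₂-middle x x<m)) ⟩
    strip m f x                     ∎
    where open ≡-Reasoning
  ... | no  x≢j₂ = begin
    E₂.g x                          ≡⟨ E₂.g-other x x≢j₂ ⟩
    f₂ x                            ≡⟨ f₂-middle x x<m ⟩
    f (suc x) ∸ 1                   ≡⟨ sym (m≤n⇒m⊓n≡m (subst (_≤ m ∸ 1) (f₂-middle x x<m) (∸-monoˡ-≤ 1 (E₂.f<m x (m<n⇒m<1+n x<m) x≢j₂)))) ⟩
    strip m f x                     ∎
    where open ≡-Reasoning

  shallow⇒strip : Shallow n f → Shallow m (strip m f)
  shallow⇒strip shallow = shallow-cong m E₂.g (strip m f) (proj₁ E₂.g-perm) g₂≗strip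
    (proj₁ (E₂.shallow⇒ (proj₁ shallow⇔f₂ shallow)))

  strip⇒shallow : Shallow m (strip m f) → Shallow n f
  strip⇒shallow shallow = proj₂ shallow⇔f₂ (E₂.shallow⇐ (shallow-cong m (strip m f) E₂.g strip<m (λ x x<m → sym (g₂≗strip x x<m)) shallow) excess₂≡0)
    where
    strip<m : Endo m (strip m f)
    strip<m x x<m = subst (_< m) (g₂≗strip x x<m) (proj₁ E₂.g-perm x x<m)

-- The shape of shallow 132-avoiders

left-of-max>right-of-max : ∀ n f → Perm n f → ¬ Contains132 n f → ∀ a → f a ≡ n ∸ 1 →
                           ∀ x z → x < a → a < z → z < n → f z < f x
left-of-max>right-of-max n f (f<n , f-inj) avoids a fa≡max x z x<a a<z z<n with <-cmp (f z) (f x)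
... | tri< fz<fx _ _ = fz<fx
... | tri≈ _ fz≡fx _ = ⊥-elim (<-irrefl (f-inj x z (<-trans x<a (<-trans a<z z<n)) z<n (sym fz≡fx)) (<-trans x<a a<z))
... | tri> _ _ fx<fz = ⊥-elim (avoids (x , a , z , x<a , a<z , z<n , fx<fz , fz<fa))
  where
  fz<fa : f z < f a
  fz<fa = subst (f z <_) (sym fa≡max) (≤∧≢⇒< (∸-monoˡ-≤ 1 (f<n z z<n))
    (λ fz≡max → <-irrefl (f-inj a z (<-trans a<z z<n) z<n (trans fa≡max (sym fz≡max))) a<z))

max-inside⇒last≡0 : ∀ M f → Good132 (suc M) f → ∀ a → 1 ≤ a → a < M → f a ≡ M → f M ≡ 0
max-inside⇒last≡0 M f (P , shallow , avoids) a 1≤a a<M fa≡M with f M ≟ 0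
... | yes fM≡0 = fM≡0
... | no  fM≢0 = ⊥-elim (unshallow below-right above-left shallow)
  where
  open ShallowErase M f P a (m<n⇒m<1+n a<M) fa≡M
  open Inverse (suc M) f P
  left>right : ∀ x z → x < a → a < z → z < suc M → f z < f x
  left>right = left-of-max>right-of-max (suc M) f P avoids a fa≡M
  y₀ : ℕ
  y₀ = f⁻¹ 0
  fy₀≡0 : f y₀ ≡ 0
  fy₀≡0 = f∘f⁻¹ 0 z<s
  below-right : k < a → ∃ λ y → a < y × y < M × f y < k
  below-right _ = y₀ , a<y₀ , y₀<M , subst (_< k) (sym fy₀≡0) (n≢0⇒n>0 fM≢0)
    where
    y₀<M : y₀ < M
    y₀<M = <1+n∧≢⇒< (f⁻¹< 0 z<s) (λ y₀≡M → fM≢0 (trans (cong f (sym y₀≡M)) fy₀≡0))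
    a<y₀ : a < y₀
    a<y₀ with <-cmp a y₀
    ... | tri< a<y₀ _ _ = a<y₀
    ... | tri≈ _ a≡y₀ _ = ⊥-elim (<-irrefl (trans (sym fy₀≡0) (trans (cong f (sym a≡y₀)) fa≡M)) (≤-<-trans z≤n a<M))
    ... | tri> _ _ y₀<a = ⊥-elim (<⇒≱ (left>right y₀ M y₀<a a<M ≤-refl) (subst (_≤ f M) (sym fy₀≡0) z≤n))
  above-left : a ≤ k → ∃ λ p → p < a × k < f p
  above-left _ = 0 , 1≤a , left>right 0 M 1≤a a<M ≤-refl

module SecondMax (M′ : ℕ) (f : ℕ → ℕ) (good : Good132 (2 + M′) f)
                 (a : ℕ) (1≤a : 1 ≤ a) (a<M′ : a < M′) (fa≡M : f a ≡ suc M′) where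

  private
    M = suc M′
    P = proj₁ good
    a<M : a < M
    a<M = m<n⇒m<1+n a<M′

  module E₁ = ShallowErase M f P a (m<n⇒m<1+n a<M) fa≡M

  g : ℕ → ℕ
  g = E₁.g

  left>right : ∀ x z → x < a → a < z → z < suc M → f z < f x
  left>right = left-of-max>right-of-max (suc M) f P (proj₂ (proj₂ good)) a fa≡M

  ga≡0 : g a ≡ 0
  ga≡0 = trans E₁.g-at (max-inside⇒last≡0 M f good a 1≤a a<M fa≡M)

  g0≡f0 : g 0 ≡ f 0
  g0≡f0 = E₁.g-other 0 (λ 0≡a → <-irrefl 0≡a 1≤a)

  j′ : ℕ
  j′ = Inverse.f⁻¹ M g E₁.g-perm M′
  j′<M : j′ < M
  j′<M = Inverse.f⁻¹< M g E₁.g-perm M′ ≤-refl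
  gj′≡M′ : g j′ ≡ M′
  gj′≡M′ = Inverse.f∘f⁻¹ M g E₁.g-perm M′ ≤-refl

  j′≢a : j′ ≢ a
  j′≢a j′≡a = <-irrefl (trans (sym ga≡0) (trans (cong g (sym j′≡a)) gj′≡M′)) (≤-<-trans z≤n a<M′)

  j′<a : j′ < a
  j′<a with <-cmp j′ a
  ... | tri< j′<a _ _ = j′<a
  ... | tri≈ _ j′≡a _ = ⊥-elim (j′≢a j′≡a)
  ... | tri> _ _ a<j′ = ⊥-elim (<-irrefl (proj₂ P 0 a z<s (m<n⇒m<1+n a<M) (trans f0≡M (sym fa≡M))) 1≤a)
    where
    fj′≡M′ : f j′ ≡ M′
    fj′≡M′ = trans (sym (E₁.g-other j′ j′≢a)) gj′≡M′
    f0≡M : f 0 ≡ M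
    f0≡M = ≤-antisym (s≤s⁻¹ (proj₁ P 0 z<s)) (subst (_< f 0) fj′≡M′ (left>right 0 j′ 1≤a a<j′ (m<n⇒m<1+n j′<M)))

  module E₂ = ShallowErase M′ g E₁.g-perm j′ j′<M gj′≡M′

  k′≡fM′ : E₂.k ≡ f M′
  k′≡fM′ = E₁.g-other M′ (λ M′≡a → <-irrefl (sym M′≡a) a<M′)

  k′≢0 : E₂.k ≢ 0
  k′≢0 k′≡0 = <-irrefl (proj₂ P M′ M (m<n⇒m<1+n (n<1+n M′)) (n<1+n M)
                 (trans (sym k′≡fM′) (trans k′≡0 (sym (max-inside⇒last≡0 M f good a 1≤a a<M fa≡M))))) (n<1+n M′)

  j′≡0 : j′ ≡ 0
  j′≡0 with j′ ≟ 0
  ... | yes j′≡0 = j′≡0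
  ... | no  j′≢0 = ⊥-elim (E₂.unshallow below-right above-left (proj₁ (E₁.shallow⇒ (proj₁ (proj₂ good)))))
    where
    below-right : E₂.k < j′ → ∃ λ y → j′ < y × y < M′ × g y < E₂.k
    below-right _ = a , j′<a , a<M′ , subst (_< E₂.k) (sym ga≡0) (n≢0⇒n>0 k′≢0)
    above-left : j′ ≤ E₂.k → ∃ λ p → p < j′ × E₂.k < g p
    above-left _ = 0 , n≢0⇒n>0 j′≢0 , subst₂ _<_ (sym k′≡fM′) (sym g0≡f0) (left>right 0 M′ 1≤a a<M′ (m<n⇒m<1+n (n<1+n M′)))

max-inside⇒first≡M∸1 : ∀ M f → Good132 (suc M) f → ∀ a → 1 ≤ a → suc (suc a) ≤ M → f a ≡ M → f 0 ≡ M ∸ 1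
max-inside⇒first≡M∸1 (suc M′) f good a 1≤a a+2≤M fa≡M = trans (sym g0≡f0) (trans (cong g (sym j′≡0)) gj′≡M′)
  where open SecondMax M′ f good a 1≤a (s≤s⁻¹ a+2≤M) fa≡M

-- Classification by the position of the maximum

maxAtᵇ : ℕ → ℕ → (ℕ → ℕ) → Bool
maxAtᵇ n a f = good132ᵇ n f ∧ (f a ≡ᵇ n ∸ 1)

endsIn0ᵇ : ℕ → (ℕ → ℕ) → Bool
endsIn0ᵇ n f = good132ᵇ n f ∧ (f (n ∸ 1) ≡ᵇ 0)

good∧≡⁻ : ∀ n f a v → Endo n f → T (good132ᵇ n f ∧ (f a ≡ᵇ v)) → Good132 n f × f a ≡ v
good∧≡⁻ n f a v f<n t with Equivalence.to T-∧ t
... | good , fa≡v = good132⁻ n f f<n good , ≡ᵇ⇒≡ _ _ fa≡v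

good∧≡⁺ : ∀ n f a v → Good132 n f → f a ≡ v → T (good132ᵇ n f ∧ (f a ≡ᵇ v))
good∧≡⁺ n f a v good fa≡v = Equivalence.from T-∧ (good132⁺ n f good , ≡⇒≡ᵇ _ _ fa≡v)

good132-local : ∀ n → Local n (good132ᵇ n)
good132-local = goodᵇ-local (1 ∷ 3 ∷ 2 ∷ [])

good∧≡-local : ∀ n a v → a < n → Local n (λ f → good132ᵇ n f ∧ (f a ≡ᵇ v))
good∧≡-local n a v a<n f g f<n f≗g = cong₂ _∧_ (good132-local n f g f<n f≗g) (cong (_≡ᵇ v) (f≗g a a<n))

insert : ℕ → ℕ → (ℕ → ℕ) → ℕ → ℕ
insert j N g x = if x ≡ᵇ j then N else if x ≡ᵇ N then g j else g x

insert-at : ∀ j N g → insert j N g j ≡ N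
insert-at j N g rewrite ≡ᵇ-refl j = refl

insert-top : ∀ j N g → j ≢ N → insert j N g N ≡ g j
insert-top j N g j≢N rewrite ≡ᵇ-false (j≢N ∘ sym) | ≡ᵇ-refl N = refl

insert-other : ∀ j N g x → x ≢ j → x ≢ N → insert j N g x ≡ g x
insert-other j N g x x≢j x≢N rewrite ≡ᵇ-false x≢j | ≡ᵇ-false x≢N = refl

insert-perm : ∀ N g j → Perm N g → j < suc N → Perm (suc N) (insert j N g)
insert-perm N g j (g<N , g-inj) j≤N = endo , inj
  where
  data Slot (x : ℕ) : Set where
    at-j   : x ≡ j → insert j N g x ≡ N → Slot x
    at-top : j < N → insert j N g x ≡ g j → x ≡ N → Slot x
    other  : x < N → x ≢ j → insert j N g x ≡ g x → Slot x
  slot : ∀ x → x < suc N → Slot x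
  slot x x<n with x ≟ j | x ≟ N
  ... | yes refl | _        = at-j refl (insert-at x N g)
  ... | no  x≢j  | yes refl = at-top (<1+n∧≢⇒< j≤N (x≢j ∘ sym)) (insert-top j x g (x≢j ∘ sym)) refl
  ... | no  x≢j  | no  x≢N  = other (<1+n∧≢⇒< x<n x≢N) x≢j (insert-other j N g x x≢j x≢N)
  endo : Endo (suc N) (insert j N g)
  endo x x<n with slot x x<n
  ... | at-j _ e         = subst (_< suc N) (sym e) ≤-refl
  ... | at-top j<N e _   = subst (_< suc N) (sym e) (m<n⇒m<1+n (g<N j j<N))
  ... | other x<N _ e    = subst (_< suc N) (sym e) (m<n⇒m<1+n (g<N x x<N))
  inj : InjectiveOn (suc N) (insert j N g)
  inj x y x<n y<n e with slot x x<n | slot y y<n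
  ... | at-j x≡j _        | at-j y≡j _        = trans x≡j (sym y≡j)
  ... | at-j _ ex         | at-top j<N ey _   = ⊥-elim (<-irrefl (trans (sym ey) (trans (sym e) ex)) (g<N j j<N))
  ... | at-j _ ex         | other y<N _ ey    = ⊥-elim (<-irrefl (trans (sym ey) (trans (sym e) ex)) (g<N y y<N))
  ... | at-top j<N ex _   | at-j _ ey         = ⊥-elim (<-irrefl (trans (sym ex) (trans e ey)) (g<N j j<N))
  ... | at-top _ _ x≡N    | at-top _ _ y≡N    = trans x≡N (sym y≡N)
  ... | at-top j<N ex _   | other y<N y≢j ey  = ⊥-elim (y≢j (sym (g-inj j y j<N y<N (trans (sym ex) (trans e ey)))))
  ... | other x<N _ ex    | at-j _ ey         = ⊥-elim (<-irrefl (trans (sym ex) (trans e ey)) (g<N x x<N))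
  ... | other x<N x≢j ex  | at-top j<N ey _   = ⊥-elim (x≢j (g-inj x j x<N j<N (trans (sym ex) (trans e ey))))
  ... | other x<N _ ex    | other y<N _ ey    = g-inj x y x<N y<N (trans (sym ex) (trans e ey))

erase-insert : ∀ N g j → j < suc N → erase j N (insert j N g) ≗[ N ] g
erase-insert N g j j≤N x x<N with x ≟ j
... | yes refl = trans (erase-at x N (insert x N g)) (insert-top x N g (λ x≡N → <-irrefl x≡N x<N))
... | no  x≢j  = trans (erase-other j N (insert j N g) x x≢j) (insert-other j N g x x≢j (λ x≡N → <-irrefl x≡N x<N))

insert-erase : ∀ N f j → f j ≡ N → insert j N (erase j N f) ≗[ suc N ] f
insert-erase N f j fj≡N x x<n with x ≟ j | x ≟ N
... | yes refl | _        = trans (insert-at x N (erase x N f)) (sym fj≡N)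
... | no  x≢j  | yes refl = trans (insert-top j x (erase j x f) (x≢j ∘ sym)) (erase-at j x f)
... | no  x≢j  | no  x≢N  = trans (insert-other j N (erase j N f) x x≢j x≢N) (erase-other j N f x x≢j)

erase-local : ∀ N j → LocalMap (suc N) N (erase j N)
erase-local N j f f′ _ f≗f′ x x<N with x ≟ j
... | yes refl = trans (erase-at x N f) (trans (f≗f′ N ≤-refl) (sym (erase-at x N f′)))
... | no  x≢j  = trans (erase-other j N f x x≢j) (trans (f≗f′ x (m<n⇒m<1+n x<N)) (sym (erase-other j N f′ x x≢j)))

insert-local : ∀ N j → j < suc N → LocalMap N (suc N) (insert j N)
insert-local N j j≤N g g′ _ g≗g′ x x<n with x ≟ j | x ≟ N
... | yes refl | _        = trans (insert-at x N g) (sym (insert-at x N g′))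
... | no  x≢j  | yes refl = trans (insert-top j x g (x≢j ∘ sym))
                              (trans (g≗g′ j (<1+n∧≢⇒< j≤N (x≢j ∘ sym))) (sym (insert-top j x g′ (x≢j ∘ sym))))
... | no  x≢j  | no  x≢N  = trans (insert-other j N g x x≢j x≢N)
                              (trans (g≗g′ x (<1+n∧≢⇒< x<n x≢N)) (sym (insert-other j N g′ x x≢j x≢N)))

contains132-agree : ∀ m n h h′ → m ≤ n → h ≗[ m ] h′ → Contains132 m h → Contains132 n h′
contains132-agree m n h h′ m≤n h≗h′ (x , y , z , x<y , y<z , z<m , v₁ , v₂) =
  x , y , z , x<y , y<z , <-≤-trans z<m m≤n ,
  subst₂ _<_ (h≗h′ x x<m) (h≗h′ z z<m) v₁ , subst₂ _<_ (h≗h′ z z<m) (h≗h′ y y<m) v₂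
  where
  y<m = <-trans y<z z<m
  x<m = <-trans x<y y<m

contains132-narrow : ∀ m n h → Contains132 n h →
  (∀ x y z → x < y → y < z → z < n → h x < h z → h z < h y → z < m) → Contains132 m h
contains132-narrow m n h (x , y , z , x<y , y<z , z<n , v₁ , v₂) inside =
  x , y , z , x<y , y<z , inside x y z x<y y<z z<n v₁ v₂ , v₁ , v₂

contains132-inverse : ∀ n f → Perm n f → Contains132 n (inverse n f) → Contains132 n f
contains132-inverse n f P (a , b , c , a<b , b<c , c<n , v₁ , v₂) =
  f⁻¹ a , f⁻¹ c , f⁻¹ b , v₁ , v₂ , f⁻¹< b b<n ,
  subst₂ _<_ (sym (f∘f⁻¹ a a<n)) (sym (f∘f⁻¹ b b<n)) a<b , subst₂ _<_ (sym (f∘f⁻¹ b b<n)) (sym (f∘f⁻¹ c c<n)) b<c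
  where
  open Inverse n f P
  b<n = <-trans b<c c<n
  a<n = <-trans a<b b<n

erase-last-good : ∀ N f → Good132 (suc N) f → f N ≡ N → Good132 N (erase N N f)
erase-last-good N f (P , shallow , avoids) fN≡N =
  g-perm , proj₁ (shallow⇒ shallow) , avoids ∘ contains132-agree N (suc N) g f (n≤1+n N) g≗f
  where
  open ShallowErase N f P N ≤-refl fN≡N
  open AtTop refl

insert-last-good : ∀ N g → Good132 N g → Good132 (suc N) (insert N N g)
insert-last-good N g (P , shallow , avoids) = P′ , shallow′ , avoids′
  where
  h = insert N N g
  P′ = insert-perm N g N P ≤-refl
  module Back = ShallowErase N h P′ N ≤-refl (insert-at N N g)
  shallow′ : Shallow (suc N) h
  shallow′ = Back.shallow⇐ (shallow-cong N g Back.g (proj₁ P) (λ x x<N → sym (erase-insert N g N ≤-refl x x<N)) shallow)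
                           (Back.AtTop.excess-top refl)
  avoids′ : ¬ Contains132 (suc N) h
  avoids′ c = avoids (contains132-agree N N h g ≤-refl
    (λ x x<N → insert-other N N g x (<⇒≢ x<N) (<⇒≢ x<N))
    (contains132-narrow N (suc N) h c λ x y z _ y<z z<n _ v₂ → <1+n∧≢⇒< z<n λ z≡N →
      <⇒≱ (subst (_< h y) (trans (cong h z≡N) (insert-at N N g)) v₂) (s≤s⁻¹ (proj₁ P′ y (<-trans y<z z<n)))))

count-max-last : ∀ N → countMaps (suc N) (maxAtᵇ (suc N) N) ≡ countMaps N (good132ᵇ N)
count-max-last N = countMaps-bij (suc N) N (maxAtᵇ (suc N) N) (good132ᵇ N) (erase N N) (insert N N)
  (good∧≡-local (suc N) N N ≤-refl) (good132-local N) (erase-local N N) (insert-local N N ≤-refl) to from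
  where
  to : ∀ f → Endo (suc N) f → T (maxAtᵇ (suc N) N f) →
       Endo N (erase N N f) × T (good132ᵇ N (erase N N f)) × insert N N (erase N N f) ≗[ suc N ] f
  to f f<n t with good∧≡⁻ (suc N) f N N f<n t
  ... | good , fN≡N = let good′ = erase-last-good N f good fN≡N in
    proj₁ (proj₁ good′) , good132⁺ N (erase N N f) good′ , insert-erase N f N fN≡N
  from : ∀ g → Endo N g → T (good132ᵇ N g) →
         Endo (suc N) (insert N N g) × T (maxAtᵇ (suc N) N (insert N N g)) × erase N N (insert N N g) ≗[ N ] g
  from g g<N t = let good′ = insert-last-good N g (good132⁻ N g g<N t) in
    proj₁ (proj₁ good′) , good∧≡⁺ (suc N) (insert N N g) N N good′ (insert-at N N g) , erase-insert N g N ≤-refl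

erase-penultimate-good : ∀ M f → 1 ≤ M → Good132 (2 + M) f → f M ≡ suc M →
                         Good132 (suc M) (erase M (suc M) f) × erase M (suc M) f M ≡ 0
erase-penultimate-good M f 1≤M good@(P , shallow , avoids) fM≡N =
  (g-perm , proj₁ (shallow⇒ shallow) , avoids ∘ lift) , gM≡0
  where
  N = suc M
  open ShallowErase N f P M (m<n⇒m<1+n ≤-refl) fM≡N
  gM≡0 : g M ≡ 0
  gM≡0 = trans g-at (max-inside⇒last≡0 N f good M 1≤M ≤-refl fM≡N)
  lift : Contains132 N g → Contains132 (suc N) f
  lift c = contains132-agree M (suc N) g f (≤-trans (n≤1+n M) (n≤1+n N))
    (λ x x<M → g-other x (<⇒≢ x<M))
    (contains132-narrow M N g c λ x y z _ _ z<N v₁ _ → <1+n∧≢⇒< z<N λ z≡M →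
      <⇒≱ (subst (g x <_) (trans (cong g z≡M) gM≡0) v₁) z≤n)

insert-penultimate-good : ∀ M g → 1 ≤ M → Good132 (suc M) g → g M ≡ 0 → Good132 (2 + M) (insert M (suc M) g)
insert-penultimate-good M g 1≤M (P , shallow , avoids) gM≡0 = P′ , shallow′ , avoids′
  where
  N = suc M
  h = insert M N g
  P′ = insert-perm N g M P (m<n⇒m<1+n ≤-refl)
  module Back = ShallowErase N h P′ M (m<n⇒m<1+n ≤-refl) (insert-at M N g)
  hN≡0 : h N ≡ 0
  hN≡0 = trans (insert-top M N g (<⇒≢ ≤-refl)) gM≡0
  excess≡0 : Back.excess ≡ 0
  excess≡0 rewrite hN≡0 | <ᵇ-true 1≤M =
    ∑<-zero N λ y _ → trans (cong (λ b → ⟦ (M <ᵇ y) ∧ b ⟧) (<ᵇ-false {h y} {0} (λ ()))) (cong ⟦_⟧ (∧-zeroʳ _))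
  shallow′ : Shallow (suc N) h
  shallow′ = Back.shallow⇐ (shallow-cong N g Back.g (proj₁ P)
    (λ x x<N → sym (erase-insert N g M (m<n⇒m<1+n ≤-refl) x x<N)) shallow) excess≡0
  inside : ∀ x y z → x < y → y < z → z < suc N → h x < h z → h z < h y → z < M
  inside x y z _ y<z z<n v₁ v₂ with z ≟ N | z ≟ M
  ... | yes refl | _        = ⊥-elim (<⇒≱ (subst (h x <_) hN≡0 v₁) z≤n)
  ... | no  _    | yes refl = ⊥-elim (<⇒≱ (subst (_< h y) (insert-at M N g) v₂) (s≤s⁻¹ (proj₁ P′ y (<-trans y<z z<n))))
  ... | no  z≢N  | no  z≢M  = <1+n∧≢⇒< (<1+n∧≢⇒< z<n z≢N) z≢M
  avoids′ : ¬ Contains132 (suc N) h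
  avoids′ c = avoids (contains132-agree M N h g (n≤1+n M)
    (λ x x<M → insert-other M N g x (<⇒≢ x<M) (<⇒≢ (m<n⇒m<1+n x<M)))
    (contains132-narrow M (suc N) h c inside))

count-max-penultimate : ∀ M → 1 ≤ M → countMaps (suc (suc M)) (maxAtᵇ (suc (suc M)) M) ≡ countMaps (suc M) (endsIn0ᵇ (suc M))
count-max-penultimate M 1≤M = countMaps-bij (suc N) N (maxAtᵇ (suc N) M) (endsIn0ᵇ N) (erase M N) (insert M N)
  (good∧≡-local (suc N) M N M<1+N) (good∧≡-local N M 0 ≤-refl) (erase-local N M) (insert-local N M M<1+N) to from
  where
  N = suc M
  M<1+N : M < suc N
  M<1+N = m<n⇒m<1+n ≤-refl
  to : ∀ f → Endo (suc N) f → T (maxAtᵇ (suc N) M f) →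
       Endo N (erase M N f) × T (endsIn0ᵇ N (erase M N f)) × insert M N (erase M N f) ≗[ suc N ] f
  to f f<n t with good∧≡⁻ (suc N) f M N f<n t
  ... | good , fM≡N with erase-penultimate-good M f 1≤M good fM≡N
  ...   | good′ , gM≡0 = proj₁ (proj₁ good′) , good∧≡⁺ N (erase M N f) M 0 good′ gM≡0 , insert-erase N f M fM≡N
  from : ∀ g → Endo N g → T (endsIn0ᵇ N g) →
         Endo (suc N) (insert M N g) × T (maxAtᵇ (suc N) M (insert M N g)) × erase M N (insert M N g) ≗[ N ] g
  from g g<N t with good∧≡⁻ N g M 0 g<N t
  ... | good , gM≡0 = let good′ = insert-penultimate-good M g 1≤M good gM≡0 in
    proj₁ (proj₁ good′) , good∧≡⁺ (suc N) (insert M N g) M N good′ (insert-at M N g) , erase-insert N g M M<1+N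

count-max-first : ∀ N → countMaps (suc N) (maxAtᵇ (suc N) 0) ≡ countMaps (suc N) (endsIn0ᵇ (suc N))
count-max-first N = countMaps-bij n n (maxAtᵇ n 0) (endsIn0ᵇ n) (inverse n) (inverse n)
  (good∧≡-local n 0 N z<s) (good∧≡-local n N 0 ≤-refl) (inverse-local n) (inverse-local n) to from
  where
  n = suc N
  swap : ∀ a v f → Endo n f → a < n → v < n → T (good132ᵇ n f ∧ (f a ≡ᵇ v)) →
         Endo n (inverse n f) × T (good132ᵇ n (inverse n f) ∧ (inverse n f v ≡ᵇ a)) × inverse n (inverse n f) ≗[ n ] f
  swap a v f f<n a<n v<n t with good∧≡⁻ n f a v f<n t
  ... | (P , shallow , avoids) , fa≡v =
    f⁻¹< , good∧≡⁺ n f⁻¹ v a (f⁻¹-perm , shallow-inverse n f P shallow , avoids ∘ contains132-inverse n f P)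
                              (trans (cong f⁻¹ (sym fa≡v)) (f⁻¹∘f a a<n)) ,
    inverse-involutive n f P
    where open Inverse n f P
  to : ∀ f → Endo n f → T (maxAtᵇ n 0 f) → Endo n (inverse n f) × T (endsIn0ᵇ n (inverse n f)) × inverse n (inverse n f) ≗[ n ] f
  to f f<n = swap 0 N f f<n z<s ≤-refl
  from : ∀ g → Endo n g → T (endsIn0ᵇ n g) → Endo n (inverse n g) × T (maxAtᵇ n 0 (inverse n g)) × inverse n (inverse n g) ≗[ n ] g
  from g g<n = swap N 0 g g<n ≤-refl z<s

framedᵇ : ℕ → ℕ → (ℕ → ℕ) → Bool
framedᵇ c m f = good132ᵇ (suc (suc m)) f ∧ ((f 0 ≡ᵇ c) ∧ (f (suc m) ≡ᵇ 0))

strip-mono : ∀ m {v w} → v ≤ w → (v ∸ 1) ⊓ (m ∸ 1) ≤ (w ∸ 1) ⊓ (m ∸ 1)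
strip-mono m v≤w = ⊓-monoˡ-≤ (m ∸ 1) (∸-monoˡ-≤ 1 v≤w)

strip-local : ∀ m → LocalMap (suc (suc m)) m (strip m)
strip-local m f f′ _ f≗f′ x x<m = cong (λ v → (v ∸ 1) ⊓ (m ∸ 1)) (f≗f′ (suc x) (s<s (m<n⇒m<1+n x<m)))

-- Inverts strip m on the permutations of [0, m + 2) whose first entry is c ∈ {m, m + 1} and last entry is 0.
module Framing (m c : ℕ) (φ : ℕ → ℕ) (m≤c : m ≤ c) (c≤1+m : c ≤ suc m) (c≢0 : c ≢ 0)
  (φ-range : ∀ u → u < m → φ u ≢ 0 × φ u ≤ suc m × φ u ≢ c)
  (strip∘φ : ∀ u → u < m → (φ u ∸ 1) ⊓ (m ∸ 1) ≡ u)
  (φ∘strip : ∀ v → v ≢ 0 → v ≤ suc m → v ≢ c → φ ((v ∸ 1) ⊓ (m ∸ 1)) ≡ v) where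

  private
    n : ℕ
    n = suc (suc m)

  frame : (ℕ → ℕ) → ℕ → ℕ
  frame g zero    = c
  frame g (suc x) = if x ≡ᵇ m then 0 else φ (g x)

  frame-last : ∀ g → frame g (suc m) ≡ 0
  frame-last g rewrite ≡ᵇ-refl m = refl

  frame-middle : ∀ g x → x < m → frame g (suc x) ≡ φ (g x)
  frame-middle g x x<m rewrite ≡ᵇ-false (<⇒≢ x<m) = refl

  data Slot (g : ℕ → ℕ) : ℕ → Set where
    first  : Slot g 0
    middle : ∀ {x} → x < m → Slot g (suc x)
    last   : Slot g (suc m)

  slot : ∀ g x → x < n → Slot g x
  slot g zero    _   = first
  slot g (suc x) x<n with x ≟ m
  ... | yes refl = last
  ... | no  x≢m  = middle (<1+n∧≢⇒< (s≤s⁻¹ x<n) x≢m)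

  φ-injective : ∀ u v → u < m → v < m → φ u ≡ φ v → u ≡ v
  φ-injective u v u<m v<m e = trans (sym (strip∘φ u u<m)) (trans (cong (λ w → (w ∸ 1) ⊓ (m ∸ 1)) e) (strip∘φ v v<m))

  frame-perm : ∀ g → Perm m g → Perm n (frame g)
  frame-perm g (g<m , g-inj) = endo , inj
    where
    endo : Endo n (frame g)
    endo x x<n with slot g x x<n
    ... | first        = s≤s c≤1+m
    ... | middle {x} x<m = subst (_< n) (sym (frame-middle g x x<m)) (s≤s (proj₁ (proj₂ (φ-range (g x) (g<m x x<m)))))
    ... | last         = subst (_< n) (sym (frame-last g)) z<s
    inj : InjectiveOn n (frame g)
    inj x y x<n y<n e with slot g x x<n | slot g y y<n
    ... | first          | first          = refl
    ... | first          | middle {y} y<m = ⊥-elim (proj₂ (proj₂ (φ-range (g y) (g<m y y<m))) (trans (sym (frame-middle g y y<m)) (sym e)))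
    ... | first          | last           = ⊥-elim (c≢0 (trans e (frame-last g)))
    ... | middle {x} x<m | first          = ⊥-elim (proj₂ (proj₂ (φ-range (g x) (g<m x x<m))) (trans (sym (frame-middle g x x<m)) e))
    ... | middle {x} x<m | middle {y} y<m = cong suc (g-inj x y x<m y<m (φ-injective _ _ (g<m x x<m) (g<m y y<m)
                                              (trans (sym (frame-middle g x x<m)) (trans e (frame-middle g y y<m)))))
    ... | middle {x} x<m | last           = ⊥-elim (proj₁ (φ-range (g x) (g<m x x<m)) (trans (sym (frame-middle g x x<m)) (trans e (frame-last g))))
    ... | last           | first          = ⊥-elim (c≢0 (trans (sym e) (frame-last g)))
    ... | last           | middle {y} y<m = ⊥-elim (proj₁ (φ-range (g y) (g<m y y<m)) (trans (sym (frame-middle g y y<m)) (trans (sym e) (frame-last g))))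
    ... | last           | last           = refl

  strip-frame : ∀ g → Endo m g → strip m (frame g) ≗[ m ] g
  strip-frame g g<m x x<m = trans (cong (λ v → (v ∸ 1) ⊓ (m ∸ 1)) (frame-middle g x x<m)) (strip∘φ (g x) (g<m x x<m))

  φ-reflects-< : ∀ u v → u < m → v < m → φ u < φ v → u < v
  φ-reflects-< u v u<m v<m φu<φv = ≤∧≢⇒< (subst₂ _≤_ (strip∘φ u u<m) (strip∘φ v v<m) (strip-mono m (<⇒≤ φu<φv)))
                                         (λ u≡v → <-irrefl (cong φ u≡v) φu<φv)

  frame-avoids : ∀ g → Perm m g → ¬ Contains132 m g → ¬ Contains132 n (frame g)
  frame-avoids g P@(g<m , _) avoids (x , y , z , x<y , y<z , z<n , v₁ , v₂) =
    no-pattern (slot g x (<-trans x<y y<n)) (slot g z z<n) x<y y<z y<n v₁ v₂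
    where
    y<n = <-trans y<z z<n
    no-pattern : ∀ {x y z} → Slot g x → Slot g z → x < y → y < z → y < n → frame g x < frame g z → frame g z < frame g y → ⊥
    no-pattern first _ _ _ y<n v₁ v₂ = <⇒≱ (≤-trans (s≤s (≤-<-trans m≤c v₁)) v₂) (s≤s⁻¹ (proj₁ (frame-perm g P) _ y<n))
    no-pattern last _ x<y _ y<n _ _ = <⇒≱ x<y (s≤s⁻¹ y<n)
    no-pattern (middle _) first x<y y<z _ _ _ = <⇒≱ (<-trans x<y y<z) z≤n
    no-pattern {x} (middle _) last _ _ _ v₁ _ = <⇒≱ (subst (frame g x <_) (frame-last g) v₁) z≤n
    no-pattern {suc x′} {zero} (middle _) (middle _) () _ _ _ _
    no-pattern {suc x′} {suc y′} {suc z′} (middle x′<m) (middle z′<m) x<y y<z _ v₁ v₂ = avoids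
      (x′ , y′ , z′ , s≤s⁻¹ x<y , s≤s⁻¹ y<z , z′<m ,
       φ-reflects-< _ _ (g<m x′ x′<m) (g<m z′ z′<m) (subst₂ _<_ (frame-middle g x′ x′<m) (frame-middle g z′ z′<m) v₁) ,
       φ-reflects-< _ _ (g<m z′ z′<m) (g<m y′ y′<m) (subst₂ _<_ (frame-middle g z′ z′<m) (frame-middle g y′ y′<m) v₂))
      where
      y′<m = <-trans (s≤s⁻¹ y<z) z′<m

  module Framed (f : ℕ → ℕ) (P : Perm n f) (first≡c : f 0 ≡ c) (last≡0 : f (suc m) ≡ 0) where

    middle≢0 : ∀ x → x < m → f (suc x) ≢ 0
    middle≢0 x x<m e = <⇒≢ x<m (suc-injective (proj₂ P (suc x) (suc m) (s<s (m<n⇒m<1+n x<m)) ≤-refl (trans e (sym last≡0))))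

    middle≢c : ∀ x → x < m → f (suc x) ≢ c
    middle≢c x x<m e = 1+n≢0 (proj₂ P (suc x) 0 (s<s (m<n⇒m<1+n x<m)) z<s (trans e (sym first≡c)))

    middle≤1+m : ∀ x → x < m → f (suc x) ≤ suc m
    middle≤1+m x x<m = s≤s⁻¹ (proj₁ P (suc x) (s<s (m<n⇒m<1+n x<m)))

    frame-strip : frame (strip m f) ≗[ n ] f
    frame-strip x x<n with slot (strip m f) x x<n
    ... | first = sym first≡c
    ... | middle {x} x<m = trans (frame-middle (strip m f) x x<m) (φ∘strip _ (middle≢0 x x<m) (middle≤1+m x x<m) (middle≢c x x<m))
    ... | last = trans (frame-last (strip m f)) (sym last≡0)

    strip-perm : Perm m (strip m f)
    strip-perm = endo , inj
      where
      endo : Endo m (strip m f)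
      endo x x<m = ≤-<-trans (m⊓n≤n _ (m ∸ 1)) (m∸1<m x<m)
        where
        m∸1<m : ∀ {m} → x < m → m ∸ 1 < m
        m∸1<m {suc m} _ = ≤-refl
      inj : InjectiveOn m (strip m f)
      inj x y x<m y<m e = suc-injective (proj₂ P (suc x) (suc y) (s<s (m<n⇒m<1+n x<m)) (s<s (m<n⇒m<1+n y<m))
        (trans (sym (frame-strip (suc x) (s<s (m<n⇒m<1+n x<m))))
          (trans (trans (frame-middle (strip m f) x x<m) (trans (cong φ e) (sym (frame-middle (strip m f) y y<m))))
            (frame-strip (suc y) (s<s (m<n⇒m<1+n y<m))))))

    strip-reflects-< : ∀ x y → strip m f x < strip m f y → f (suc x) < f (suc y)
    strip-reflects-< x y lt = ≰⇒> (λ fy≤fx → <⇒≱ lt (strip-mono m fy≤fx))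

    strip-avoids : ¬ Contains132 n f → ¬ Contains132 m (strip m f)
    strip-avoids avoids (x , y , z , x<y , y<z , z<m , v₁ , v₂) =
      avoids (suc x , suc y , suc z , s<s x<y , s<s y<z , s<s (m<n⇒m<1+n z<m) ,
              strip-reflects-< x z v₁ , strip-reflects-< z y v₂)

  frame-local : LocalMap m n frame
  frame-local g g′ _ g≗g′ zero    _   = refl
  frame-local g g′ _ g≗g′ (suc x) x<n with x ≟ m
  ... | yes refl = trans (frame-last g) (sym (frame-last g′))
  ... | no  x≢m  = trans (frame-middle g x x<m) (trans (cong φ (g≗g′ x x<m)) (sym (frame-middle g′ x x<m)))
    where x<m = <1+n∧≢⇒< (s≤s⁻¹ x<n) x≢m

  strip-endo : ∀ f → Endo m (strip m f)
  strip-endo f x x<m = ≤-<-trans (m⊓n≤n _ (m ∸ 1)) (pred< x<m)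
    where
    pred< : ∀ {m} → x < m → m ∸ 1 < m
    pred< {suc m} _ = ≤-refl

  count-framed : ∀ Q → Local m Q →
    countMaps n (λ f → framedᵇ c m f ∧ Q (strip m f)) ≡ countMaps m (λ g → good132ᵇ m g ∧ Q g)
  count-framed Q Q-local = countMaps-bij n m _ _ (strip m) frame framed-local good∧Q-local (strip-local m) frame-local to from
    where
    good∧Q-local : Local m (λ g → good132ᵇ m g ∧ Q g)
    good∧Q-local g g′ g<m g≗g′ = cong₂ _∧_ (good132-local m g g′ g<m g≗g′) (Q-local g g′ g<m g≗g′)
    framed-local : Local n (λ f → framedᵇ c m f ∧ Q (strip m f))
    framed-local f f′ f<n f≗f′ = cong₂ _∧_
      (cong₂ _∧_ (good132-local n f f′ f<n f≗f′) (cong₂ _∧_ (cong (_≡ᵇ c) (f≗f′ 0 z<s)) (cong (_≡ᵇ 0) (f≗f′ (suc m) (n<1+n (suc m))))))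
      (Q-local (strip m f) (strip m f′) (strip-endo f) (strip-local m f f′ f<n f≗f′))
    to : ∀ f → Endo n f → T (framedᵇ c m f ∧ Q (strip m f)) →
         Endo m (strip m f) × T (good132ᵇ m (strip m f) ∧ Q (strip m f)) × frame (strip m f) ≗[ n ] f
    to f f<n t with Equivalence.to T-∧ t
    ... | framed , Q-strip with Equivalence.to T-∧ framed
    ...   | good , ends with Equivalence.to (T-∧ {f 0 ≡ᵇ c}) ends | good132⁻ n f f<n good
    ...     | first≡ᵇc , last≡ᵇ0 | P , shallow , avoids = strip-endo f ,
      Equivalence.from T-∧ (good132⁺ m (strip m f) (strip-perm , Strip.shallow⇒strip m f P last≡0 m≤first shallow , strip-avoids avoids) , Q-strip) ,
      frame-strip
      where
      first≡c = ≡ᵇ⇒≡ _ _ first≡ᵇc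
      last≡0 = ≡ᵇ⇒≡ _ _ last≡ᵇ0
      m≤first = subst (m ≤_) (sym first≡c) m≤c
      open Framed f P first≡c last≡0
    from : ∀ g → Endo m g → T (good132ᵇ m g ∧ Q g) →
           Endo n (frame g) × T (framedᵇ c m (frame g) ∧ Q (strip m (frame g))) × strip m (frame g) ≗[ m ] g
    from g g<m t with Equivalence.to T-∧ t
    ... | good , Qg with good132⁻ m g g<m good
    ...   | P , shallow , avoids = proj₁ P′ ,
      Equivalence.from T-∧ (Equivalence.from T-∧ (good132⁺ n (frame g) (P′ , shallow′ , frame-avoids g P avoids) ,
                                                  Equivalence.from T-∧ (≡⇒≡ᵇ c c refl , ≡⇒≡ᵇ _ _ (frame-last g))) ,
                            subst T (Q-local g (strip m (frame g)) g<m (λ x x<m → sym (strip-frame g g<m x x<m))) Qg) ,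
      strip-frame g g<m
      where
      P′ = frame-perm g P
      shallow′ : Shallow n (frame g)
      shallow′ = Strip.strip⇒shallow m (frame g) P′ (frame-last g) m≤c
        (shallow-cong m g (strip m (frame g)) g<m (λ x x<m → sym (strip-frame g g<m x x<m)) shallow)

count-framed-top : ∀ m → countMaps (suc (suc m)) (framedᵇ (suc m) m) ≡ countMaps m (good132ᵇ m)
count-framed-top m = begin
  countMaps (suc (suc m)) (framedᵇ (suc m) m)                       ≡⟨ countMaps-cong (suc (suc m)) (framedᵇ (suc m) m) _ (λ f _ → sym (∧-identityʳ _)) ⟩
  countMaps (suc (suc m)) (λ f → framedᵇ (suc m) m f ∧ true)        ≡⟨ count-framed (λ _ → true) (λ _ _ _ _ → refl) ⟩
  countMaps m (λ g → good132ᵇ m g ∧ true)                           ≡⟨ countMaps-cong m _ (good132ᵇ m) (λ g _ → ∧-identityʳ _) ⟩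
  countMaps m (good132ᵇ m)                                          ∎
  where
  open ≡-Reasoning
  open Framing m (suc m) suc (n≤1+n m) ≤-refl 1+n≢0
    (λ u u<m → 1+n≢0 , s≤s (<⇒≤ u<m) , <⇒≢ (s<s u<m))
    (λ u u<m → m≤n⇒m⊓n≡m (∸-monoˡ-≤ 1 u<m))
    (λ v v≢0 v≤1+m v≢1+m → trans (cong suc (m≤n⇒m⊓n≡m (∸-monoˡ-≤ 1 (s≤s⁻¹ (<1+n∧≢⇒< (s≤s v≤1+m) v≢1+m)))))
                                 (suc-pred v ⦃ ≢-nonZero v≢0 ⦄))

-- Undoes the clamp of strip when f 0 = m.
lift : ℕ → ℕ → ℕ
lift m u = if u ≡ᵇ m ∸ 1 then suc m else suc u

module LiftFraming (m : ℕ) (1≤m : 1 ≤ m) where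

  lift-top : lift m (m ∸ 1) ≡ suc m
  lift-top rewrite ≡ᵇ-refl (m ∸ 1) = refl

  lift-other : ∀ u → u ≢ m ∸ 1 → lift m u ≡ suc u
  lift-other u u≢ rewrite ≡ᵇ-false u≢ = refl

  m⊓m∸1 : m ⊓ (m ∸ 1) ≡ m ∸ 1
  m⊓m∸1 = m≥n⇒m⊓n≡n (m∸n≤m m 1)

  range : ∀ u → u < m → lift m u ≢ 0 × lift m u ≤ suc m × lift m u ≢ m
  range u u<m with u ≟ m ∸ 1
  ... | yes refl = subst (_≢ 0) (sym lift-top) 1+n≢0 , ≤-reflexive lift-top , subst (_≢ m) (sym lift-top) (≢-sym (<⇒≢ ≤-refl))
  ... | no  u≢   = subst (_≢ 0) (sym (lift-other u u≢)) 1+n≢0 , subst (_≤ suc m) (sym (lift-other u u≢)) (s≤s (<⇒≤ u<m)) ,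
                   subst (_≢ m) (sym (lift-other u u≢)) (λ 1+u≡m → u≢ (cong (_∸ 1) 1+u≡m))

  strip∘lift : ∀ u → u < m → (lift m u ∸ 1) ⊓ (m ∸ 1) ≡ u
  strip∘lift u u<m with u ≟ m ∸ 1
  ... | yes refl rewrite lift-top = m⊓m∸1
  ... | no  u≢   rewrite lift-other u u≢ = m≤n⇒m⊓n≡m (∸-monoˡ-≤ 1 u<m)

  lift∘strip : ∀ v → v ≢ 0 → v ≤ suc m → v ≢ m → lift m ((v ∸ 1) ⊓ (m ∸ 1)) ≡ v
  lift∘strip v v≢0 v≤1+m v≢m with v ≟ suc m
  ... | yes refl rewrite m⊓m∸1 = lift-top
  ... | no  v≢1+m = trans (cong (lift m) (m≤n⇒m⊓n≡m (∸-monoˡ-≤ 1 (<⇒≤ v<m))))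
                          (trans (lift-other (v ∸ 1) (λ e → <-irrefl e (∸-monoˡ-< v<m (n≢0⇒n>0 v≢0)))) (suc-pred v ⦃ ≢-nonZero v≢0 ⦄))
    where
    v<m : v < m
    v<m = <1+n∧≢⇒< (<1+n∧≢⇒< (s≤s v≤1+m) v≢1+m) v≢m

  open Framing m m (lift m) ≤-refl (n≤1+n m) (λ m≡0 → <⇒≢ 1≤m (sym m≡0)) range strip∘lift lift∘strip public

count-max-inside : ∀ m a → suc (suc a) ≤ m → countMaps (suc (suc m)) (maxAtᵇ (suc (suc m)) (suc a)) ≡ countMaps m (maxAtᵇ m a)
count-max-inside m a a+2≤m = trans (countMaps-cong n _ _ same) (count-framed (λ g → g a ≡ᵇ m ∸ 1) (λ g g′ _ g≗g′ → cong (_≡ᵇ m ∸ 1) (g≗g′ a a<m)))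
  where
  n = suc (suc m)
  a<m : a < m
  a<m = <-trans (n<1+n a) a+2≤m
  open LiftFraming m (≤-trans (s≤s z≤n) a<m)
  same : ∀ f → Endo n f → maxAtᵇ n (suc a) f ≡ (framedᵇ m m f ∧ (strip m f a ≡ᵇ m ∸ 1))
  same f f<n = T⇔T⇒≡ to from
    where
    to : T (maxAtᵇ n (suc a) f) → T (framedᵇ m m f ∧ (strip m f a ≡ᵇ m ∸ 1))
    to t with good∧≡⁻ n f (suc a) (suc m) f<n t
    ... | good , fa≡1+m = Equivalence.from T-∧ (Equivalence.from T-∧ (good132⁺ n f good ,
          Equivalence.from T-∧ (≡⇒≡ᵇ _ _ first≡m , ≡⇒≡ᵇ _ _ last≡0)) , ≡⇒≡ᵇ _ _ strip-a)
      where
      first≡m = max-inside⇒first≡M∸1 (suc m) f good (suc a) (s≤s z≤n) (s≤s a+2≤m) fa≡1+m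
      last≡0 = max-inside⇒last≡0 (suc m) f good (suc a) (s≤s z≤n) (s<s a<m) fa≡1+m
      strip-a : strip m f a ≡ m ∸ 1
      strip-a = trans (cong (λ v → (v ∸ 1) ⊓ (m ∸ 1)) fa≡1+m) m⊓m∸1
    from : T (framedᵇ m m f ∧ (strip m f a ≡ᵇ m ∸ 1)) → T (maxAtᵇ n (suc a) f)
    from t with Equivalence.to T-∧ t
    ... | framed , strip-a with Equivalence.to T-∧ framed
    ...   | good , ends with Equivalence.to (T-∧ {f 0 ≡ᵇ m}) ends | good132⁻ n f f<n good
    ...     | first≡ᵇm , last≡ᵇ0 | G@(P , _ , _) = good∧≡⁺ n f (suc a) (suc m) G (begin
      f (suc a)                  ≡⟨ sym (frame-strip (suc a) (s<s (m<n⇒m<1+n a<m))) ⟩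
      frame (strip m f) (suc a)  ≡⟨ frame-middle (strip m f) a a<m ⟩
      lift m (strip m f a)       ≡⟨ cong (lift m) (≡ᵇ⇒≡ _ _ strip-a) ⟩
      lift m (m ∸ 1)             ≡⟨ lift-top ⟩
      suc m                      ∎)
      where
      open ≡-Reasoning
      open Framed f P (≡ᵇ⇒≡ _ _ first≡ᵇm) (≡ᵇ⇒≡ _ _ last≡ᵇ0)

-- The recurrence

count132 countEndsIn0 : ℕ → ℕ
count132 n     = countMaps n (good132ᵇ n)
countEndsIn0 n = countMaps n (endsIn0ᵇ n)

countMaxAt : ℕ → ℕ → ℕ
countMaxAt n a = countMaps n (maxAtᵇ n a)

unique-max-position : ∀ N f → Perm (suc N) f → count (suc N) (λ a → f a ≡ᵇ N) ≡ 1
unique-max-position N f P = trans (∑<-single (suc N) _ j j<n others) (cong ⟦_⟧ (trans (cong (_≡ᵇ N) fj≡N) (≡ᵇ-refl N)))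
  where
  open Inverse (suc N) f P
  j : ℕ
  j = f⁻¹ N
  j<n : j < suc N
  j<n = f⁻¹< N ≤-refl
  fj≡N : f j ≡ N
  fj≡N = f∘f⁻¹ N ≤-refl
  others : ∀ a → a < suc N → a ≢ j → ⟦ f a ≡ᵇ N ⟧ ≡ 0
  others a a<n a≢j = cong ⟦_⟧ (≡ᵇ-false (λ fa≡N → a≢j (proj₂ P a j a<n j<n (trans fa≡N (sym fj≡N)))))

count132-by-max : ∀ N → count132 (suc N) ≡ ∑[ a < suc N ] countMaxAt (suc N) a
count132-by-max N = countMaps-partition (suc N) (suc N) (good132ᵇ (suc N)) (λ a f → f a ≡ᵇ N)
  (λ f f<n good → unique-max-position N f (proj₁ (good132⁻ (suc N) f f<n good)))

countEndsIn0MaxAt : ℕ → ℕ → ℕ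
countEndsIn0MaxAt n a = countMaps n (λ f → endsIn0ᵇ n f ∧ (f a ≡ᵇ n ∸ 1))

endsIn0-max-first : ∀ m → countEndsIn0MaxAt (suc (suc m)) 0 ≡ countMaps (suc (suc m)) (framedᵇ (suc m) m)
endsIn0-max-first m = countMaps-cong (suc (suc m)) _ _ λ f _ →
  reorder (good132ᵇ (suc (suc m)) f) (f (suc m) ≡ᵇ 0) (f 0 ≡ᵇ suc m)
  where
  reorder : ∀ a b c → ((a ∧ b) ∧ c) ≡ (a ∧ (c ∧ b))
  reorder true  true  c = sym (∧-identityʳ c)
  reorder true  false c = sym (∧-zeroʳ c)
  reorder false b     c = refl

endsIn0-max-inside : ∀ m a → a < m → countEndsIn0MaxAt (suc (suc m)) (suc a) ≡ countMaxAt (suc (suc m)) (suc a)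
endsIn0-max-inside m a a<m = countMaps-cong n _ _ λ f f<n → T⇔T⇒≡ (to f) (from f f<n)
  where
  n = suc (suc m)
  to : ∀ f → T (endsIn0ᵇ n f ∧ (f (suc a) ≡ᵇ suc m)) → T (maxAtᵇ n (suc a) f)
  to f t with Equivalence.to (T-∧ {endsIn0ᵇ n f}) t
  ... | ends , fa≡ᵇ1+m = Equivalence.from T-∧ (proj₁ (Equivalence.to T-∧ ends) , fa≡ᵇ1+m)
  from : ∀ f → Endo n f → T (maxAtᵇ n (suc a) f) → T (endsIn0ᵇ n f ∧ (f (suc a) ≡ᵇ suc m))
  from f f<n t with good∧≡⁻ n f (suc a) (suc m) f<n t
  ... | good , fa≡1+m = Equivalence.from T-∧ (good∧≡⁺ n f (suc m) 0 good
                          (max-inside⇒last≡0 (suc m) f good (suc a) (s≤s z≤n) (s<s a<m) fa≡1+m) , ≡⇒≡ᵇ _ _ fa≡1+m)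

endsIn0-max-last : ∀ m → countEndsIn0MaxAt (suc (suc m)) (suc m) ≡ 0
endsIn0-max-last m = trans (countMaps-cong (suc (suc m)) _ _ (λ f _ → contradictory (good132ᵇ (suc (suc m)) f) (f (suc m))))
                           (countMaps-false (suc (suc m)))
  where
  contradictory : ∀ b v → ((b ∧ (v ≡ᵇ 0)) ∧ (v ≡ᵇ suc m)) ≡ false
  contradictory false v       = refl
  contradictory true  zero    = refl
  contradictory true  (suc v) = refl

countEndsIn0-by-max : ∀ m → countEndsIn0 (suc (suc m)) ≡
  countMaps (suc (suc m)) (framedᵇ (suc m) m) + ∑[ a < m ] countMaxAt (suc (suc m)) (suc a)
countEndsIn0-by-max m = begin
  countEndsIn0 n                                                  ≡⟨ countMaps-partition n n (endsIn0ᵇ n) (λ a f → f a ≡ᵇ suc m)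
                                                                       (λ f f<n t → unique-max-position (suc m) f (proj₁ (proj₁ (good∧≡⁻ n f (suc m) 0 f<n t)))) ⟩
  ∑[ a < n ] countEndsIn0MaxAt n a                                ≡⟨ cong (countEndsIn0MaxAt n 0 +_) (∑<-suc m _) ⟩
  countEndsIn0MaxAt n 0 + (∑[ a < m ] countEndsIn0MaxAt n (suc a) + countEndsIn0MaxAt n (suc m))
                                                                  ≡⟨ cong₂ (λ x y → x + (y + countEndsIn0MaxAt n (suc m))) (endsIn0-max-first m)
                                                                            (∑<-cong m (endsIn0-max-inside m)) ⟩
  framed + (inside + countEndsIn0MaxAt n (suc m))                 ≡⟨ cong (λ x → framed + (inside + x)) (endsIn0-max-last m) ⟩
  framed + (inside + 0)                                           ≡⟨ cong (framed +_) (+-identityʳ _) ⟩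
  framed + inside                                                 ∎
  where
  open ≡-Reasoning
  n = suc (suc m)
  framed = countMaps n (framedᵇ (suc m) m)
  inside = ∑[ a < m ] countMaxAt n (suc a)

countMaxInside : ℕ → ℕ
countMaxInside m = ∑[ a < m ] countMaxAt (suc (suc m)) (suc a)

countEndsIn0-step : ∀ m → countEndsIn0 (suc (suc m)) ≡ count132 m + countMaxInside m
countEndsIn0-step m = trans (countEndsIn0-by-max m) (cong (_+ countMaxInside m) (count-framed-top m))

count132-step : ∀ m → count132 (suc (suc m)) ≡ countEndsIn0 (suc (suc m)) + (countMaxInside m + count132 (suc m))
count132-step m = begin
  count132 n                                                    ≡⟨ count132-by-max (suc m) ⟩
  countMaxAt n 0 + ∑[ a < suc m ] countMaxAt n (suc a)          ≡⟨ cong (countMaxAt n 0 +_) (∑<-suc m _) ⟩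
  countMaxAt n 0 + (countMaxInside m + countMaxAt n (suc m))             ≡⟨ cong₂ (λ x y → x + (countMaxInside m + y))
                                                                             (count-max-first (suc m)) (count-max-last (suc m)) ⟩
  countEndsIn0 n + (countMaxInside m + count132 (suc m))                 ∎
  where
  open ≡-Reasoning
  n = suc (suc m)

countMaxInside-step : ∀ m → countMaxInside (suc m) + count132 m ≡ count132 (suc m) + countEndsIn0 (suc (suc m))
countMaxInside-step m = begin
  countMaxInside (suc m) + count132 m                                 ≡⟨ cong (_+ count132 m) (∑<-suc m _) ⟩
  ∑[ a < m ] countMaxAt (3 + m) (suc a) + countMaxAt (3 + m) (suc m) + count132 m
                                                                      ≡⟨ cong₂ (λ x y → x + y + count132 m)
                                                                           (∑<-cong m (λ a a<m → count-max-inside (suc m) a (s≤s a<m)))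
                                                                           (count-max-penultimate (suc m) (s≤s z≤n)) ⟩
  S + w + count132 m                                                  ≡⟨ xy∙z≈xz∙y S w _ ⟩
  S + count132 m + w                                                  ≡⟨ cong (λ x → S + x + w) (sym (count-max-last m)) ⟩
  S + countMaxAt (suc m) m + w                                        ≡⟨ cong (_+ w) (sym (trans (count132-by-max m) (∑<-suc m _))) ⟩
  count132 (suc m) + w                                                ∎
  where
  open ≡-Reasoning
  S w : ℕ
  S = ∑[ a < m ] countMaxAt (suc m) a
  w = countEndsIn0 (suc (suc m))

count132-recurrence : ∀ m → countEndsIn0 (suc (suc m)) ≡ count132 (suc m) →
                      count132 (suc (suc m)) + count132 m ≡ 3 * count132 (suc m)
count132-recurrence m w≡t₁ = begin
  count132 (suc (suc m)) + t₀           ≡⟨ cong (_+ t₀) (count132-step m) ⟩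
  w + (s + t₁) + t₀                     ≡⟨ regroup w s t₁ t₀ ⟩
  w + (t₀ + s) + t₁                     ≡⟨ cong₂ (λ x y → x + y + t₁) w≡t₁ (sym (countEndsIn0-step m)) ⟩
  t₁ + w + t₁                           ≡⟨ cong (λ x → t₁ + x + t₁) w≡t₁ ⟩
  t₁ + t₁ + t₁                          ≡⟨ triple t₁ ⟩
  3 * t₁                                ∎
  where
  open ≡-Reasoning
  t₀ = count132 m
  t₁ = count132 (suc m)
  w = countEndsIn0 (suc (suc m))
  s = countMaxInside m
  regroup : ∀ w s t₁ t₀ → w + (s + t₁) + t₀ ≡ w + (t₀ + s) + t₁
  regroup = solve-∀
  triple : ∀ t → t + t + t ≡ 3 * t
  triple = solve-∀

countEndsIn0≡count132 : ∀ m → countEndsIn0 (suc (suc m)) ≡ count132 (suc m)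
countEndsIn0≡count132 zero    = countEndsIn0-step 0
countEndsIn0≡count132 (suc m) = +-cancelʳ-≡ t₀ _ _ (begin
  countEndsIn0 (3 + m) + t₀              ≡⟨ cong (_+ t₀) (countEndsIn0-step (suc m)) ⟩
  t₁ + countMaxInside (suc m) + t₀       ≡⟨ +-assoc t₁ _ t₀ ⟩
  t₁ + (countMaxInside (suc m) + t₀)     ≡⟨ cong (t₁ +_) (countMaxInside-step m) ⟩
  t₁ + (t₁ + countEndsIn0 (2 + m))       ≡⟨ cong (λ x → t₁ + (t₁ + x)) IH ⟩
  t₁ + (t₁ + t₁)                         ≡⟨ triple t₁ ⟩
  3 * t₁                                 ≡⟨ sym (count132-recurrence m IH) ⟩
  count132 (2 + m) + t₀                  ∎)
  where
  open ≡-Reasoning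
  t₀ = count132 m
  t₁ = count132 (suc m)
  IH = countEndsIn0≡count132 m
  triple : ∀ t → t + (t + t) ≡ 3 * t
  triple = solve-∀

-- F₋₁ = 1 extends the odd-indexed Fibonacci numbers F₁, F₃, F₅, … one step back, matching count132 0 = 1.
fib-odd : ℕ → ℕ
fib-odd zero    = 1
fib-odd (suc k) = fib (suc (k + k))

fib-skip : ∀ j → fib (4 + j) + fib j ≡ 3 * fib (2 + j)
fib-skip j = identity (fib j) (fib (suc j))
  where
  identity : ∀ x y → ((y + x) + y) + (y + x) + x ≡ 3 * (y + x)
  identity = solve-∀

fib-odd-recurrence : ∀ k → fib-odd (suc (suc k)) + fib-odd k ≡ 3 * fib-odd (suc k)
fib-odd-recurrence zero    = refl
fib-odd-recurrence (suc k) = begin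
  fib (suc (suc (suc k) + suc (suc k))) + fib (suc (k + k))   ≡⟨ cong (λ i → fib i + fib (suc (k + k))) (index₁ k) ⟩
  fib (4 + suc (k + k)) + fib (suc (k + k))                   ≡⟨ fib-skip (suc (k + k)) ⟩
  3 * fib (2 + suc (k + k))                                   ≡⟨ cong (λ i → 3 * fib i) (index₂ k) ⟩
  3 * fib (suc (suc k + suc k))                               ∎
  where
  open ≡-Reasoning
  index₁ : ∀ k → suc (suc (suc k) + suc (suc k)) ≡ 4 + suc (k + k)
  index₁ = solve-∀
  index₂ : ∀ k → 2 + suc (k + k) ≡ suc (suc k + suc k)
  index₂ = solve-∀

count132≡fib-odd : ∀ m → count132 m ≡ fib-odd m
count132≡fib-odd zero          = refl
count132≡fib-odd (suc zero)    = refl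
count132≡fib-odd (suc (suc m)) = +-cancelʳ-≡ (count132 m) _ _ (begin
  count132 (suc (suc m)) + count132 m   ≡⟨ count132-recurrence m (countEndsIn0≡count132 m) ⟩
  3 * count132 (suc m)                  ≡⟨ cong (3 *_) (count132≡fib-odd (suc m)) ⟩
  3 * fib-odd (suc m)                   ≡⟨ sym (fib-odd-recurrence m) ⟩
  fib-odd (suc (suc m)) + fib-odd m     ≡⟨ cong (fib-odd (suc (suc m)) +_) (sym (count132≡fib-odd m)) ⟩
  fib-odd (suc (suc m)) + count132 m    ∎)
  where open ≡-Reasoning

2*[1+m]∸1≡1+m+m : ∀ m → 2 * suc m ∸ 1 ≡ suc (m + m)
2*[1+m]∸1≡1+m+m m = trans (cong (m +_) (+-identityʳ (suc m))) (+-suc m m)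

count132≡fib : ∀ m → count132 (suc m) ≡ fib (2 * suc m ∸ 1)
count132≡fib m = trans (count132≡fib-odd (suc m)) (cong fib (sym (2*[1+m]∸1≡1+m+m m)))

theorem3p1 : (n : ℕ) → n ≥ 1 → (σ : Vec ℕ 3) →
    (σ ≡ 1 ∷ 3 ∷ 2 ∷ [] ⊎ σ ≡ 2 ∷ 1 ∷ 3 ∷ []) →
    t n σ ≡ fib (2 * n ∸ 1)
theorem3p1 (suc m) _ σ (inj₁ refl) = trans (t≡countMaps (suc m) σ) (count132≡fib m)
theorem3p1 (suc m) _ σ (inj₂ refl) = trans (t≡countMaps (suc m) σ) (trans (count213≡count132 (suc m)) (count132≡fib m))
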